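{- Let $y_1,\dots,y_m.h(u_1,\dots,u_k)$ be a DHP and let $x_1,\dots,x_n.s_1,\dots,x_1,\dots,x_n.s_m$ be a DHP var-arg list, where each $y_j$ has the type of $s_j$. Then $x_1,\dots,x_n.h(u_1,\dots,u_k)\{y_1\mapsto s_1,\dots,y_m\mapsto s_m\}$ is a DHP.
   Context: Terms are simply-typed $\lambda$-terms in $\beta\eta$-long normal form. Types are sorts $a$ or $(\sigma_1,\dots,\sigma_n)\to a$. There are typed variables $\mathcal{V}$, infinitely many of each type, and typed function symbols $\mathcal{F}$. Terms are generated as follows. If $h\in\mathcal{F}\cup\mathcal{V}$ has type $(\sigma_1,\dots,\sigma_n)\to a$ and $t_i:\sigma_i$, then $h(t_1,\dots,t_n):a$. If $t:a$ and $x_i:\sigma_i$, then $x_1,\dots,x_n.t:(\sigma_1,\dots,\sigma_n)\to a$. Terms are taken modulo $\alpha$-renaming, and bound variables are distinct and never free. $\mathrm{fv}$ denotes free variables. $x{\downarrow}=y_1,\dots,y_n.x(y_1{\downarrow},\dots,y_n{\downarrow})$ is the $\eta$-expansion of $x:(\sigma_1,\dots,\sigma_n)\to a$. Subterms: $\vec x.h(s_1,\dots,s_m)\trianglerighteq t$ iff the two are equal or $\vec x.s_i\trianglerighteq t$ for some $i$, with binder prefixes concatenated. Substitution application is hereditary and capture-avoiding: - $x(\vec t)\theta=w\{\vec z\mapsto\vec t\theta\}$ if $\theta(x)=\vec z.w$; - $h(\vec t)\theta=h(\vec t\theta)$ if $h\notin\mathrm{dom}(\theta)$; - $(\vec x.t)\theta=\vec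 z.(t\{\vec x\mapsto\vec z\}\theta)$ for fresh $\vec z$. Expanded terms: $\vec x.s$ is expanded if it equals $\vec x,y_1,\dots,y_k.h(s_1,\dots,s_m,y_1{\downarrow},\dots,y_k{\downarrow})$ with $(\bigcup_i\mathrm{fv}(s_i)\cup\{h\})\cap\{\vec y\}=\varnothing$. Expanded subterms: for $\vec x=x_1,\dots,x_n$, a term $\vec x.s$, and an expanded term $\vec x.t=\vec x,y_1,\dots,y_k.h(t_1,\dots,t_m,\vec y{\downarrow})$, we write $\vec x.s\trianglerighteq_E\vec x.t$ iff there are $n'\ge n$ and terms $x_1,\dots,x_{n'}.t_{m+j}$ ($1\le j\le k$) with $\vec x.s\trianglerighteq x_1,\dots,x_{n'}.h(t_1,\dots,t_{m+k})$. DHP var-arg lists: a list $\vec x.t_1,\dots,\vec x.t_m$ is a DHP var-arg list if for all $1\le i\le m$: - (i) $\varnothing\ne\mathrm{fv}(t_i)\subseteq\{\vec x\}$; - (ii) $\vec x.t_i$ is expanded; - (iii) $\vec x.t_i\not\trianglerighteq_E\vec x.t_j$ for all $j\ne i$. A term $s$ is a DHP (deterministic higher-order pattern) if for every subterm $\vec x.y(t_1,\dots,t_m)$ of $s$ with $y\notin\{\vec x\}$, the list $\vec x.t_1,\dots,\vec x.t_m$ is a DHP var-arg list. -}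

module Defs where

open import Data.List using (List; []; _∷_; _++_)
open import Data.Nat using (ℕ; zero; suc)
open import Data.Product using (Σ; ∃; _×_; _,_)
open import Relation.Binary.PropositionalEquality using (_≡_; _≢_)
open import Relation.Nullary using (¬_)

-- Types.  A type is (σ₁,…,σₙ) → a with a a sort; a sort a is identified
-- with the type () → a  (n = 0).

data Ty (S : Set) : Set where
  _⇒_ : List (Ty S) → S → Ty S

infixr 5 _⇒_

Ctx : Set → Set
Ctx S = List (Ty S)

-- Typed de Bruijn variables (positions in a context).  α-equivalence,
-- freshness and capture avoidance are built in.

data Var {S : Set} : Ctx S → Ty S → Set where
  here  : ∀ {Γ σ}   → Var (σ ∷ Γ) σ
  there : ∀ {Γ σ τ} → Var Γ σ → Var (τ ∷ Γ) σ

index : ∀ {S} {Γ : Ctx S} {σ} → Var Γ σ → ℕ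
index here      = zero
index (there v) = suc (index v)

wkV : ∀ {S} {Γ : Ctx S} {σ} (σs : Ctx S) → Var Γ σ → Var (σs ++ Γ) σ
wkV []       v = v
wkV (_ ∷ σs) v = there (wkV σs v)

bvar : ∀ {S} {Γ : Ctx S} {σs : Ctx S} {σ} → Var σs σ → Var (σs ++ Γ) σ
bvar here      = here
bvar (there v) = there (bvar v)

liftR : ∀ {S} {Γ Δ : Ctx S} (σs : Ctx S) →
        (∀ {σ} → Var Γ σ → Var Δ σ) → ∀ {σ} → Var (σs ++ Γ) σ → Var (σs ++ Δ) σ
liftR []       ρ v         = ρ v
liftR (_ ∷ σs) ρ here      = here
liftR (_ ∷ σs) ρ (there v) = there (liftR σs ρ v)

-- Terms in βη-long normal form over sorts S and function symbols F
-- (F σ = the function symbols of type σ).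
--   Tm Γ σ : terms  x₁…xₙ.t  of type σ = (σ₁,…,σₙ) → a  (binders in front of Γ)
--   Nf Γ a : terms  h(t₁,…,tₘ)  of sort a
--   Args Γ σs : argument lists

module _ {S : Set} {F : Ty S → Set} where

  data Head (Γ : Ctx S) : Ty S → Set where
    var : ∀ {σ} → Var Γ σ → Head Γ σ
    fun : ∀ {σ} → F σ → Head Γ σ

  mutual
    data Tm (Γ : Ctx S) : Ty S → Set where
      lam : ∀ {σs a} → Nf (σs ++ Γ) a → Tm Γ (σs ⇒ a)

    data Nf (Γ : Ctx S) : S → Set where
      hd : ∀ {σs a} → Head Γ (σs ⇒ a) → Args Γ σs → Nf Γ a

    data Args (Γ : Ctx S) : List (Ty S) → Set where
      []  : Args Γ []
      _∷_ : ∀ {σ σs} → Tm Γ σ → Args Γ σs → Args Γ (σ ∷ σs)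

  infixr 5 _++A_
  _++A_ : ∀ {Γ ρs τs} → Args Γ ρs → Args Γ τs → Args Γ (ρs ++ τs)
  []       ++A us = us
  (t ∷ ts) ++A us = t ∷ (ts ++A us)

  _!_ : ∀ {Γ σs σ} → Args Γ σs → Var σs σ → Tm Γ σ
  (t ∷ ts) ! here    = t
  (t ∷ ts) ! there i = ts ! i

  Ren : Ctx S → Ctx S → Set
  Ren Γ Δ = ∀ {σ} → Var Γ σ → Var Δ σ

  renH : ∀ {Γ Δ σ} → Ren Γ Δ → Head Γ σ → Head Δ σ
  renH ρ (var v) = var (ρ v)
  renH ρ (fun f) = fun f

  mutual
    renT : ∀ {Γ Δ σ} → Ren Γ Δ → Tm Γ σ → Tm Δ σ
    renT ρ (lam {σs} w) = lam (renN (liftR σs ρ) w)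

    renN : ∀ {Γ Δ a} → Ren Γ Δ → Nf Γ a → Nf Δ a
    renN ρ (hd h ts) = hd (renH ρ h) (renA ρ ts)

    renA : ∀ {Γ Δ σs} → Ren Γ Δ → Args Γ σs → Args Δ σs
    renA ρ []       = []
    renA ρ (t ∷ ts) = renT ρ t ∷ renA ρ ts

  -- η-expansion  x↓ = y₁,…,yₙ.x(y₁↓,…,yₙ↓)

  mutual
    eta : ∀ {Γ} (σs : Ctx S) (a : S) → Var Γ (σs ⇒ a) → Tm Γ (σs ⇒ a)
    eta σs a x = lam (hd (var (wkV σs x)) (etas σs bvar))

    etas : ∀ {Γ} (τs : Ctx S) → (∀ {τ} → Var τs τ → Var Γ τ) → Args Γ τs
    etas []             f = []
    etas ((ρs ⇒ c) ∷ τs) f = eta ρs c (f here) ∷ etas τs (λ v → f (there v))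

  etaBinders : ∀ {Γ} (τs : Ctx S) → Args (τs ++ Γ) τs
  etaBinders τs = etas τs bvar

  -- Hereditary substitution of one variable of type τs ⇒ b.
  -- A substitution maps each variable either to a variable or (only at
  -- type τs ⇒ b) to a term.

  data Img (τs : Ctx S) (b : S) (Δ : Ctx S) : Ty S → Set where
    ivar : ∀ {σ} → Var Δ σ → Img τs b Δ σ
    itm  : Tm Δ (τs ⇒ b) → Img τs b Δ (τs ⇒ b)

  Sb : Ctx S → S → Ctx S → Ctx S → Set
  Sb τs b Γ Δ = ∀ {σ} → Var Γ σ → Img τs b Δ σ

  wkImg : ∀ {τs b Δ σ ρ} → Img τs b Δ σ → Img τs b (ρ ∷ Δ) σ
  wkImg (ivar v) = ivar (there v)
  wkImg (itm u)  = itm (renT there u)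

  liftS : ∀ {τs b Γ Δ} (σs : Ctx S) → Sb τs b Γ Δ → Sb τs b (σs ++ Γ) (σs ++ Δ)
  liftS []       θ v         = θ v
  liftS (_ ∷ σs) θ here      = ivar here
  liftS (_ ∷ σs) θ (there v) = wkImg (liftS σs θ v)

  sb1 : ∀ {ρs c Δ} → Tm Δ (ρs ⇒ c) → Sb ρs c ((ρs ⇒ c) ∷ Δ) Δ
  sb1 t here      = itm t
  sb1 t (there v) = ivar v

  mutual
    hsubN : ∀ {Γ Δ a} (τs : Ctx S) (b : S) → Sb τs b Γ Δ → Nf Γ a → Nf Δ a
    hsubN τs b θ (hd (fun f) ts) = hd (fun f) (hsubA τs b θ ts)
    hsubN τs b θ (hd (var v) ts) = hsubHd τs b θ (θ v) ts

    hsubHd : ∀ {Γ Δ σs a} (τs : Ctx S) (b : S) → Sb τs b Γ Δ →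
             Img τs b Δ (σs ⇒ a) → Args Γ σs → Nf Δ a
    hsubHd τs b θ (ivar v)      ts = hd (var v) (hsubA τs b θ ts)
    hsubHd τs b θ (itm (lam w)) ts = inst τs w (hsubA τs b θ ts)

    hsubT : ∀ {Γ Δ σ} (τs : Ctx S) (b : S) → Sb τs b Γ Δ → Tm Γ σ → Tm Δ σ
    hsubT τs b θ (lam {σs} w) = lam (hsubN τs b (liftS σs θ) w)

    hsubA : ∀ {Γ Δ σs} (τs : Ctx S) (b : S) → Sb τs b Γ Δ → Args Γ σs → Args Δ σs
    hsubA τs b θ []       = []
    hsubA τs b θ (t ∷ ts) = hsubT τs b θ t ∷ hsubA τs b θ ts

    -- inst τs w t⃗ = w{z⃗ ↦ t⃗} for the binders z⃗ : τs of w
    -- (the tᵢ do not contain the zⱼ, so substituting one binder at a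
    --  time coincides with simultaneous substitution)
    inst : ∀ {Δ a} (τs : Ctx S) → Nf (τs ++ Δ) a → Args Δ τs → Nf Δ a
    inst []              w []       = w
    inst ((ρs ⇒ c) ∷ τs) w (t ∷ ts) =
      inst τs (hsubN ρs c (sb1 (renT (wkV τs) t)) w) ts

  -- x⃗.( h(u⃗){y₁ ↦ s₁,…,yₘ ↦ sₘ} ) for the DHP y⃗.h(u⃗) (body w, in
  -- context Ys ++ Γ) and sⱼ in context Xs ++ Γ
  substBody : ∀ {Γ a} (Ys Xs : Ctx S) → Nf (Ys ++ Γ) a → Args (Xs ++ Γ) Ys →
              Tm Γ (Xs ⇒ a)
  substBody Ys Xs w ss = lam (inst Ys (renN (liftR Ys (wkV Xs)) w) ss)

  -- Binder prefixes: Ext Γ Δ records the binders passed on the way from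
  -- a term in context Γ (its free variables) to a subterm in context Δ.

  data Ext (Γ : Ctx S) : Ctx S → Set where
    stop  : Ext Γ Γ
    under : ∀ {Δ} (σs : Ctx S) → Ext (σs ++ Γ) Δ → Ext Γ Δ

  inj : ∀ {Γ Δ σ} → Ext Γ Δ → Var Γ σ → Var Δ σ
  inj stop         v = v
  inj (under σs e) v = inj e (wkV σs v)

  -- Subterms  x⃗.s ⊵ x⃗,z⃗.h(…)  (binder prefixes concatenated).
  -- SubT t e r : the term t (in context Γ) has the subterm whose binder
  -- prefix (beyond Γ) is e and whose body is r.

  mutual
    data SubT {Γ : Ctx S} : ∀ {σ} → Tm Γ σ → ∀ {Δ} → Ext Γ Δ → ∀ {b} → Nf Δ b → Set where
      lam : ∀ {σs a Δ b} {w : Nf (σs ++ Γ) a} {e : Ext (σs ++ Γ) Δ} {r : Nf Δ b} →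
            SubN w e r → SubT (lam {σs = σs} w) (under σs e) r

    data SubN {Γ : Ctx S} : ∀ {a} → Nf Γ a → ∀ {Δ} → Ext Γ Δ → ∀ {b} → Nf Δ b → Set where
      self : ∀ {a} {t : Nf Γ a} → SubN t stop t
      arg  : ∀ {σs a Δ b σ} {h : Head Γ (σs ⇒ a)} {ts : Args Γ σs}
               {e : Ext Γ Δ} {r : Nf Δ b} (i : Var σs σ) →
             SubT (ts ! i) e r → SubN (hd h ts) e r

  mutual
    data OccT {Γ : Ctx S} : ∀ {ρ} → Var Γ ρ → ∀ {σ} → Tm Γ σ → Set where
      lam : ∀ {ρ σs a} {v : Var Γ ρ} {w : Nf (σs ++ Γ) a} →
            OccN (wkV σs v) w → OccT v (lam {σs = σs} w)

    data OccN {Γ : Ctx S} : ∀ {ρ} → Var Γ ρ → ∀ {a} → Nf Γ a → Set where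
      head : ∀ {σs a} {v : Var Γ (σs ⇒ a)} {ts : Args Γ σs} →
             OccN v (hd (var v) ts)
      arg  : ∀ {ρ σs a σ} {v : Var Γ ρ} {h : Head Γ (σs ⇒ a)} {ts : Args Γ σs}
               (i : Var σs σ) → OccT v (ts ! i) → OccN v (hd h ts)

  -- Expanded terms.  x⃗.t (t in context Δ, x⃗ being part of Δ) is expanded
  -- with decomposition (h, s⃗) iff
  --   t = y₁,…,yₖ.h(s₁,…,sₘ,y₁↓,…,yₖ↓)
  -- where h and the sᵢ do not mention the yⱼ, i.e. are weakenings of a
  -- head / arguments living in Δ.

  ExpandedAs : ∀ {Δ τs b ρs} → Head Δ ((ρs ++ τs) ⇒ b) → Args Δ ρs →
               Tm Δ (τs ⇒ b) → Set
  ExpandedAs {τs = τs} h ss t =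
    t ≡ lam (hd (renH (wkV τs) h) (renA (wkV τs) ss ++A etaBinders τs))

  Expanded : ∀ {Δ σ} → Tm Δ σ → Set
  Expanded {Δ} {τs ⇒ b} t =
    Σ (Ctx S) λ ρs → Σ (Head Δ ((ρs ++ τs) ⇒ b)) λ h → Σ (Args Δ ρs) λ ss →
      ExpandedAs h ss t

  -- Expanded subterms:  x⃗.s ⊵_E x⃗.t  for an expanded  x⃗.t =
  -- x⃗,y⃗.h(t₁,…,tₘ,y⃗↓): there are n' ≥ n (a further prefix e) and terms
  -- t_{m+1},…,t_{m+k} with  x⃗.s ⊵ x₁…x_{n'}.h(t₁,…,t_{m+k}).
  _⊵E_ : ∀ {Δ σ τ} → Tm Δ σ → Tm Δ τ → Set
  _⊵E_ {Δ} {τ = τs ⇒ b} s t =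
    Σ (Ctx S) λ ρs → Σ (Head Δ ((ρs ++ τs) ⇒ b)) λ h → Σ (Args Δ ρs) λ ts →
      ExpandedAs h ts t ×
      Σ (Ctx S) λ Δ' → Σ (Ext Δ Δ') λ e → Σ (Args Δ' τs) λ rest →
        SubT s e (hd (renH (inj e) h) (renA (inj e) ts ++A rest))

  -- DHP var-arg lists.  The list x⃗.t₁,…,x⃗.tₘ: the tᵢ live in context Δ,
  -- which consists of the binders x⃗ (recorded by e) in front of the
  -- ambient free variables Γ.

  record DHPVarArgs {Γ Δ : Ctx S} (e : Ext Γ Δ) {σs : Ctx S} (ts : Args Δ σs) : Set where
    field
      fv-nonempty : ∀ {σ} (i : Var σs σ) → Σ (Ty S) λ ρ → Σ (Var Δ ρ) λ v → OccT v (ts ! i)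
      -- (i)  fv(tᵢ) ⊆ x⃗ : no variable outside the prefix occurs
      fv-bound    : ∀ {σ} (i : Var σs σ) {ρ} (y : Var Γ ρ) → ¬ OccT (inj e y) (ts ! i)
      expanded    : ∀ {σ} (i : Var σs σ) → Expanded (ts ! i)
      -- (iii) x⃗.tᵢ ⋭_E x⃗.tⱼ for j ≠ i
      no-emb      : ∀ {σ τ} (i : Var σs σ) (j : Var σs τ) → index i ≢ index j →
                    ¬ ((ts ! i) ⊵E (ts ! j))

  -- Deterministic higher-order patterns: for every subterm x⃗.y(t⃗) with y
  -- not among the binders x⃗ (i.e. y a free variable of the whole term),
  -- x⃗.t₁,…,x⃗.tₘ is a DHP var-arg list.

  DHP : ∀ {Γ σ} → Tm Γ σ → Set
  DHP {Γ} t =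
    ∀ {Δ} (e : Ext Γ Δ) {σs a} (y : Var Γ (σs ⇒ a)) (ts : Args Δ σs) →
    SubT t e (hd (var (inj e y)) ts) → DHPVarArgs e ts

-- Each sⱼ is expanded, sⱼ = x⃗,z⃗.Hⱼ(r⃗ⱼ,z⃗↓), so substituting it for yⱼ in yⱼ(t⃗) β-reduces in one step
-- to Hⱼ(r⃗ⱼ,t⃗′): the η-expanded binders are just replaced by the arguments. The substitution therefore
-- acts node by node on h(u⃗), and the DHP condition, a constraint on each node, is checked node by
-- node. A node yⱼ(t⃗) becomes Hⱼ(r⃗ⱼ,t⃗′), whose head is not free and whose r⃗ⱼ are closed, because sⱼ only mentions x⃗.
-- A node z(t⃗) with z free becomes z(t⃗′), and t⃗′ is again a DHP var-arg list: free variables are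
-- traced through the substitution in both directions, images of expanded terms are expanded, and an
-- expanded subterm x⃗.t′ᵢ ⊵_E x⃗.t′ⱼ reflects to x⃗.tᵢ ⊵_E x⃗.tⱼ. For the last point, no match starts
-- inside an argument of a substituted sₖ (of sₖ itself by size, of the others by (iii) for s⃗), and
-- no two substituted terms share a head with comparable argument prefixes, again by (iii); the latter
-- also makes the substitution injective, which reflects the equality of arguments.

module Submission where

open import Defs
open import Data.Empty using (⊥; ⊥-elim)
open import Data.List using ([]; _∷_; _++_)
open import Data.List.Properties using (++-assoc; ++-cancelˡ; ++-cancelʳ)
open import Data.Nat using (ℕ; zero; suc; _+_; _<_; _≤_; s≤s; _≟_)
open import Data.Nat.Properties using (≤-trans; m≤m+n; m≤n+m; <-irrefl; m≤n⇒m≤1+n; suc-injective)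
open import Data.Product using (Σ; _×_; _,_; proj₁; proj₂)
open import Data.Sum using (_⊎_; inj₁; inj₂; [_,_]′)
open import Data.Unit using (⊤; tt)
open import Relation.Binary.PropositionalEquality
open import Relation.Nullary using (¬_; yes; no)

-- Heterogeneous equality that, unlike _≅_, remembers the index: HE P x y yields i ≡ j.
data HE {I : Set} (P : I → Set) {i : I} (x : P i) : {j : I} → P j → Set where
  he : HE P x x

he-idx : ∀ {I} {P : I → Set} {i j} {x : P i} {y : P j} → HE P x y → i ≡ j
he-idx he = refl

he-≡ : ∀ {I} {P : I → Set} {i} {x y : P i} → HE P x y → x ≡ y
he-≡ he = refl

≡-he : ∀ {I} {P : I → Set} {i} {x y : P i} → x ≡ y → HE P x y
≡-he refl = he

he-sym : ∀ {I} {P : I → Set} {i j} {x : P i} {y : P j} → HE P x y → HE P y x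
he-sym he = he

he-trans : ∀ {I} {P : I → Set} {i j k} {x : P i} {y : P j} {z : P k} → HE P x y → HE P y z → HE P x z
he-trans he q = q

module _ {S : Set} {F : Ty S → Set} where

  -- Instances of the families of Defs at our F, which is not determined by their indices.
  Rn : Ctx S → Ctx S → Set
  Rn = Ren {F = F}

  TmF : Ctx S → Ty S → Set
  TmF = Tm {F = F}

  NfF : Ctx S → S → Set
  NfF = Nf {F = F}

  ArgsF : Ctx S → Ctx S → Set
  ArgsF = Args {F = F}

  HeadF : Ctx S → Ty S → Set
  HeadF = Head {F = F}

  ImgF : Ctx S → S → Ctx S → Ty S → Set
  ImgF = Img {F = F}

  SbF : Ctx S → S → Ctx S → Ctx S → Set
  SbF = Sb {F = F}

  ExtF : Ctx S → Ctx S → Set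
  ExtF = Ext {F = F}

  subst-HE : ∀ {Δ b} {L1 L2 : Ctx S} (eq : L1 ≡ L2) (h : HeadF Δ (L1 ⇒ b)) →
             HE (HeadF Δ) (subst (λ L → HeadF Δ (L ⇒ b)) eq h) h
  subst-HE refl h = he

  hd-inj : ∀ {Γ a L1 L2} {h1 : HeadF Γ (L1 ⇒ a)} {h2 : HeadF Γ (L2 ⇒ a)}
             {as1 : ArgsF Γ L1} {as2 : ArgsF Γ L2} →
           hd h1 as1 ≡ hd h2 as2 → HE (HeadF Γ) h1 h2 × HE (ArgsF Γ) as1 as2
  hd-inj refl = he , he

  hd-cong-HE : ∀ {Γ a L1 L2} {h1 : HeadF Γ (L1 ⇒ a)} {h2 : HeadF Γ (L2 ⇒ a)}
                 {as1 : ArgsF Γ L1} {as2 : ArgsF Γ L2} →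
               HE (HeadF Γ) h1 h2 → HE (ArgsF Γ) as1 as2 → hd h1 as1 ≡ hd h2 as2
  hd-cong-HE he he = refl

  lam-inj : ∀ {Γ σs a} {w1 w2 : NfF (σs ++ Γ) a} → lam {σs = σs} w1 ≡ lam w2 → w1 ≡ w2
  lam-inj refl = refl

  ∷-inj-HE : ∀ {Γ σ1 σ2 L1 L2} {x : TmF Γ σ1} {y : TmF Γ σ2} {X : ArgsF Γ L1} {Y : ArgsF Γ L2} →
             HE (ArgsF Γ) (x ∷ X) (y ∷ Y) → HE (TmF Γ) x y × HE (ArgsF Γ) X Y
  ∷-inj-HE he = he , he

  ∷-cong-HE : ∀ {Γ σ1 σ2 L1 L2} {x : TmF Γ σ1} {y : TmF Γ σ2} {X : ArgsF Γ L1} {Y : ArgsF Γ L2} →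
              HE (TmF Γ) x y → HE (ArgsF Γ) X Y → HE (ArgsF Γ) (x ∷ X) (y ∷ Y)
  ∷-cong-HE he he = he

  ++A-assoc : ∀ {Γ L M N} (X : ArgsF Γ L) (Y : ArgsF Γ M) (Z : ArgsF Γ N) →
              HE (ArgsF Γ) ((X ++A Y) ++A Z) (X ++A (Y ++A Z))
  ++A-assoc [] Y Z = he
  ++A-assoc (x ∷ X) Y Z = ∷-cong-HE he (++A-assoc X Y Z)

  ++A-cancelˡ : ∀ {Γ L M1 M2} (X : ArgsF Γ L) {Y1 : ArgsF Γ M1} {Y2 : ArgsF Γ M2} →
                HE (ArgsF Γ) (X ++A Y1) (X ++A Y2) → HE (ArgsF Γ) Y1 Y2
  ++A-cancelˡ [] e = e
  ++A-cancelˡ (x ∷ X) e = ++A-cancelˡ X (proj₂ (∷-inj-HE e))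

  ++A-cancelʳ≡ : ∀ {Γ L M} (X1 X2 : ArgsF Γ L) (E : ArgsF Γ M) → X1 ++A E ≡ X2 ++A E → X1 ≡ X2
  ++A-cancelʳ≡ [] [] E e = refl
  ++A-cancelʳ≡ (x ∷ X1) (y ∷ X2) E e with ∷-inj-HE (≡-he e)
  ... | p , q = cong₂ _∷_ (he-≡ p) (++A-cancelʳ≡ X1 X2 E (he-≡ q))

  ++A-cancelʳ : ∀ {Γ L1 L2 M} {X1 : ArgsF Γ L1} {X2 : ArgsF Γ L2} (E : ArgsF Γ M) →
                HE (ArgsF Γ) (X1 ++A E) (X2 ++A E) → HE (ArgsF Γ) X1 X2
  ++A-cancelʳ {L1 = L1} {L2} {M} {X1} {X2} E e with ++-cancelʳ M L1 L2 (he-idx e)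
  ... | refl = ≡-he (++A-cancelʳ≡ X1 X2 E (he-≡ e))

  ArgsΣ : Ctx S → Set
  ArgsΣ Γ = Σ (Ctx S) (ArgsF Γ)

  ++A-compare : ∀ {Γ L1 L2 M1 M2} (X1 : ArgsF Γ L1) (X2 : ArgsF Γ L2) {Y1 : ArgsF Γ M1} {Y2 : ArgsF Γ M2} →
                HE (ArgsF Γ) (X1 ++A Y1) (X2 ++A Y2) →
                (Σ (ArgsΣ Γ) λ Z → HE (ArgsF Γ) X2 (X1 ++A proj₂ Z)) ⊎
                (Σ (ArgsΣ Γ) λ Z → HE (ArgsF Γ) X1 (X2 ++A proj₂ Z))
  ++A-compare [] X2 e = inj₁ ((_ , X2) , he)
  ++A-compare (x ∷ X1) [] e = inj₂ ((_ , x ∷ X1) , he)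
  ++A-compare (x ∷ X1) (y ∷ X2) e with ∷-inj-HE e
  ... | p , q with ++A-compare X1 X2 q
  ... | inj₁ (Z , r) = inj₁ (Z , ∷-cong-HE (he-sym p) r)
  ... | inj₂ (Z , r) = inj₂ (Z , ∷-cong-HE p r)

  ++A-!-bvar : ∀ {Γ L M σ} (X : ArgsF Γ L) (Y : ArgsF Γ M) (k : Var L σ) → (X ++A Y) ! bvar k ≡ X ! k
  ++A-!-bvar (x ∷ X) Y here = refl
  ++A-!-bvar (x ∷ X) Y (there k) = ++A-!-bvar X Y k

  ++A-!-wkV : ∀ {Γ L M σ} (X : ArgsF Γ L) (Y : ArgsF Γ M) (k : Var M σ) → (X ++A Y) ! wkV L k ≡ Y ! k
  ++A-!-wkV [] Y k = refl
  ++A-!-wkV (x ∷ X) Y k = ++A-!-wkV X Y k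

  renA-! : ∀ {Γ Δ L σ} (ρ : Rn Γ Δ) (as : ArgsF Γ L) (i : Var L σ) → renA ρ as ! i ≡ renT ρ (as ! i)
  renA-! ρ (a ∷ as) here = refl
  renA-! ρ (a ∷ as) (there i) = renA-! ρ as i

  ++A-prefix-! : ∀ {Γ LA LX LR σ} {A : ArgsF Γ LA} (X : ArgsF Γ LX) (R : ArgsF Γ LR) →
                 HE (ArgsF Γ) A (X ++A R) → (k : Var LX σ) → Σ (Var LA σ) λ i → A ! i ≡ X ! k
  ++A-prefix-! X R he k = bvar k , ++A-!-bvar X R k

  there-inj : ∀ {Γ : Ctx S} {σ τ} {u1 u2 : Var Γ σ} → there {τ = τ} u1 ≡ there u2 → u1 ≡ u2
  there-inj refl = refl

  wkV-inj : ∀ {Γ : Ctx S} σs {σ} {u1 u2 : Var Γ σ} → wkV σs u1 ≡ wkV σs u2 → u1 ≡ u2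
  wkV-inj [] e = e
  wkV-inj (_ ∷ σs) e = wkV-inj σs (there-inj e)

  bvar≢wkV : ∀ {Γ : Ctx S} σs {σ} (k : Var σs σ) (u : Var Γ σ) → bvar k ≡ wkV σs u → ⊥
  bvar≢wkV (_ ∷ σs) here u ()
  bvar≢wkV (_ ∷ σs) (there k) u e = bvar≢wkV σs k u (there-inj e)

  bvar-inj : ∀ {Γ : Ctx S} σs {σ} {k1 k2 : Var σs σ} → bvar {Γ = Γ} k1 ≡ bvar k2 → k1 ≡ k2
  bvar-inj (_ ∷ σs) {k1 = here} {here} e = refl
  bvar-inj (_ ∷ σs) {k1 = here} {there k2} ()
  bvar-inj (_ ∷ σs) {k1 = there k1} {here} ()
  bvar-inj (_ ∷ σs) {k1 = there k1} {there k2} e = cong there (bvar-inj σs (there-inj e))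

  index-inj-HE : ∀ {Γ : Ctx S} {σ1 σ2} (v1 : Var Γ σ1) (v2 : Var Γ σ2) → index v1 ≡ index v2 → HE (Var Γ) v1 v2
  index-inj-HE here here e = he
  index-inj-HE (there v1) (there v2) e with index-inj-HE v1 v2 (suc-injective e)
  ... | he = he
  index-inj-HE here (there v2) ()
  index-inj-HE (there v1) here ()

  InjectiveRen : ∀ {Γ Δ : Ctx S} → Rn Γ Δ → Set
  InjectiveRen {Γ} ρ = ∀ {σ} {x y : Var Γ σ} → ρ x ≡ ρ y → x ≡ y

  liftR-inj : ∀ {Γ Δ : Ctx S} σs (ρ : Rn Γ Δ) → InjectiveRen ρ → InjectiveRen (liftR σs ρ)
  liftR-inj [] ρ i e = i e
  liftR-inj (_ ∷ σs) ρ i {x = here} {here} e = refl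
  liftR-inj (_ ∷ σs) ρ i {x = here} {there y} ()
  liftR-inj (_ ∷ σs) ρ i {x = there x} {here} ()
  liftR-inj (_ ∷ σs) ρ i {x = there x} {there y} e = cong there (liftR-inj σs ρ i (there-inj e))

  ren-inj-HE : ∀ {Γ' Δ'} (ρ : Rn Γ' Δ') → InjectiveRen ρ → ∀ {σ1 σ2} {x : Var Γ' σ1} {y : Var Γ' σ2} →
               HE (Var Δ') (ρ x) (ρ y) → HE (Var Γ') x y
  ren-inj-HE ρ i q with he-idx q
  ... | refl = ≡-he (i (he-≡ q))

  extend : ∀ {Γ0 Δ : Ctx S} → ExtF Γ0 Δ → (σs : Ctx S) → ExtF Γ0 (σs ++ Δ)
  extend stop σs = under σs stop
  extend (under τs e) σs = under τs (extend e σs)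

  _⊕_ : ∀ {A B C : Ctx S} → ExtF A B → ExtF B C → ExtF A C
  stop ⊕ e = e
  under σs e1 ⊕ e = under σs (e1 ⊕ e)

  ⊕-stop : ∀ {A B : Ctx S} (e : ExtF A B) → e ⊕ stop ≡ e
  ⊕-stop stop = refl
  ⊕-stop (under σs e) = cong (under σs) (⊕-stop e)

  extend-⊕ : ∀ {A B C : Ctx S} (e : ExtF A B) σs (e' : ExtF (σs ++ B) C) → extend e σs ⊕ e' ≡ e ⊕ under σs e'
  extend-⊕ stop σs e' = refl
  extend-⊕ (under τs e) σs e' = cong (under τs) (extend-⊕ e σs e')

  inj-extend : ∀ {A B : Ctx S} (e : ExtF A B) σs {σ} (v : Var A σ) → inj (extend e σs) v ≡ wkV σs (inj e v)
  inj-extend stop σs v = refl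
  inj-extend (under τs e) σs v = inj-extend e σs (wkV τs v)

  inj-inj : ∀ {A B : Ctx S} (e : ExtF A B) → InjectiveRen (inj e)
  inj-inj stop eq = eq
  inj-inj (under σs e) eq = wkV-inj σs (inj-inj e eq)

  data BinderView {Γ : Ctx S} (ρs : Ctx S) {σ} : Var (ρs ++ Γ) σ → Set where
    binder : (k : Var ρs σ) → BinderView ρs (bvar k)
    outer : (u : Var Γ σ) → BinderView ρs (wkV ρs u)

  binderView : ∀ {Γ : Ctx S} ρs {σ} (v : Var (ρs ++ Γ) σ) → BinderView ρs v
  binderView [] v = outer v
  binderView (_ ∷ ρs) here = binder here
  binderView (_ ∷ ρs) (there v) with binderView ρs v
  ... | binder k = binder (there k)
  ... | outer u = outer u

  liftR-ext : ∀ {Γ Δ : Ctx S} σs {ρ ρ' : Rn Γ Δ} → (∀ {σ} (v : Var Γ σ) → ρ v ≡ ρ' v) →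
              ∀ {σ} (v : Var (σs ++ Γ) σ) → liftR σs ρ v ≡ liftR σs ρ' v
  liftR-ext [] e v = e v
  liftR-ext (_ ∷ σs) e here = refl
  liftR-ext (_ ∷ σs) e (there v) = cong there (liftR-ext σs e v)

  renH-ext : ∀ {Γ Δ σ} {ρ ρ' : Rn Γ Δ} → (∀ {σ} (v : Var Γ σ) → ρ v ≡ ρ' v) →
             (h : HeadF Γ σ) → renH ρ h ≡ renH ρ' h
  renH-ext e (var v) = cong var (e v)
  renH-ext e (fun f) = refl

  mutual
    renT-ext : ∀ {Γ Δ σ} {ρ ρ' : Rn Γ Δ} → (∀ {σ} (v : Var Γ σ) → ρ v ≡ ρ' v) →
               (t : TmF Γ σ) → renT ρ t ≡ renT ρ' t
    renT-ext e (lam {σs} w) = cong lam (renN-ext (liftR-ext σs e) w)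

    renN-ext : ∀ {Γ Δ a} {ρ ρ' : Rn Γ Δ} → (∀ {σ} (v : Var Γ σ) → ρ v ≡ ρ' v) →
               (t : NfF Γ a) → renN ρ t ≡ renN ρ' t
    renN-ext e (hd h ts) = cong₂ hd (renH-ext e h) (renA-ext e ts)

    renA-ext : ∀ {Γ Δ σs} {ρ ρ' : Rn Γ Δ} → (∀ {σ} (v : Var Γ σ) → ρ v ≡ ρ' v) →
               (ts : ArgsF Γ σs) → renA ρ ts ≡ renA ρ' ts
    renA-ext e [] = refl
    renA-ext e (t ∷ ts) = cong₂ _∷_ (renT-ext e t) (renA-ext e ts)

  liftR-comp : ∀ {Γ Δ Θ : Ctx S} σs (ρ1 : Rn Δ Θ) (ρ2 : Rn Γ Δ) →
               ∀ {σ} (v : Var (σs ++ Γ) σ) →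
               liftR σs ρ1 (liftR σs ρ2 v) ≡ liftR σs (λ x → ρ1 (ρ2 x)) v
  liftR-comp [] ρ1 ρ2 v = refl
  liftR-comp (_ ∷ σs) ρ1 ρ2 here = refl
  liftR-comp (_ ∷ σs) ρ1 ρ2 (there v) = cong there (liftR-comp σs ρ1 ρ2 v)

  mutual
    renT-comp : ∀ {Γ Δ Θ σ} (ρ1 : Rn Δ Θ) (ρ2 : Rn Γ Δ) (t : TmF Γ σ) →
                renT ρ1 (renT ρ2 t) ≡ renT (λ x → ρ1 (ρ2 x)) t
    renT-comp ρ1 ρ2 (lam {σs} w) =
      cong lam (trans (renN-comp (liftR σs ρ1) (liftR σs ρ2) w)
                      (renN-ext (liftR-comp σs ρ1 ρ2) w))

    renN-comp : ∀ {Γ Δ Θ a} (ρ1 : Rn Δ Θ) (ρ2 : Rn Γ Δ) (t : NfF Γ a) →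
                renN ρ1 (renN ρ2 t) ≡ renN (λ x → ρ1 (ρ2 x)) t
    renN-comp ρ1 ρ2 (hd (var v) ts) = cong (hd (var (ρ1 (ρ2 v)))) (renA-comp ρ1 ρ2 ts)
    renN-comp ρ1 ρ2 (hd (fun f) ts) = cong (hd (fun f)) (renA-comp ρ1 ρ2 ts)

    renA-comp : ∀ {Γ Δ Θ σs} (ρ1 : Rn Δ Θ) (ρ2 : Rn Γ Δ) (ts : ArgsF Γ σs) →
                renA ρ1 (renA ρ2 ts) ≡ renA (λ x → ρ1 (ρ2 x)) ts
    renA-comp ρ1 ρ2 [] = refl
    renA-comp ρ1 ρ2 (t ∷ ts) = cong₂ _∷_ (renT-comp ρ1 ρ2 t) (renA-comp ρ1 ρ2 ts)

  liftR-id : ∀ {Γ : Ctx S} σs {σ} (v : Var (σs ++ Γ) σ) → liftR σs (λ x → x) v ≡ v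
  liftR-id [] v = refl
  liftR-id (_ ∷ σs) here = refl
  liftR-id (_ ∷ σs) (there v) = cong there (liftR-id σs v)

  renH-id : ∀ {Γ σ} (h : HeadF Γ σ) → renH (λ x → x) h ≡ h
  renH-id (var v) = refl
  renH-id (fun f) = refl

  mutual
    renT-id : ∀ {Γ σ} (t : TmF Γ σ) → renT (λ x → x) t ≡ t
    renT-id (lam {σs} w) = cong lam (trans (renN-ext (liftR-id σs) w) (renN-id w))

    renN-id : ∀ {Γ a} (t : NfF Γ a) → renN (λ x → x) t ≡ t
    renN-id (hd h ts) = cong₂ hd (renH-id h) (renA-id ts)

    renA-id : ∀ {Γ σs} (ts : ArgsF Γ σs) → renA (λ x → x) ts ≡ ts
    renA-id [] = refl
    renA-id (t ∷ ts) = cong₂ _∷_ (renT-id t) (renA-id ts)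

  liftR-wkV : ∀ {Γ Δ : Ctx S} σs (ρ : Rn Γ Δ) {σ} (v : Var Γ σ) → liftR σs ρ (wkV σs v) ≡ wkV σs (ρ v)
  liftR-wkV [] ρ v = refl
  liftR-wkV (_ ∷ σs) ρ v = cong there (liftR-wkV σs ρ v)

  liftR-bvar : ∀ {Γ Δ : Ctx S} σs (ρ : Rn Γ Δ) {σ} (v : Var σs σ) → liftR σs ρ (bvar v) ≡ bvar v
  liftR-bvar (_ ∷ σs) ρ here = refl
  liftR-bvar (_ ∷ σs) ρ (there v) = cong there (liftR-bvar σs ρ v)

  renA-++ : ∀ {Γ Δ ρs τs} (ρ : Rn Γ Δ) (as : ArgsF Γ ρs) (bs : ArgsF Γ τs) →
            renA ρ (as ++A bs) ≡ renA ρ as ++A renA ρ bs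
  renA-++ ρ [] bs = refl
  renA-++ ρ (a ∷ as) bs = cong (renT ρ a ∷_) (renA-++ ρ as bs)

  etas-ext : ∀ {Γ} τs (f g : Rn τs Γ) → (∀ {σ} (v : Var τs σ) → f v ≡ g v) →
             etas {F = F} τs f ≡ etas τs g
  etas-ext [] f g e = refl
  etas-ext ((ρs ⇒ c) ∷ τs) f g e =
    cong₂ _∷_ (cong (eta ρs c) (e here)) (etas-ext τs _ _ (λ v → e (there v)))

  mutual
    eta-ren : ∀ {Γ Δ} σs a (x : Var Γ (σs ⇒ a)) (ρ : Rn Γ Δ) →
              renT ρ (eta {F = F} σs a x) ≡ eta σs a (ρ x)
    eta-ren σs a x ρ =
      cong lam (cong₂ hd (cong var (liftR-wkV σs ρ x))
                 (trans (etas-ren σs bvar (liftR σs ρ))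
                        (etas-ext σs _ _ (λ v → liftR-bvar σs ρ v))))

    etas-ren : ∀ {Γ Δ} τs (f : Rn τs Γ) (ρ : Rn Γ Δ) →
               renA ρ (etas {F = F} τs f) ≡ etas τs (λ v → ρ (f v))
    etas-ren [] f ρ = refl
    etas-ren ((ρs ⇒ c) ∷ τs) f ρ =
      cong₂ _∷_ (eta-ren ρs c (f here) ρ) (etas-ren τs (λ v → f (there v)) ρ)

  renH-comp : ∀ {Γ Δ Θ σ} (ρ1 : Rn Δ Θ) (ρ2 : Rn Γ Δ) (h : HeadF Γ σ) →
              renH ρ1 (renH ρ2 h) ≡ renH (λ x → ρ1 (ρ2 x)) h
  renH-comp ρ1 ρ2 (var v) = refl
  renH-comp ρ1 ρ2 (fun f) = refl

  ⇒-injˡ : ∀ {L1 L2 : Ctx S} {a1 a2 : S} → (L1 ⇒ a1) ≡ (L2 ⇒ a2) → L1 ≡ L2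
  ⇒-injˡ refl = refl

  ⇒-injʳ : ∀ {L1 L2 : Ctx S} {a1 a2 : S} → (L1 ⇒ a1) ≡ (L2 ⇒ a2) → a1 ≡ a2
  ⇒-injʳ refl = refl

  var-inj : ∀ {Γ σ} {x y : Var Γ σ} → var {F = F} x ≡ var y → x ≡ y
  var-inj refl = refl

  renH-inj : ∀ {Γ Δ σ} (ρ : Rn Γ Δ) → InjectiveRen ρ → (h1 h2 : HeadF Γ σ) → renH ρ h1 ≡ renH ρ h2 → h1 ≡ h2
  renH-inj ρ i (var x) (var y) e = cong var (i (var-inj e))
  renH-inj ρ i (var x) (fun f) ()
  renH-inj ρ i (fun f) (var y) ()
  renH-inj ρ i (fun f) (fun g) refl = refl

  mutual
    renT-inj : ∀ {Γ Δ σ} (ρ : Rn Γ Δ) → InjectiveRen ρ → (t1 t2 : TmF Γ σ) → renT ρ t1 ≡ renT ρ t2 → t1 ≡ t2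
    renT-inj ρ i (lam {σs} w1) (lam w2) e = cong lam (renN-inj (liftR σs ρ) (liftR-inj σs ρ i) w1 w2 (lam-inj e))

    renN-inj : ∀ {Γ Δ a} (ρ : Rn Γ Δ) → InjectiveRen ρ → (n1 n2 : NfF Γ a) → renN ρ n1 ≡ renN ρ n2 → n1 ≡ n2
    renN-inj ρ i (hd h1 as1) (hd h2 as2) e with hd-inj e
    ... | q1 , q2 with he-idx q2
    ... | refl = cong₂ hd (renH-inj ρ i h1 h2 (he-≡ q1)) (renA-inj ρ i as1 as2 (he-≡ q2))

    renA-inj : ∀ {Γ Δ L} (ρ : Rn Γ Δ) → InjectiveRen ρ → (as1 as2 : ArgsF Γ L) → renA ρ as1 ≡ renA ρ as2 → as1 ≡ as2
    renA-inj ρ i [] [] e = refl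
    renA-inj ρ i (t1 ∷ as1) (t2 ∷ as2) e with ∷-inj-HE (≡-he e)
    ... | p , q = cong₂ _∷_ (renT-inj ρ i t1 t2 (he-≡ p)) (renA-inj ρ i as1 as2 (he-≡ q))

  renH-injHE : ∀ {Γ Δ σ1 σ2} (ρ : Rn Γ Δ) → InjectiveRen ρ → {h1 : HeadF Γ σ1} {h2 : HeadF Γ σ2} →
               HE (HeadF Δ) (renH ρ h1) (renH ρ h2) → HE (HeadF Γ) h1 h2
  renH-injHE ρ i {h1} {h2} q with he-idx q
  ... | refl = ≡-he (renH-inj ρ i h1 h2 (he-≡ q))

  renT-injHE : ∀ {Γ Δ σ1 σ2} (ρ : Rn Γ Δ) → InjectiveRen ρ → {t1 : TmF Γ σ1} {t2 : TmF Γ σ2} →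
               HE (TmF Δ) (renT ρ t1) (renT ρ t2) → HE (TmF Γ) t1 t2
  renT-injHE ρ i {t1} {t2} q with he-idx q
  ... | refl = ≡-he (renT-inj ρ i t1 t2 (he-≡ q))

  renH-cong-HE : ∀ {Γ Δ σ1 σ2} (ρ : Rn Γ Δ) {h1 : HeadF Γ σ1} {h2 : HeadF Γ σ2} →
                 HE (HeadF Γ) h1 h2 → HE (HeadF Δ) (renH ρ h1) (renH ρ h2)
  renH-cong-HE ρ he = he

  unren-prefix : ∀ {Γ Δ L LX LR} (ρ : Rn Γ Δ) → InjectiveRen ρ → (as : ArgsF Γ L) (X : ArgsF Γ LX) {R : ArgsF Δ LR} →
                 HE (ArgsF Δ) (renA ρ as) (renA ρ X ++A R) → Σ (ArgsΣ Γ) λ R' → HE (ArgsF Γ) as (X ++A proj₂ R')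
  unren-prefix ρ i as [] q = (_ , as) , he
  unren-prefix ρ i [] (x ∷ X) q with he-idx q
  ... | ()
  unren-prefix ρ i (a ∷ as) (x ∷ X) q with ∷-inj-HE q
  ... | p1 , p2 with unren-prefix ρ i as X p2
  ... | R' , r = R' , ∷-cong-HE (renT-injHE ρ i p1) r

  -- Hereditary substitution of η-expanded variables

  wkImgs : ∀ {τs b Δ σ} σs → ImgF τs b Δ σ → ImgF τs b (σs ++ Δ) σ
  wkImgs [] i = i
  wkImgs (_ ∷ σs) i = wkImg (wkImgs σs i)

  liftS-wkV : ∀ {τs b Γ Δ} σs (θ : SbF τs b Γ Δ) {σ} (v : Var Γ σ) →
              liftS σs θ (wkV σs v) ≡ wkImgs σs (θ v)
  liftS-wkV [] θ v = refl
  liftS-wkV (_ ∷ σs) θ v = cong wkImg (liftS-wkV σs θ v)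

  wkImgs-ivar : ∀ {τs b Δ σ} σs (u : Var Δ σ) → wkImgs {τs = τs} {b} σs (ivar {F = F} u) ≡ ivar (wkV σs u)
  wkImgs-ivar [] u = refl
  wkImgs-ivar (_ ∷ σs) u = cong wkImg (wkImgs-ivar σs u)

  wkImgs-itm : ∀ {τs b Δ} σs (t : TmF Δ (τs ⇒ b)) → wkImgs σs (itm t) ≡ itm (renT (wkV σs) t)
  wkImgs-itm [] t = cong itm (sym (renT-id t))
  wkImgs-itm (_ ∷ σs) t = trans (cong wkImg (wkImgs-itm σs t)) (cong itm (renT-comp there (wkV σs) t))

  liftS-bvar : ∀ {τs b Γ Δ} σs (θ : SbF τs b Γ Δ) {σ} (v : Var σs σ) →
               liftS σs θ (bvar v) ≡ ivar (bvar v)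
  liftS-bvar (_ ∷ σs) θ here = refl
  liftS-bvar (_ ∷ σs) θ (there v) = cong wkImg (liftS-bvar σs θ v)

  liftS-liftR : ∀ {τs b Γ Γ' Δ} σs (θ : SbF τs b Γ' Δ) (ρ : Rn Γ Γ') (ρ' : Rn Γ Δ) →
                (∀ {σ} (v : Var Γ σ) → θ (ρ v) ≡ ivar (ρ' v)) →
                ∀ {σ} (v : Var (σs ++ Γ) σ) → liftS σs θ (liftR σs ρ v) ≡ ivar (liftR σs ρ' v)
  liftS-liftR [] θ ρ ρ' e v = e v
  liftS-liftR (_ ∷ σs) θ ρ ρ' e here = refl
  liftS-liftR (_ ∷ σs) θ ρ ρ' e (there v) = cong wkImg (liftS-liftR σs θ ρ ρ' e v)

  hsubA-++ : ∀ {τs b Γ Δ ρs σs} (θ : SbF τs b Γ Δ) (as : ArgsF Γ ρs) (bs : ArgsF Γ σs) →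
             hsubA τs b θ (as ++A bs) ≡ hsubA τs b θ as ++A hsubA τs b θ bs
  hsubA-++ θ [] bs = refl
  hsubA-++ θ (a ∷ as) bs = cong (_ ∷_) (hsubA-++ θ as bs)

  mutual
    hsubT-renT : ∀ {τs b Γ Γ' Δ σ} (θ : SbF τs b Γ' Δ) (ρ : Rn Γ Γ') (ρ' : Rn Γ Δ) →
                 (∀ {σ} (v : Var Γ σ) → θ (ρ v) ≡ ivar (ρ' v)) →
                 (t : TmF Γ σ) → hsubT τs b θ (renT ρ t) ≡ renT ρ' t
    hsubT-renT θ ρ ρ' e (lam {σs} w) =
      cong lam (hsubN-renN (liftS σs θ) (liftR σs ρ) (liftR σs ρ') (liftS-liftR σs θ ρ ρ' e) w)

    hsubN-renN : ∀ {τs b Γ Γ' Δ a} (θ : SbF τs b Γ' Δ) (ρ : Rn Γ Γ') (ρ' : Rn Γ Δ) →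
                 (∀ {σ} (v : Var Γ σ) → θ (ρ v) ≡ ivar (ρ' v)) →
                 (t : NfF Γ a) → hsubN τs b θ (renN ρ t) ≡ renN ρ' t
    hsubN-renN {τs} {b} θ ρ ρ' e (hd (var v) ts) with θ (ρ v) | e v
    ... | .(ivar (ρ' v)) | refl = cong (hd (var (ρ' v))) (hsubA-renA θ ρ ρ' e ts)
    hsubN-renN θ ρ ρ' e (hd (fun f) ts) = cong (hd (fun f)) (hsubA-renA θ ρ ρ' e ts)

    hsubA-renA : ∀ {τs b Γ Γ' Δ σs} (θ : SbF τs b Γ' Δ) (ρ : Rn Γ Γ') (ρ' : Rn Γ Δ) →
                 (∀ {σ} (v : Var Γ σ) → θ (ρ v) ≡ ivar (ρ' v)) →
                 (ts : ArgsF Γ σs) → hsubA τs b θ (renA ρ ts) ≡ renA ρ' ts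
    hsubA-renA θ ρ ρ' e [] = refl
    hsubA-renA θ ρ ρ' e (t ∷ ts) = cong₂ _∷_ (hsubT-renT θ ρ ρ' e t) (hsubA-renA θ ρ ρ' e ts)

  hsubA-etas : ∀ {τs' b' Γ Δ} τs (f : Rn τs Γ) (g : Rn τs Δ) (θ : SbF τs' b' Γ Δ) →
               (∀ {σ} (v : Var τs σ) → θ (f v) ≡ ivar (g v)) →
               hsubA τs' b' θ (etas τs f) ≡ etas τs g
  hsubA-etas [] f g θ e = refl
  hsubA-etas {τs'} {b'} ((ρs ⇒ c) ∷ τs) f g θ e =
    cong₂ _∷_
      (cong lam (trans (cong (λ i → hsubHd τs' b' (liftS ρs θ) i (etas ρs bvar))
                             (trans (liftS-wkV ρs θ (f here))
                               (trans (cong (wkImgs ρs) (e here)) (wkImgs-ivar ρs (g here)))))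
                   (cong (hd (var (wkV ρs (g here))))
                     (hsubA-etas ρs bvar bvar (liftS ρs θ) (liftS-bvar ρs θ)))))
      (hsubA-etas τs (λ v → f (there v)) (λ v → g (there v)) θ (λ v → e (there v)))

  split : ∀ {Δ : Ctx S} ρs {σ} → Var (ρs ++ Δ) σ → Var ρs σ ⊎ Var Δ σ
  split [] v = inj₂ v
  split (_ ∷ ρs) here = inj₁ here
  split (_ ∷ ρs) (there v) with split ρs v
  ... | inj₁ x = inj₁ (there x)
  ... | inj₂ y = inj₂ y

  caseSplit : ∀ {ρs Δ : Ctx S} {σ} → Rn ρs Δ → Var ρs σ ⊎ Var Δ σ → Var Δ σ
  caseSplit f (inj₁ x) = f x
  caseSplit f (inj₂ y) = y

  split-wkV : ∀ {Δ : Ctx S} ρs {σ} (v : Var Δ σ) → split ρs (wkV ρs v) ≡ inj₂ v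
  split-wkV [] v = refl
  split-wkV (_ ∷ ρs) v rewrite split-wkV ρs v = refl

  split-bvar : ∀ {Δ : Ctx S} ρs {σ} (v : Var ρs σ) → split {Δ = Δ} ρs (bvar v) ≡ inj₁ v
  split-bvar (_ ∷ ρs) here = refl
  split-bvar {Δ} (_ ∷ ρs) (there v) rewrite split-bvar {Δ = Δ} ρs v = refl

  caseSplit-there : ∀ {Δ : Ctx S} ρs τ (f : Rn (τ ∷ ρs) Δ) {σ} (v : Var (ρs ++ Δ) σ) →
                    caseSplit f (split (τ ∷ ρs) (there v)) ≡ caseSplit (λ x → f (there x)) (split ρs v)
  caseSplit-there ρs τ f v with split ρs v
  ... | inj₁ x = refl
  ... | inj₂ y = refl

  sb1-ren : ∀ {Δ : Ctx S} {σ} → Var Δ σ → Rn (σ ∷ Δ) Δ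
  sb1-ren y here = y
  sb1-ren y (there v) = v

  data EtaOrVar {τs b Δ} : ∀ {σ} → ImgF τs b Δ σ → Var Δ σ → Set where
    is-var : ∀ {σ} {u : Var Δ σ} → EtaOrVar (ivar u) u
    is-eta : ∀ {t u} → t ≡ eta τs b u → EtaOrVar (itm t) u

  caseSplit-liftR : ∀ {Γ : Ctx S} ρs {σ} (v : Var (ρs ++ Γ) σ) →
                    v ≡ caseSplit bvar (split ρs (liftR ρs (wkV ρs) v))
  caseSplit-liftR {Γ} ρs v with binderView ρs v
  ... | binder k rewrite liftR-bvar {Γ = Γ} ρs (wkV ρs) k | split-bvar {Δ = ρs ++ Γ} ρs k = refl
  ... | outer u rewrite liftR-wkV ρs (wkV ρs) u | split-wkV ρs (wkV {Γ = Γ} ρs u) = refl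

  hsubN-weakHead : ∀ {Δ b ρs' c τs L} (t' : TmF (τs ++ Δ) (ρs' ⇒ c)) (H : HeadF Δ (L ⇒ b))
                   (X : ArgsF ((ρs' ⇒ c) ∷ τs ++ Δ) L) →
                   hsubN ρs' c (sb1 t') (hd (renH (wkV ((ρs' ⇒ c) ∷ τs)) H) X) ≡
                   hd (renH (wkV τs) H) (hsubA ρs' c (sb1 t') X)
  hsubN-weakHead t' (var u) X = refl
  hsubN-weakHead t' (fun f) X = refl

  EtaOrVar-lift : ∀ {τs b Γ Δ} σs (θ : SbF τs b Γ Δ) (π : Rn Γ Δ) →
                  (∀ {σ} (v : Var Γ σ) → EtaOrVar (θ v) (π v)) →
                  ∀ {σ} (v : Var (σs ++ Γ) σ) → EtaOrVar (liftS σs θ v) (liftR σs π v)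
  EtaOrVar-lift [] θ π e v = e v
  EtaOrVar-lift (_ ∷ σs) θ π e here = is-var
  EtaOrVar-lift {τs} {b} (_ ∷ σs) θ π e (there v) with liftS σs θ v | liftR σs π v | EtaOrVar-lift σs θ π e v
  ... | .(ivar u) | u | is-var = is-var
  ... | .(itm _) | u | is-eta eq = is-eta (trans (cong (renT there) eq) (eta-ren τs b u there))

  -- η-expansion is a unit of hereditary substitution; these laws need each other at smaller types.
  mutual
    inst-expanded : ∀ {Δ b} (τs : Ctx S) {ρs} (H : HeadF Δ ((ρs ++ τs) ⇒ b)) (A : ArgsF Δ ρs) (B : ArgsF Δ τs) →
                    inst τs (hd (renH (wkV τs) H) (renA (wkV τs) A ++A etaBinders τs)) B ≡ hd H (A ++A B)
    inst-expanded [] H A [] = cong₂ hd (renH-id H) (cong (_++A []) (renA-id A))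
    inst-expanded {Δ} {b} (σ@(ρs' ⇒ c) ∷ τs) {ρs} H A (t ∷ B) = begin
        inst τs (hsubN ρs' c θ (hd (renH (wkV (σ ∷ τs)) H) (renA (wkV (σ ∷ τs)) A ++A etaBinders (σ ∷ τs)))) B
      ≡⟨ cong (λ n → inst τs n B) (hsubN-weakHead t′ H _) ⟩
        inst τs (hd (renH (wkV τs) H) (hsubA ρs' c θ (renA (wkV (σ ∷ τs)) A ++A etaBinders (σ ∷ τs)))) B
      ≡⟨ cong (λ X → inst τs (hd (renH (wkV τs) H) X) B) args≡ ⟩
        inst τs (hd (renH (wkV τs) H) (renA (wkV τs) A ++A (t′ ∷ etaBinders τs))) B
      ≡⟨ cong (λ n → inst τs n B) (hd-cong-HE (renH-cong-HE (wkV τs) (he-sym H′≅H)) (he-sym args≅)) ⟩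
        inst τs (hd (renH (wkV τs) H′) (renA (wkV τs) (A ++A (t ∷ [])) ++A etaBinders τs)) B
      ≡⟨ inst-expanded τs H′ (A ++A (t ∷ [])) B ⟩
        hd H′ ((A ++A (t ∷ [])) ++A B)
      ≡⟨ hd-cong-HE H′≅H (++A-assoc A (t ∷ []) B) ⟩
        hd H (A ++A (t ∷ B))
      ∎
      where
        open ≡-Reasoning
        t′ : TmF (τs ++ Δ) σ
        t′ = renT (wkV τs) t
        θ : SbF ρs' c (σ ∷ τs ++ Δ) (τs ++ Δ)
        θ = sb1 t′
        H′ : HeadF Δ (((ρs ++ (σ ∷ [])) ++ τs) ⇒ b)
        H′ = subst (λ L → HeadF Δ (L ⇒ b)) (sym (++-assoc ρs (σ ∷ []) τs)) H
        H′≅H : HE (HeadF Δ) H′ H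
        H′≅H = subst-HE (sym (++-assoc ρs (σ ∷ []) τs)) H
        args≡ : hsubA ρs' c θ (renA (wkV (σ ∷ τs)) A ++A etaBinders (σ ∷ τs)) ≡
                renA (wkV τs) A ++A (t′ ∷ etaBinders τs)
        args≡ = trans (hsubA-++ θ (renA (wkV (σ ∷ τs)) A) (etaBinders (σ ∷ τs)))
                  (cong₂ _++A_ (hsubA-renA θ (wkV (σ ∷ τs)) (wkV τs) (λ v → refl) A)
                     (cong₂ _∷_ (hsubT-eta ρs' c θ here t′ refl)
                                (hsubA-etas τs (λ v → there (bvar v)) bvar θ (λ v → refl))))
        args≅ : HE (ArgsF (τs ++ Δ)) (renA (wkV τs) (A ++A (t ∷ [])) ++A etaBinders τs)
                (renA (wkV τs) A ++A (t′ ∷ etaBinders τs))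
        args≅ = he-trans (≡-he (cong (_++A etaBinders τs) (renA-++ (wkV τs) A (t ∷ []))))
                         (++A-assoc (renA (wkV τs) A) (t′ ∷ []) (etaBinders τs))

    hsubT-eta : ∀ {Γ Δ} ρs c (θ : SbF ρs c Γ Δ) (x : Var Γ (ρs ⇒ c)) (t : TmF Δ (ρs ⇒ c)) →
                θ x ≡ itm t → hsubT ρs c θ (eta ρs c x) ≡ t
    hsubT-eta ρs c θ x (lam body) e =
      cong lam
        (trans (cong (λ i → hsubHd ρs c (liftS ρs θ) i (etas ρs bvar))
                     (trans (liftS-wkV ρs θ x) (trans (cong (wkImgs ρs) e) (wkImgs-itm ρs (lam body)))))
        (trans (cong (inst ρs (renN (liftR ρs (wkV ρs)) body))
                     (hsubA-etas ρs bvar bvar (liftS ρs θ) (liftS-bvar ρs θ)))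
        (trans (inst-etas ρs body (liftR ρs (wkV ρs)) (λ v → v) bvar (caseSplit-liftR ρs))
               (renN-id body))))

    inst-etas : ∀ ρs {Γ0 Δ c} (body : NfF Γ0 c) (π : Rn Γ0 (ρs ++ Δ)) (π' : Rn Γ0 Δ) (f : Rn ρs Δ) →
                (∀ {σ} (v : Var Γ0 σ) → π' v ≡ caseSplit f (split ρs (π v))) →
                inst ρs (renN π body) (etas ρs f) ≡ renN π' body
    inst-etas [] body π π' f e = renN-ext (λ v → sym (e v)) body
    inst-etas ((τs ⇒ b) ∷ ρs) {Γ0} {Δ} body π π' f e =
      trans (cong (λ n → inst ρs n (etas ρs (λ v → f (there v))))
               (trans (hsubN-etaOrVar τs b (sb1 (renT (wkV ρs) (eta τs b (f here)))) (sb1-ren (wkV ρs (f here))) sb1-etaOrVar (renN π body))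
                      (renN-comp (sb1-ren (wkV ρs (f here))) π body)))
            (inst-etas ρs body (λ v → sb1-ren (wkV ρs (f here)) (π v)) π' (λ v → f (there v)) caseSplit-sb1)
      where
        sb1-etaOrVar : ∀ {σ} (v : Var ((τs ⇒ b) ∷ ρs ++ Δ) σ) →
                       EtaOrVar (sb1 (renT (wkV ρs) (eta τs b (f here))) v) (sb1-ren (wkV ρs (f here)) v)
        sb1-etaOrVar here = is-eta (eta-ren τs b (f here) (wkV ρs))
        sb1-etaOrVar (there v) = is-var
        caseSplit-sb1 : ∀ {σ} (v : Var Γ0 σ) → π' v ≡ caseSplit (λ x → f (there x)) (split ρs (sb1-ren (wkV ρs (f here)) (π v)))
        caseSplit-sb1 v with π v | e v
        ... | here | eq rewrite split-wkV ρs (f here) = eq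
        ... | there u | eq = trans eq (caseSplit-there ρs (τs ⇒ b) f u)

    hsubN-etaOrVar : ∀ τs b {Γ Δ} (θ : SbF τs b Γ Δ) (π : Rn Γ Δ) → (∀ {σ} (v : Var Γ σ) → EtaOrVar (θ v) (π v)) →
                     ∀ {a} (w : NfF Γ a) → hsubN τs b θ w ≡ renN π w
    hsubN-etaOrVar τs b θ π e (hd (fun f) ts) = cong (hd (fun f)) (hsubA-etaOrVar τs b θ π e ts)
    hsubN-etaOrVar τs b θ π e (hd (var v) ts) with θ v | π v | e v
    ... | .(ivar u) | u | is-var = cong (hd (var u)) (hsubA-etaOrVar τs b θ π e ts)
    ... | .(itm _) | u | is-eta refl =
      trans (inst-expanded τs (var u) [] (hsubA τs b θ ts)) (cong (hd (var u)) (hsubA-etaOrVar τs b θ π e ts))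

    hsubT-etaOrVar : ∀ τs b {Γ Δ} (θ : SbF τs b Γ Δ) (π : Rn Γ Δ) → (∀ {σ} (v : Var Γ σ) → EtaOrVar (θ v) (π v)) →
                     ∀ {σ} (t : TmF Γ σ) → hsubT τs b θ t ≡ renT π t
    hsubT-etaOrVar τs b θ π e (lam {σs} w) = cong lam (hsubN-etaOrVar τs b (liftS σs θ) (liftR σs π) (EtaOrVar-lift σs θ π e) w)

    hsubA-etaOrVar : ∀ τs b {Γ Δ} (θ : SbF τs b Γ Δ) (π : Rn Γ Δ) → (∀ {σ} (v : Var Γ σ) → EtaOrVar (θ v) (π v)) →
                     ∀ {σs} (ts : ArgsF Γ σs) → hsubA τs b θ ts ≡ renA π ts
    hsubA-etaOrVar τs b θ π e [] = refl
    hsubA-etaOrVar τs b θ π e (t ∷ ts) = cong₂ _∷_ (hsubT-etaOrVar τs b θ π e t) (hsubA-etaOrVar τs b θ π e ts)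

  -- Shallow substitution

  expTm : ∀ {Δ ρs τs b} → HeadF Δ ((ρs ++ τs) ⇒ b) → ArgsF Δ ρs → TmF Δ (τs ⇒ b)
  expTm {τs = τs} H s = lam (hd (renH (wkV τs) H) (renA (wkV τs) s ++A etaBinders τs))

  -- A variable is sent to a variable or to an expanded term expTm H s over a base context B
  -- (embedded by the κ of imgN); substituting the latter for y in y(t⃗) yields H(s⃗, t⃗) directly.
  data Shallow (B Δ : Ctx S) : Ty S → Set where
    ren : ∀ {σ} → Var Δ σ → Shallow B Δ σ
    exp : ∀ {ρs τs b} → HeadF B ((ρs ++ τs) ⇒ b) → ArgsF B ρs → Shallow B Δ (τs ⇒ b)

  ShallowSb : Ctx S → Ctx S → Ctx S → Set
  ShallowSb B Γ Δ = ∀ {σ} → Var Γ σ → Shallow B Δ σ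

  wkShallow : ∀ {B Δ σ τ} → Shallow B Δ σ → Shallow B (τ ∷ Δ) σ
  wkShallow (ren u) = ren (there u)
  wkShallow (exp H s) = exp H s

  liftSh : ∀ {B Γ Δ} σs → ShallowSb B Γ Δ → ShallowSb B (σs ++ Γ) (σs ++ Δ)
  liftSh [] θ v = θ v
  liftSh (_ ∷ σs) θ here = ren here
  liftSh (_ ∷ σs) θ (there v) = wkShallow (liftSh σs θ v)

  mutual
    imgN : ∀ {B Γ Δ a} → Rn B Δ → ShallowSb B Γ Δ → NfF Γ a → NfF Δ a
    imgN κ θ (hd (fun f) as) = hd (fun f) (imgA κ θ as)
    imgN κ θ (hd (var v) as) = imgHd κ θ (θ v) as

    imgHd : ∀ {B Γ Δ σs a} → Rn B Δ → ShallowSb B Γ Δ → Shallow B Δ (σs ⇒ a) → ArgsF Γ σs → NfF Δ a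
    imgHd κ θ (ren u) as = hd (var u) (imgA κ θ as)
    imgHd κ θ (exp H s) as = hd (renH κ H) (renA κ s ++A imgA κ θ as)

    imgT : ∀ {B Γ Δ σ} → Rn B Δ → ShallowSb B Γ Δ → TmF Γ σ → TmF Δ σ
    imgT κ θ (lam {σs} w) = lam (imgN (λ v → wkV σs (κ v)) (liftSh σs θ) w)

    imgA : ∀ {B Γ Δ σs} → Rn B Δ → ShallowSb B Γ Δ → ArgsF Γ σs → ArgsF Δ σs
    imgA κ θ [] = []
    imgA κ θ (t ∷ ts) = imgT κ θ t ∷ imgA κ θ ts

  imgA-++ : ∀ {B Γ Δ ρs σs} (κ : Rn B Δ) (θ : ShallowSb B Γ Δ) (as : ArgsF Γ ρs) (bs : ArgsF Γ σs) →
            imgA κ θ (as ++A bs) ≡ imgA κ θ as ++A imgA κ θ bs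
  imgA-++ κ θ [] bs = refl
  imgA-++ κ θ (a ∷ as) bs = cong (_ ∷_) (imgA-++ κ θ as bs)

  expTm-ren : ∀ {Δ Θ ρs τs b} (ρ : Rn Δ Θ) (H : HeadF Δ ((ρs ++ τs) ⇒ b)) (s : ArgsF Δ ρs) →
              renT ρ (expTm H s) ≡ expTm (renH ρ H) (renA ρ s)
  expTm-ren {τs = τs} ρ H s =
    cong lam (cong₂ hd
      (trans (renH-comp (liftR τs ρ) (wkV τs) H)
        (trans (renH-ext (liftR-wkV τs ρ) H) (sym (renH-comp (wkV τs) ρ H))))
      (trans (renA-++ (liftR τs ρ) (renA (wkV τs) s) (etaBinders τs))
        (cong₂ _++A_
          (trans (renA-comp (liftR τs ρ) (wkV τs) s)
            (trans (renA-ext (liftR-wkV τs ρ) s) (sym (renA-comp (wkV τs) ρ s))))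
          (trans (etas-ren τs bvar (liftR τs ρ)) (etas-ext τs _ _ (liftR-bvar τs ρ))))))

  data Agree {τs b B Δ} (κ : Rn B Δ) : ∀ {σ} → ImgF τs b Δ σ → Shallow B Δ σ → Set where
    ag-v : ∀ {σ} {u : Var Δ σ} → Agree κ (ivar u) (ren u)
    ag-e : ∀ {ρs} {H : HeadF B ((ρs ++ τs) ⇒ b)} {s : ArgsF B ρs} {t} →
           t ≡ expTm (renH κ H) (renA κ s) → Agree κ (itm t) (exp H s)

  Agree-lift : ∀ {τs b B Γ Δ} σs (θ : SbF τs b Γ Δ) (κ : Rn B Δ) (θ̂ : ShallowSb B Γ Δ) →
               (∀ {σ} (v : Var Γ σ) → Agree κ (θ v) (θ̂ v)) →
               ∀ {σ} (v : Var (σs ++ Γ) σ) → Agree (λ x → wkV σs (κ x)) (liftS σs θ v) (liftSh σs θ̂ v)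
  Agree-lift [] θ κ θ̂ e v = e v
  Agree-lift (_ ∷ σs) θ κ θ̂ e here = ag-v
  Agree-lift (_ ∷ σs) θ κ θ̂ e (there v) with liftS σs θ v | liftSh σs θ̂ v | Agree-lift σs θ κ θ̂ e v
  ... | .(ivar _) | .(ren _) | ag-v = ag-v
  ... | .(itm _) | .(exp H s) | ag-e {H = H} {s} eq =
    ag-e (trans (cong (renT there) eq)
         (trans (expTm-ren there _ _)
                (cong₂ expTm (renH-comp there _ H) (renA-comp there _ s))))

  mutual
    hsubN≡imgN : ∀ {τs b B Γ Δ a} (θ : SbF τs b Γ Δ) (κ : Rn B Δ) (θ̂ : ShallowSb B Γ Δ) →
                 (∀ {σ} (v : Var Γ σ) → Agree κ (θ v) (θ̂ v)) → (w : NfF Γ a) → hsubN τs b θ w ≡ imgN κ θ̂ w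
    hsubN≡imgN θ κ θ̂ e (hd (fun f) ts) = cong (hd (fun f)) (hsubA≡imgA θ κ θ̂ e ts)
    hsubN≡imgN {τs} {b} θ κ θ̂ e (hd (var v) ts) with θ v | θ̂ v | e v
    ... | .(ivar _) | .(ren u) | ag-v {u = u} = cong (hd (var u)) (hsubA≡imgA θ κ θ̂ e ts)
    ... | .(itm _) | .(exp H s) | ag-e {H = H} {s} refl =
      trans (inst-expanded τs (renH κ H) (renA κ s) (hsubA τs b θ ts))
            (cong (λ X → hd (renH κ H) (renA κ s ++A X)) (hsubA≡imgA θ κ θ̂ e ts))

    hsubT≡imgT : ∀ {τs b B Γ Δ σ} (θ : SbF τs b Γ Δ) (κ : Rn B Δ) (θ̂ : ShallowSb B Γ Δ) →
                 (∀ {σ} (v : Var Γ σ) → Agree κ (θ v) (θ̂ v)) → (t : TmF Γ σ) → hsubT τs b θ t ≡ imgT κ θ̂ t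
    hsubT≡imgT θ κ θ̂ e (lam {σs} w) = cong lam (hsubN≡imgN (liftS σs θ) _ (liftSh σs θ̂) (Agree-lift σs θ κ θ̂ e) w)

    hsubA≡imgA : ∀ {τs b B Γ Δ σs} (θ : SbF τs b Γ Δ) (κ : Rn B Δ) (θ̂ : ShallowSb B Γ Δ) →
                 (∀ {σ} (v : Var Γ σ) → Agree κ (θ v) (θ̂ v)) → (ts : ArgsF Γ σs) → hsubA τs b θ ts ≡ imgA κ θ̂ ts
    hsubA≡imgA θ κ θ̂ e [] = refl
    hsubA≡imgA θ κ θ̂ e (t ∷ ts) = cong₂ _∷_ (hsubT≡imgT θ κ θ̂ e t) (hsubA≡imgA θ κ θ̂ e ts)

  liftSh-ext : ∀ {B Γ Δ} σs {θ θ' : ShallowSb B Γ Δ} → (∀ {σ} (v : Var Γ σ) → θ v ≡ θ' v) →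
               ∀ {σ} (v : Var (σs ++ Γ) σ) → liftSh σs θ v ≡ liftSh σs θ' v
  liftSh-ext [] e v = e v
  liftSh-ext (_ ∷ σs) e here = refl
  liftSh-ext (_ ∷ σs) e (there v) = cong wkShallow (liftSh-ext σs e v)

  mutual
    imgN-ext : ∀ {B Γ Δ a} {κ κ' : Rn B Δ} {θ θ' : ShallowSb B Γ Δ} →
               (∀ {σ} (v : Var B σ) → κ v ≡ κ' v) → (∀ {σ} (v : Var Γ σ) → θ v ≡ θ' v) →
               (w : NfF Γ a) → imgN κ θ w ≡ imgN κ' θ' w
    imgN-ext ek eθ (hd (fun f) as) = cong (hd (fun f)) (imgA-ext ek eθ as)
    imgN-ext {κ = κ} {κ'} {θ} {θ'} ek eθ (hd (var v) as) rewrite eθ v with θ' v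
    ... | ren u = cong (hd (var u)) (imgA-ext ek eθ as)
    ... | exp H s = cong₂ (λ h X → hd h X) (renH-ext ek H) (cong₂ _++A_ (renA-ext ek s) (imgA-ext ek eθ as))

    imgT-ext : ∀ {B Γ Δ σ} {κ κ' : Rn B Δ} {θ θ' : ShallowSb B Γ Δ} →
               (∀ {σ} (v : Var B σ) → κ v ≡ κ' v) → (∀ {σ} (v : Var Γ σ) → θ v ≡ θ' v) →
               (t : TmF Γ σ) → imgT κ θ t ≡ imgT κ' θ' t
    imgT-ext ek eθ (lam {σs} w) = cong lam (imgN-ext (λ v → cong (wkV σs) (ek v)) (liftSh-ext σs eθ) w)

    imgA-ext : ∀ {B Γ Δ σs} {κ κ' : Rn B Δ} {θ θ' : ShallowSb B Γ Δ} →
               (∀ {σ} (v : Var B σ) → κ v ≡ κ' v) → (∀ {σ} (v : Var Γ σ) → θ v ≡ θ' v) →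
               (ts : ArgsF Γ σs) → imgA κ θ ts ≡ imgA κ' θ' ts
    imgA-ext ek eθ [] = refl
    imgA-ext ek eθ (t ∷ ts) = cong₂ _∷_ (imgT-ext ek eθ t) (imgA-ext ek eθ ts)

  liftSh-liftR : ∀ {B Γ Γ' Δ} σs (θ : ShallowSb B Γ' Δ) (ρ : Rn Γ Γ') (θ' : ShallowSb B Γ Δ) →
                 (∀ {σ} (v : Var Γ σ) → θ (ρ v) ≡ θ' v) →
                 ∀ {σ} (v : Var (σs ++ Γ) σ) → liftSh σs θ (liftR σs ρ v) ≡ liftSh σs θ' v
  liftSh-liftR [] θ ρ θ' e v = e v
  liftSh-liftR (_ ∷ σs) θ ρ θ' e here = refl
  liftSh-liftR (_ ∷ σs) θ ρ θ' e (there v) = cong wkShallow (liftSh-liftR σs θ ρ θ' e v)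

  mutual
    imgN-renN : ∀ {B Γ Γ' Δ a} (κ : Rn B Δ) (θ : ShallowSb B Γ' Δ) (ρ : Rn Γ Γ') (θ' : ShallowSb B Γ Δ) →
                (∀ {σ} (v : Var Γ σ) → θ (ρ v) ≡ θ' v) → (w : NfF Γ a) → imgN κ θ (renN ρ w) ≡ imgN κ θ' w
    imgN-renN κ θ ρ θ' e (hd (fun f) as) = cong (hd (fun f)) (imgA-renA κ θ ρ θ' e as)
    imgN-renN κ θ ρ θ' e (hd (var v) as) rewrite e v with θ' v
    ... | ren u = cong (hd (var u)) (imgA-renA κ θ ρ θ' e as)
    ... | exp H s = cong (λ X → hd (renH κ H) (renA κ s ++A X)) (imgA-renA κ θ ρ θ' e as)

    imgT-renT : ∀ {B Γ Γ' Δ σ} (κ : Rn B Δ) (θ : ShallowSb B Γ' Δ) (ρ : Rn Γ Γ') (θ' : ShallowSb B Γ Δ) →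
                (∀ {σ} (v : Var Γ σ) → θ (ρ v) ≡ θ' v) → (t : TmF Γ σ) → imgT κ θ (renT ρ t) ≡ imgT κ θ' t
    imgT-renT κ θ ρ θ' e (lam {σs} w) = cong lam (imgN-renN _ (liftSh σs θ) (liftR σs ρ) (liftSh σs θ') (liftSh-liftR σs θ ρ θ' e) w)

    imgA-renA : ∀ {B Γ Γ' Δ σs} (κ : Rn B Δ) (θ : ShallowSb B Γ' Δ) (ρ : Rn Γ Γ') (θ' : ShallowSb B Γ Δ) →
                (∀ {σ} (v : Var Γ σ) → θ (ρ v) ≡ θ' v) → (ts : ArgsF Γ σs) → imgA κ θ (renA ρ ts) ≡ imgA κ θ' ts
    imgA-renA κ θ ρ θ' e [] = refl
    imgA-renA κ θ ρ θ' e (t ∷ ts) = cong₂ _∷_ (imgT-renT κ θ ρ θ' e t) (imgA-renA κ θ ρ θ' e ts)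

  liftSh-ren : ∀ {B Γ Δ} σs (θ : ShallowSb B Γ Δ) (ρ : Rn Γ Δ) →
               (∀ {σ} (v : Var Γ σ) → θ v ≡ ren (ρ v)) →
               ∀ {σ} (v : Var (σs ++ Γ) σ) → liftSh σs θ v ≡ ren (liftR σs ρ v)
  liftSh-ren [] θ ρ e v = e v
  liftSh-ren (_ ∷ σs) θ ρ e here = refl
  liftSh-ren (_ ∷ σs) θ ρ e (there v) = cong wkShallow (liftSh-ren σs θ ρ e v)

  mutual
    imgN-ren : ∀ {B Γ Δ a} (κ : Rn B Δ) (θ : ShallowSb B Γ Δ) (ρ : Rn Γ Δ) →
               (∀ {σ} (v : Var Γ σ) → θ v ≡ ren (ρ v)) → (w : NfF Γ a) → imgN κ θ w ≡ renN ρ w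
    imgN-ren κ θ ρ e (hd (fun f) as) = cong (hd (fun f)) (imgA-ren κ θ ρ e as)
    imgN-ren κ θ ρ e (hd (var v) as) rewrite e v = cong (hd (var (ρ v))) (imgA-ren κ θ ρ e as)

    imgT-ren : ∀ {B Γ Δ σ} (κ : Rn B Δ) (θ : ShallowSb B Γ Δ) (ρ : Rn Γ Δ) →
               (∀ {σ} (v : Var Γ σ) → θ v ≡ ren (ρ v)) → (t : TmF Γ σ) → imgT κ θ t ≡ renT ρ t
    imgT-ren κ θ ρ e (lam {σs} w) = cong lam (imgN-ren _ (liftSh σs θ) (liftR σs ρ) (liftSh-ren σs θ ρ e) w)

    imgA-ren : ∀ {B Γ Δ σs} (κ : Rn B Δ) (θ : ShallowSb B Γ Δ) (ρ : Rn Γ Δ) →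
               (∀ {σ} (v : Var Γ σ) → θ v ≡ ren (ρ v)) → (ts : ArgsF Γ σs) → imgA κ θ ts ≡ renA ρ ts
    imgA-ren κ θ ρ e [] = refl
    imgA-ren κ θ ρ e (t ∷ ts) = cong₂ _∷_ (imgT-ren κ θ ρ e t) (imgA-ren κ θ ρ e ts)

  bindShallow : ∀ {B Γ Δ σ} → ShallowSb B Γ Δ → Shallow B Γ σ → Shallow B Δ σ
  bindShallow θ (ren u) = θ u
  bindShallow θ (exp H s) = exp H s

  wkShallows : ∀ {B Δ σ} σs → Shallow B Δ σ → Shallow B (σs ++ Δ) σ
  wkShallows [] c = c
  wkShallows (_ ∷ σs) c = wkShallow (wkShallows σs c)

  liftSh-wkV : ∀ {B Γ Δ} σs (θ : ShallowSb B Γ Δ) {σ} (v : Var Γ σ) → liftSh σs θ (wkV σs v) ≡ wkShallows σs (θ v)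
  liftSh-wkV [] θ v = refl
  liftSh-wkV (_ ∷ σs) θ v = cong wkShallow (liftSh-wkV σs θ v)

  wkShallows-ren : ∀ {B Δ σ} σs (u : Var Δ σ) → wkShallows {B = B} σs (ren u) ≡ ren (wkV σs u)
  wkShallows-ren [] u = refl
  wkShallows-ren (_ ∷ σs) u = cong wkShallow (wkShallows-ren σs u)

  liftSh-comp : ∀ {B Γ1 Γ2 Γ3} σs (θ1 : ShallowSb B Γ1 Γ2) (θ2 : ShallowSb B Γ2 Γ3) (θ3 : ShallowSb B Γ1 Γ3) →
                (∀ {σ} (v : Var Γ1 σ) → θ3 v ≡ bindShallow θ2 (θ1 v)) →
                ∀ {σ} (v : Var (σs ++ Γ1) σ) → liftSh σs θ3 v ≡ bindShallow (liftSh σs θ2) (liftSh σs θ1 v)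
  liftSh-comp [] θ1 θ2 θ3 e v = e v
  liftSh-comp (_ ∷ σs) θ1 θ2 θ3 e here = refl
  liftSh-comp (_ ∷ σs) θ1 θ2 θ3 e (there v) with liftSh σs θ1 v | liftSh-comp σs θ1 θ2 θ3 e v
  ... | ren u | eq = cong wkShallow eq
  ... | exp H s | eq = cong wkShallow eq

  mutual
    imgN-imgN : ∀ {B Γ1 Γ2 Γ3 a} (κ1 : Rn B Γ2) (θ1 : ShallowSb B Γ1 Γ2) (κ2 : Rn B Γ3) (θ2 : ShallowSb B Γ2 Γ3)
                (θ3 : ShallowSb B Γ1 Γ3) → (∀ {σ} (u : Var B σ) → θ2 (κ1 u) ≡ ren (κ2 u)) →
                (∀ {σ} (v : Var Γ1 σ) → θ3 v ≡ bindShallow θ2 (θ1 v)) →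
                (w : NfF Γ1 a) → imgN κ2 θ2 (imgN κ1 θ1 w) ≡ imgN κ2 θ3 w
    imgN-imgN κ1 θ1 κ2 θ2 θ3 h e (hd (fun f) as) = cong (hd (fun f)) (imgA-imgA κ1 θ1 κ2 θ2 θ3 h e as)
    imgN-imgN κ1 θ1 κ2 θ2 θ3 h e (hd (var v) as) rewrite e v with θ1 v
    ... | ren u = bind-head (θ2 u)
      where bind-head : ∀ c → imgHd κ2 θ2 c (imgA κ1 θ1 as) ≡ imgHd κ2 θ3 c as
            bind-head (ren x) = cong (hd (var x)) (imgA-imgA κ1 θ1 κ2 θ2 θ3 h e as)
            bind-head (exp H s) = cong (λ X → hd (renH κ2 H) (renA κ2 s ++A X)) (imgA-imgA κ1 θ1 κ2 θ2 θ3 h e as)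
    ... | exp (fun f) s =
      cong (hd (fun f)) (trans (imgA-++ κ2 θ2 (renA κ1 s) (imgA κ1 θ1 as))
        (cong₂ _++A_ (trans (imgA-renA κ2 θ2 κ1 (λ u → ren (κ2 u)) h s) (imgA-ren κ2 _ κ2 (λ _ → refl) s))
                     (imgA-imgA κ1 θ1 κ2 θ2 θ3 h e as)))
    ... | exp (var x) s rewrite h x =
      cong (hd (var (κ2 x))) (trans (imgA-++ κ2 θ2 (renA κ1 s) (imgA κ1 θ1 as))
        (cong₂ _++A_ (trans (imgA-renA κ2 θ2 κ1 (λ u → ren (κ2 u)) h s) (imgA-ren κ2 _ κ2 (λ _ → refl) s))
                     (imgA-imgA κ1 θ1 κ2 θ2 θ3 h e as)))

    imgT-imgT : ∀ {B Γ1 Γ2 Γ3 σ} (κ1 : Rn B Γ2) (θ1 : ShallowSb B Γ1 Γ2) (κ2 : Rn B Γ3) (θ2 : ShallowSb B Γ2 Γ3)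
                (θ3 : ShallowSb B Γ1 Γ3) → (∀ {σ} (u : Var B σ) → θ2 (κ1 u) ≡ ren (κ2 u)) →
                (∀ {σ} (v : Var Γ1 σ) → θ3 v ≡ bindShallow θ2 (θ1 v)) →
                (t : TmF Γ1 σ) → imgT κ2 θ2 (imgT κ1 θ1 t) ≡ imgT κ2 θ3 t
    imgT-imgT κ1 θ1 κ2 θ2 θ3 h e (lam {σs} w) =
      cong lam (imgN-imgN _ (liftSh σs θ1) _ (liftSh σs θ2) (liftSh σs θ3)
                 (λ u → trans (liftSh-wkV σs θ2 (κ1 u)) (trans (cong (wkShallows σs) (h u)) (wkShallows-ren σs (κ2 u))))
                 (liftSh-comp σs θ1 θ2 θ3 e) w)

    imgA-imgA : ∀ {B Γ1 Γ2 Γ3 σs} (κ1 : Rn B Γ2) (θ1 : ShallowSb B Γ1 Γ2) (κ2 : Rn B Γ3) (θ2 : ShallowSb B Γ2 Γ3)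
                (θ3 : ShallowSb B Γ1 Γ3) → (∀ {σ} (u : Var B σ) → θ2 (κ1 u) ≡ ren (κ2 u)) →
                (∀ {σ} (v : Var Γ1 σ) → θ3 v ≡ bindShallow θ2 (θ1 v)) →
                (ts : ArgsF Γ1 σs) → imgA κ2 θ2 (imgA κ1 θ1 ts) ≡ imgA κ2 θ3 ts
    imgA-imgA κ1 θ1 κ2 θ2 θ3 h e [] = refl
    imgA-imgA κ1 θ1 κ2 θ2 θ3 h e (t ∷ ts) = cong₂ _∷_ (imgT-imgT κ1 θ1 κ2 θ2 θ3 h e t) (imgA-imgA κ1 θ1 κ2 θ2 θ3 h e ts)

  data Decomp (B : Ctx S) : Ty S → Set where
    decomp : ∀ {ρs τs b} → HeadF B ((ρs ++ τs) ⇒ b) → ArgsF B ρs → Decomp B (τs ⇒ b)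

  shallowOf : ∀ {B Δ σ} → Decomp B σ → Shallow B Δ σ
  shallowOf (decomp H s) = exp H s

  shallowOf≢ren : ∀ {B Δ σ} (c : Decomp B σ) {u : Var Δ σ} → shallowOf c ≡ ren u → ⊥
  shallowOf≢ren (decomp H s) ()

  selectShallow : ∀ {Δ Ys : Ctx S} {σ} → (∀ {σ} → Var Ys σ → Decomp Δ σ) → Var Ys σ ⊎ Var Δ σ → Shallow Δ Δ σ
  selectShallow dec (inj₁ q) = shallowOf (dec q)
  selectShallow dec (inj₂ u) = ren u

  instSb : ∀ {Δ} Ys → (∀ {σ} → Var Ys σ → Decomp Δ σ) → ShallowSb Δ (Ys ++ Δ) Δ
  instSb Ys dec v = selectShallow dec (split Ys v)

  expOf : ∀ {B σ} → Decomp B σ → TmF B σ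
  expOf (decomp H s) = expTm H s

  inst≡imgN : ∀ Ys {Δ a} (w : NfF (Ys ++ Δ) a) (ss : ArgsF Δ Ys) (dec : ∀ {σ} → Var Ys σ → Decomp Δ σ) →
              (∀ {σ} (q : Var Ys σ) → ss ! q ≡ expOf (dec q)) →
              inst Ys w ss ≡ imgN (λ x → x) (instSb Ys dec) w
  inst≡imgN [] w [] dec hyp = sym (trans (imgN-ren (λ x → x) (instSb [] dec) (λ x → x) (λ v → refl) w) (renN-id w))
  inst≡imgN ((τs ⇒ b) ∷ Ys) {Δ} w (s ∷ ss) dec hyp =
    trans (inst≡imgN Ys _ ss (λ q → dec (there q)) (λ q → hyp (there q)))
    (trans (cong (imgN (λ x → x) (instSb Ys (λ q → dec (there q))))
                 (hsubN≡imgN (sb1 (renT (wkV Ys) s)) (wkV Ys) θ₁ agrees w))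
           (imgN-imgN (wkV Ys) θ₁ (λ x → x) (instSb Ys (λ q → dec (there q))) (instSb ((τs ⇒ b) ∷ Ys) dec) instSb-wkV instSb-bind w))
    where
      θ₁ : ShallowSb Δ ((τs ⇒ b) ∷ Ys ++ Δ) (Ys ++ Δ)
      θ₁ here = shallowOf (dec here)
      θ₁ (there v) = ren v
      agrees : ∀ {σ} (v : Var ((τs ⇒ b) ∷ Ys ++ Δ) σ) → Agree (wkV Ys) (sb1 (renT (wkV Ys) s) v) (θ₁ v)
      agrees here with dec here | hyp here
      ... | decomp H s₀ | eq = ag-e (trans (cong (renT (wkV Ys)) eq) (expTm-ren (wkV Ys) H s₀))
      agrees (there v) = ag-v
      instSb-wkV : ∀ {σ} (u : Var Δ σ) → instSb Ys (λ q → dec (there q)) (wkV Ys u) ≡ ren u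
      instSb-wkV u rewrite split-wkV Ys u = refl
      instSb-bind : ∀ {σ} (v : Var ((τs ⇒ b) ∷ Ys ++ Δ) σ) →
                    instSb ((τs ⇒ b) ∷ Ys) dec v ≡ bindShallow (instSb Ys (λ q → dec (there q))) (θ₁ v)
      instSb-bind here with dec here
      ... | decomp _ _ = refl
      instSb-bind (there v) with split Ys v
      ... | inj₁ q = refl
      ... | inj₂ u = refl

  decompOf : ∀ {Γ Δ Ys} {e : Ext Γ Δ} {ss : ArgsF Δ Ys} → DHPVarArgs e ss →
             ∀ {σ} → Var Ys σ → Decomp Δ σ
  decompOf D {τs ⇒ b} q with DHPVarArgs.expanded D q
  ... | ρs , H , s' , eq = decomp H s'

  decompOf-expOf : ∀ {Γ Δ Ys} {e : Ext Γ Δ} {ss : ArgsF Δ Ys} (D : DHPVarArgs e ss) →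
                   ∀ {σ} (q : Var Ys σ) → ss ! q ≡ expOf (decompOf D q)
  decompOf-expOf D {τs ⇒ b} q with DHPVarArgs.expanded D q
  ... | ρs , H , s' , eq = eq

  substBody≡imgN : ∀ {Γ a} (Ys Xs : Ctx S) (w : NfF (Ys ++ Γ) a) (ss : ArgsF (Xs ++ Γ) Ys)
                   (D : DHPVarArgs (under Xs stop) ss) →
                   substBody Ys Xs w ss ≡
                   lam (imgN (λ x → x) (λ v → instSb Ys (decompOf D) (liftR Ys (wkV Xs) v)) w)
  substBody≡imgN Ys Xs w ss D =
    cong lam (trans (inst≡imgN Ys (renN (liftR Ys (wkV Xs)) w) ss (decompOf D) (decompOf-expOf D))
                    (imgN-renN (λ x → x) (instSb Ys (decompOf D)) (liftR Ys (wkV Xs)) _ (λ v → refl) w))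

  imgA-! : ∀ {B Γ Δ L σ} (κ : Rn B Δ) (θ : ShallowSb B Γ Δ) (as : ArgsF Γ L) (i : Var L σ) →
           imgA κ θ as ! i ≡ imgT κ θ (as ! i)
  imgA-! κ θ (a ∷ as) here = refl
  imgA-! κ θ (a ∷ as) (there i) = imgA-! κ θ as i

  renShallow : ∀ {B Δ Δ' σ} → Rn Δ Δ' → Shallow B Δ σ → Shallow B Δ' σ
  renShallow ρ (ren u) = ren (ρ u)
  renShallow ρ (exp H s) = exp H s

  liftSh-bvar : ∀ {B Γ Δ} σs (θ : ShallowSb B Γ Δ) {σ} (k : Var σs σ) → liftSh σs θ (bvar k) ≡ ren (bvar k)
  liftSh-bvar (_ ∷ σs) θ here = refl
  liftSh-bvar (_ ∷ σs) θ (there k) = cong wkShallow (liftSh-bvar σs θ k)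

  ren-inj : ∀ {B Δ σ} {u1 u2 : Var Δ σ} → ren {B = B} u1 ≡ ren u2 → u1 ≡ u2
  ren-inj refl = refl

  exp-inj : ∀ {B Δ ρs1 ρs2 τs b} {H1 : HeadF B ((ρs1 ++ τs) ⇒ b)} {H2 : HeadF B ((ρs2 ++ τs) ⇒ b)}
              {s1 : ArgsF B ρs1} {s2 : ArgsF B ρs2} → exp {Δ = Δ} H1 s1 ≡ exp H2 s2 →
            HE (HeadF B) H1 H2 × HE (ArgsF B) s1 s2
  exp-inj refl = he , he

  exp-cong-HE : ∀ {B Δ ρs1 ρs2 τs b} {H1 : HeadF B ((ρs1 ++ τs) ⇒ b)} {H2 : HeadF B ((ρs2 ++ τs) ⇒ b)}
                  {s1 : ArgsF B ρs1} {s2 : ArgsF B ρs2} → HE (HeadF B) H1 H2 → HE (ArgsF B) s1 s2 →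
                exp {Δ = Δ} H1 s1 ≡ exp H2 s2
  exp-cong-HE he he = refl

  wkShallows-exp : ∀ {B Δ ρs τs b} {H : HeadF B ((ρs ++ τs) ⇒ b)} {s : ArgsF B ρs} σs →
                   wkShallows {Δ = Δ} σs (exp H s) ≡ exp H s
  wkShallows-exp [] = refl
  wkShallows-exp (_ ∷ σs) = cong wkShallow (wkShallows-exp σs)

  wkShallows-ren-inv : ∀ {B Δ σ} σs (c : Shallow B Δ σ) {u : Var (σs ++ Δ) σ} → wkShallows σs c ≡ ren u →
                       Σ (Var Δ σ) λ u0 → c ≡ ren u0 × u ≡ wkV σs u0
  wkShallows-ren-inv σs (ren u0) e = u0 , refl , sym (ren-inj (trans (sym (wkShallows-ren σs u0)) e))
  wkShallows-ren-inv σs (exp H s) e with trans (sym (wkShallows-exp σs)) e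
  ... | ()

  wkShallows-exp-inv : ∀ {B Δ ρs τs b} σs (c : Shallow B Δ (τs ⇒ b)) {H : HeadF B ((ρs ++ τs) ⇒ b)} {s : ArgsF B ρs} →
                       wkShallows σs c ≡ exp H s → c ≡ exp H s
  wkShallows-exp-inv σs (ren u) e with trans (sym (wkShallows-ren σs u)) e
  ... | ()
  wkShallows-exp-inv {Δ = Δ} σs (exp H s) e with exp-inj (trans (sym (wkShallows-exp {Δ = Δ} σs)) e)
  ... | p , q = exp-cong-HE p q

  renShallow-wkV : ∀ {B Δ σ} σs (c : Shallow B Δ σ) → renShallow (wkV σs) c ≡ wkShallows σs c
  renShallow-wkV σs (ren u) = sym (wkShallows-ren σs u)
  renShallow-wkV σs (exp H s) = sym (wkShallows-exp σs)

  data LiftedRen {B Γ Δ : Ctx S} (σs : Ctx S) (θ : ShallowSb B Γ Δ) {σ} (v : Var (σs ++ Γ) σ) (u : Var (σs ++ Δ) σ) : Set where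
    lifted-binder : (k : Var σs σ) → v ≡ bvar k → u ≡ bvar k → LiftedRen σs θ v u
    lifted-outer : (v0 : Var Γ σ) (u0 : Var Δ σ) → v ≡ wkV σs v0 → u ≡ wkV σs u0 → θ v0 ≡ ren u0 → LiftedRen σs θ v u

  liftSh-ren-inv : ∀ {B Γ Δ} σs (θ : ShallowSb B Γ Δ) {σ} (v : Var (σs ++ Γ) σ) {u} → liftSh σs θ v ≡ ren u → LiftedRen σs θ v u
  liftSh-ren-inv σs θ v e with binderView σs v
  ... | binder k = lifted-binder k refl (ren-inj (trans (sym e) (liftSh-bvar σs θ k)))
  ... | outer v0 with wkShallows-ren-inv σs (θ v0) (trans (sym (liftSh-wkV σs θ v0)) e)
  ... | u0 , e1 , e2 = lifted-outer v0 u0 refl e2 e1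

  liftSh-exp-inv : ∀ {B Γ Δ} σs (θ : ShallowSb B Γ Δ) {ρs τs b} (v : Var (σs ++ Γ) (τs ⇒ b))
                     {H : HeadF B ((ρs ++ τs) ⇒ b)} {s : ArgsF B ρs} → liftSh σs θ v ≡ exp H s →
                   Σ (Var Γ (τs ⇒ b)) λ v0 → v ≡ wkV σs v0 × θ v0 ≡ exp H s
  liftSh-exp-inv σs θ v e with binderView σs v
  ... | binder k with trans (sym (liftSh-bvar σs θ k)) e
  ... | ()
  liftSh-exp-inv σs θ v e | outer v0 = v0 , refl , wkShallows-exp-inv σs (θ v0) (trans (sym (liftSh-wkV σs θ v0)) e)

  renShallow-liftSh : ∀ {B Γ Δ Δ'} σs (θ : ShallowSb B Γ Δ) (ρ : Rn Δ Δ') {σ} (v : Var (σs ++ Γ) σ) →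
                      renShallow (liftR σs ρ) (liftSh σs θ v) ≡ liftSh σs (λ x → renShallow ρ (θ x)) v
  renShallow-liftSh [] θ ρ v = refl
  renShallow-liftSh (_ ∷ σs) θ ρ here = refl
  renShallow-liftSh (_ ∷ σs) θ ρ (there v) with liftSh σs θ v | renShallow-liftSh σs θ ρ v
  ... | ren u | e = cong wkShallow e
  ... | exp H s | e = cong wkShallow e

  mutual
    renN-imgN : ∀ {B Γ Δ Δ' a} (κ : Rn B Δ) (θ : ShallowSb B Γ Δ) (ρ : Rn Δ Δ') (n : NfF Γ a) →
                renN ρ (imgN κ θ n) ≡ imgN (λ x → ρ (κ x)) (λ v → renShallow ρ (θ v)) n
    renN-imgN κ θ ρ (hd (fun f) as) = cong (hd (fun f)) (renA-imgA κ θ ρ as)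
    renN-imgN κ θ ρ (hd (var v) as) with θ v
    ... | ren u = cong (hd (var (ρ u))) (renA-imgA κ θ ρ as)
    ... | exp H s = cong₂ hd (renH-comp ρ κ H)
                      (trans (renA-++ ρ (renA κ s) (imgA κ θ as)) (cong₂ _++A_ (renA-comp ρ κ s) (renA-imgA κ θ ρ as)))

    renT-imgT : ∀ {B Γ Δ Δ' σ} (κ : Rn B Δ) (θ : ShallowSb B Γ Δ) (ρ : Rn Δ Δ') (t : TmF Γ σ) →
                renT ρ (imgT κ θ t) ≡ imgT (λ x → ρ (κ x)) (λ v → renShallow ρ (θ v)) t
    renT-imgT κ θ ρ (lam {σs} w) =
      cong lam (trans (renN-imgN _ (liftSh σs θ) (liftR σs ρ) w)
                      (imgN-ext (λ x → liftR-wkV σs ρ (κ x)) (renShallow-liftSh σs θ ρ) w))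

    renA-imgA : ∀ {B Γ Δ Δ' L} (κ : Rn B Δ) (θ : ShallowSb B Γ Δ) (ρ : Rn Δ Δ') (as : ArgsF Γ L) →
                renA ρ (imgA κ θ as) ≡ imgA (λ x → ρ (κ x)) (λ v → renShallow ρ (θ v)) as
    renA-imgA κ θ ρ [] = refl
    renA-imgA κ θ ρ (t ∷ ts) = cong₂ _∷_ (renT-imgT κ θ ρ t) (renA-imgA κ θ ρ ts)

  imgA-wkV : ∀ {B Γ Δ L} τs (κ : Rn B Δ) (θ : ShallowSb B Γ Δ) (r : ArgsF Γ L) →
             imgA (λ x → wkV τs (κ x)) (liftSh τs θ) (renA (wkV τs) r) ≡ renA (wkV τs) (imgA κ θ r)
  imgA-wkV τs κ θ r =
    trans (imgA-renA _ (liftSh τs θ) (wkV τs) (λ v → wkShallows τs (θ v)) (liftSh-wkV τs θ) r)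
          (sym (trans (renA-imgA κ θ (wkV τs) r) (imgA-ext (λ x → refl) (λ v → renShallow-wkV τs (θ v)) r)))

  mutual
    img-eta : ∀ {B Γ Δ} σs a (κ : Rn B Δ) (θ : ShallowSb B Γ Δ) (y : Var Γ (σs ⇒ a)) (y' : Var Δ (σs ⇒ a)) →
              θ y ≡ ren y' → imgT κ θ (eta σs a y) ≡ eta σs a y'
    img-eta σs a κ θ y y' e =
      trans (cong (λ c → lam (imgHd (λ v → wkV σs (κ v)) (liftSh σs θ) c (etas σs bvar)))
                  (trans (liftSh-wkV σs θ y) (trans (cong (wkShallows σs) e) (wkShallows-ren σs y'))))
            (cong lam (cong (hd (var (wkV σs y'))) (img-etas σs _ (liftSh σs θ) bvar bvar (liftSh-bvar σs θ))))

    img-etas : ∀ {B Γ Δ} τs (κ : Rn B Δ) (θ : ShallowSb B Γ Δ) (f : Rn τs Γ) (g : Rn τs Δ) →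
               (∀ {σ} (k : Var τs σ) → θ (f k) ≡ ren (g k)) → imgA κ θ (etas τs f) ≡ etas τs g
    img-etas [] κ θ f g e = refl
    img-etas ((ρs ⇒ c) ∷ τs) κ θ f g e =
      cong₂ _∷_ (img-eta ρs c κ θ (f here) (g here) (e here))
                (img-etas τs κ θ (λ k → f (there k)) (λ k → g (there k)) (λ k → e (there k)))

  renShallow-id : ∀ {B Δ σ} (c : Shallow B Δ σ) → renShallow (λ x → x) c ≡ c
  renShallow-id (ren u) = refl
  renShallow-id (exp H s) = refl

  wkShallows-renShallow : ∀ {B Δ Δ' σ} σs (μ : Rn Δ Δ') (c : Shallow B Δ σ) →
                          wkShallows σs (renShallow μ c) ≡ renShallow (λ u → wkV σs (μ u)) c
  wkShallows-renShallow σs μ (ren u) = wkShallows-ren σs (μ u)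
  wkShallows-renShallow σs μ (exp H s) = wkShallows-exp σs

  mutual
    occT-ren : ∀ {Γ Δ ρ σ} (r : Rn Γ Δ) {u : Var Γ ρ} {t : TmF Γ σ} → OccT u t → OccT (r u) (renT r t)
    occT-ren r {u} (lam {σs = σs} o) = lam (subst (λ z → OccN z _) (liftR-wkV σs r u) (occN-ren (liftR σs r) o))

    occN-ren : ∀ {Γ Δ ρ a} (r : Rn Γ Δ) {u : Var Γ ρ} {n : NfF Γ a} → OccN u n → OccN (r u) (renN r n)
    occN-ren r head = head
    occN-ren r {n = hd h ts} (arg i o) = arg i (subst (OccT _) (sym (renA-! r ts i)) (occT-ren r o))

  occN-inv : ∀ {Γ ρ a L} {u : Var Γ ρ} {h : HeadF Γ (L ⇒ a)} {ts : ArgsF Γ L} → OccN u (hd h ts) →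
             HE (HeadF Γ) h (var {F = F} u) ⊎ Σ (Ty S) λ σ → Σ (Var L σ) λ i → OccT u (ts ! i)
  occN-inv head = inj₁ he
  occN-inv (arg i o) = inj₂ (_ , i , o)

  var-inj-HE : ∀ {Γ σ1 σ2} {x : Var Γ σ1} {y : Var Γ σ2} → HE (HeadF Γ) (var x) (var y) → HE (Var Γ) x y
  var-inj-HE he = he

  mutual
    occT-unren : ∀ {Γ Δ ρ σ} (r : Rn Γ Δ) {u : Var Δ ρ} (t : TmF Γ σ) → OccT u (renT r t) →
                 Σ (Var Γ ρ) λ x → r x ≡ u × OccT x t
    occT-unren r (lam {σs} w) (lam o) with occN-unren (liftR σs r) w o
    ... | x , e , o' with binderView σs x
    ... | binder k = ⊥-elim (bvar≢wkV σs k _ (trans (sym (liftR-bvar σs r k)) e))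
    ... | outer x0 = x0 , wkV-inj σs (trans (sym (liftR-wkV σs r x0)) e) , lam o'

    occN-unren : ∀ {Γ Δ ρ a} (r : Rn Γ Δ) {u : Var Δ ρ} (n : NfF Γ a) → OccN u (renN r n) →
                 Σ (Var Γ ρ) λ x → r x ≡ u × OccN x n
    occN-unren r (hd (var x) ts) o with occN-inv o
    ... | inj₁ q with he-idx q
    ... | refl with he-≡ q
    ... | refl = x , refl , head
    occN-unren r (hd (var x) ts) o | inj₂ (_ , i , o') with occA-unren r ts i o'
    ... | y , e , o'' = y , e , arg i o''
    occN-unren r (hd (fun f) ts) o with occN-inv o
    ... | inj₁ q with he-idx q
    ... | refl with he-≡ q
    ... | ()
    occN-unren r (hd (fun f) ts) o | inj₂ (_ , i , o') with occA-unren r ts i o'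
    ... | y , e , o'' = y , e , arg i o''

    occA-unren : ∀ {Γ Δ ρ L σ} (r : Rn Γ Δ) {u : Var Δ ρ} (ts : ArgsF Γ L) (i : Var L σ) →
                 OccT u (renA r ts ! i) → Σ (Var Γ ρ) λ x → r x ≡ u × OccT x (ts ! i)
    occA-unren r (t ∷ ts) here o = occT-unren r t o
    occA-unren r (t ∷ ts) (there i) o = occA-unren r ts i o

  HasOcc : ∀ {Δ σ} → TmF Δ σ → Set
  HasOcc {Δ} t = Σ (Ty S) λ ρ → Σ (Var Δ ρ) λ v → OccT v t

  mutual
    eta-occ : ∀ {Γ ρ} σs a (y : Var Γ (σs ⇒ a)) {u : Var Γ ρ} → OccT u (eta {F = F} σs a y) → HE (Var Γ) u y
    eta-occ σs a y {u} (lam o) with occN-inv o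
    ... | inj₁ q with var-inj-HE q
    ... | q' with he-idx q'
    ... | refl = he-sym (≡-he (wkV-inj σs (he-≡ q')))
    eta-occ σs a y {u} (lam o) | inj₂ (_ , i , o') with etas-occ σs bvar i o'
    ... | q with he-idx q
    ... | refl = ⊥-elim (bvar≢wkV σs i u (sym (he-≡ q)))

    etas-occ : ∀ {Γ ρ σ} τs (f : Rn τs Γ) (i : Var τs σ) {u : Var Γ ρ} → OccT u (etas {F = F} τs f ! i) → HE (Var Γ) u (f i)
    etas-occ ((ρs ⇒ c) ∷ τs) f here o = eta-occ ρs c (f here) o
    etas-occ ((ρs ⇒ c) ∷ τs) f (there i) o = etas-occ τs (λ v → f (there v)) i o

  OccDecomp : ∀ {B : Ctx S} {ρ ρs τs b} → Var B ρ → HeadF B ((ρs ++ τs) ⇒ b) → ArgsF B ρs → Set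
  OccDecomp {B} {ρs = ρs} x H s = HE (HeadF B) H (var x) ⊎ Σ (Ty S) λ σ → Σ (Var ρs σ) λ k → OccT x (s ! k)

  OccT⇒OccDecomp : ∀ {Δ ρs τs b ρ} (g : HeadF Δ ((ρs ++ τs) ⇒ b)) (r : ArgsF Δ ρs) {x : Var Δ ρ} →
                   OccT x (expTm g r) → OccDecomp x g r
  OccT⇒OccDecomp {ρs = ρs} {τs = τs} g r {x} (lam o) with occN-inv o
  OccT⇒OccDecomp {ρs = ρs} {τs = τs} (var y) r {x} (lam o) | inj₁ q with var-inj-HE q
  ... | q' with he-idx q'
  ... | refl = inj₁ (≡-he (cong var (wkV-inj τs (he-≡ q'))))
  OccT⇒OccDecomp {ρs = ρs} {τs = τs} (fun f) r {x} (lam o) | inj₁ q with he-idx q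
  ... | refl with he-≡ q
  ... | ()
  OccT⇒OccDecomp {ρs = ρs} {τs = τs} g r {x} (lam o) | inj₂ (_ , i , o') with binderView {Γ = τs} ρs i
  ... | binder p = inj₂ (_ , p , o-entry)
    where
      o-wk : OccT (wkV τs x) (renT (wkV τs) (r ! p))
      o-wk = subst (OccT _) (trans (++A-!-bvar (renA (wkV τs) r) (etaBinders τs) p) (renA-! (wkV τs) r p)) o'
      o-entry : OccT x (r ! p)
      o-entry with occT-unren (wkV τs) (r ! p) o-wk
      ... | x' , e , o2 with wkV-inj τs e
      ... | refl = o2
  ... | outer k with etas-occ τs bvar k (subst (OccT _) (++A-!-wkV (renA (wkV τs) r) (etaBinders τs) k) o')
  ... | q with he-idx q
  ... | refl = ⊥-elim (bvar≢wkV τs k x (sym (he-≡ q)))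

  occN-head-exp : ∀ {B Δ ρ ρs τs b} (κ : Rn B Δ) {x : Var B ρ} {H : HeadF B ((ρs ++ τs) ⇒ b)} {s : ArgsF B ρs}
                  {X : ArgsF Δ τs} → OccDecomp x H s → OccN (κ x) (hd (renH κ H) (renA κ s ++A X))
  occN-head-exp κ {x} {H} (inj₁ q) with he-idx q
  ... | refl with he-≡ q
  ... | refl = head
  occN-head-exp κ {x} {H} {s} {X} (inj₂ (σ , k , o)) =
    arg (bvar k) (subst (OccT _) (sym (trans (++A-!-bvar (renA κ s) X k) (renA-! κ s k))) (occT-ren κ o))

  mutual
    occN-img-ren : ∀ {B Γ Δ ρ a} (κ : Rn B Δ) (θ : ShallowSb B Γ Δ) {v : Var Γ ρ} {u : Var Δ ρ} → θ v ≡ ren u →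
                   {n : NfF Γ a} → OccN v n → OccN u (imgN κ θ n)
    occN-img-ren κ θ {v} e head rewrite e = head
    occN-img-ren κ θ e {hd (fun f) ts} (arg i o) = arg i (subst (OccT _) (sym (imgA-! κ θ ts i)) (occT-img-ren κ θ e o))
    occN-img-ren κ θ e {hd (var w) ts} (arg i o) with θ w
    ... | ren u' = arg i (subst (OccT _) (sym (imgA-! κ θ ts i)) (occT-img-ren κ θ e o))
    ... | exp H s = arg (wkV _ i) (subst (OccT _) (sym (trans (++A-!-wkV (renA κ s) (imgA κ θ ts) i) (imgA-! κ θ ts i)))
                                    (occT-img-ren κ θ e o))

    occT-img-ren : ∀ {B Γ Δ ρ σ} (κ : Rn B Δ) (θ : ShallowSb B Γ Δ) {v : Var Γ ρ} {u : Var Δ ρ} → θ v ≡ ren u →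
                   {t : TmF Γ σ} → OccT v t → OccT u (imgT κ θ t)
    occT-img-ren κ θ {v} {u} e (lam {σs = σs} o) =
      lam (occN-img-ren _ (liftSh σs θ) (trans (liftSh-wkV σs θ v) (trans (cong (wkShallows σs) e) (wkShallows-ren σs u))) o)

  mutual
    occN-img-exp : ∀ {B Γ Δ ρ a ρs τs b} (κ : Rn B Δ) (θ : ShallowSb B Γ Δ) {v : Var Γ (τs ⇒ b)}
                     {H : HeadF B ((ρs ++ τs) ⇒ b)} {s : ArgsF B ρs} {x : Var B ρ} → θ v ≡ exp H s → OccDecomp x H s →
                   {n : NfF Γ a} → OccN v n → OccN (κ x) (imgN κ θ n)
    occN-img-exp κ θ {v} {H} {s} e od (head {ts = ts}) rewrite e = occN-head-exp κ {H = H} {s = s} {X = imgA κ θ ts} od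
    occN-img-exp κ θ e od {hd (fun f) ts} (arg i o) = arg i (subst (OccT _) (sym (imgA-! κ θ ts i)) (occT-img-exp κ θ e od o))
    occN-img-exp κ θ e od {hd (var w) ts} (arg i o) with θ w
    ... | ren u' = arg i (subst (OccT _) (sym (imgA-! κ θ ts i)) (occT-img-exp κ θ e od o))
    ... | exp H s = arg (wkV _ i) (subst (OccT _) (sym (trans (++A-!-wkV (renA κ s) (imgA κ θ ts) i) (imgA-! κ θ ts i)))
                                    (occT-img-exp κ θ e od o))

    occT-img-exp : ∀ {B Γ Δ ρ σ ρs τs b} (κ : Rn B Δ) (θ : ShallowSb B Γ Δ) {v : Var Γ (τs ⇒ b)}
                     {H : HeadF B ((ρs ++ τs) ⇒ b)} {s : ArgsF B ρs} {x : Var B ρ} → θ v ≡ exp H s → OccDecomp x H s →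
                   {t : TmF Γ σ} → OccT v t → OccT (κ x) (imgT κ θ t)
    occT-img-exp κ θ {v} e od (lam {σs = σs} o) =
      lam (occN-img-exp _ (liftSh σs θ) (trans (liftSh-wkV σs θ v) (trans (cong (wkShallows σs) e) (wkShallows-exp σs))) od o)

  data OccSource {B Γ1 Γ2 : Ctx S} (κ : Rn B Γ2) (θ : ShallowSb B Γ1 Γ2) {ρ} (u : Var Γ2 ρ)
          (P : ∀ {σ} → Var Γ1 σ → Set) : Set where
    src-ren : (v : Var Γ1 ρ) → θ v ≡ ren u → P v → OccSource κ θ u P
    src-exp : ∀ {ρs τs b} (v : Var Γ1 (τs ⇒ b)) (H : HeadF B ((ρs ++ τs) ⇒ b)) (s : ArgsF B ρs) (x : Var B ρ) →
              θ v ≡ exp H s → P v → κ x ≡ u → OccDecomp x H s → OccSource κ θ u P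

  OccSource-map : ∀ {B Γ1 Γ2} {κ : Rn B Γ2} {θ : ShallowSb B Γ1 Γ2} {ρ} {u : Var Γ2 ρ}
                  {P Q : ∀ {σ} → Var Γ1 σ → Set} → (∀ {σ} {v : Var Γ1 σ} → P v → Q v) → OccSource κ θ u P → OccSource κ θ u Q
  OccSource-map f (src-ren v e p) = src-ren v e (f p)
  OccSource-map f (src-exp v H s x e p ek od) = src-exp v H s x e (f p) ek od

  mutual
    occN-img-source : ∀ {B Γ1 Γ2 ρ a} (κ : Rn B Γ2) (θ : ShallowSb B Γ1 Γ2) {u : Var Γ2 ρ} (n : NfF Γ1 a) →
                      OccN u (imgN κ θ n) → OccSource κ θ u (λ v → OccN v n)
    occN-img-source κ θ (hd (fun f) ts) o with occN-inv o
    ... | inj₁ q with he-idx q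
    ... | refl with he-≡ q
    ... | ()
    occN-img-source κ θ (hd (fun f) ts) o | inj₂ (_ , i , o') = OccSource-map (arg i) (occA-img-source κ θ ts i o')
    occN-img-source κ θ {u} (hd (var v) ts) o with θ v in eq
    ... | ren u' with occN-inv o
    ... | inj₁ q with var-inj-HE q
    ... | q' with he-idx q'
    ... | refl with he-≡ q'
    ... | refl = src-ren v eq head
    occN-img-source κ θ {u} (hd (var v) ts) o | ren u' | inj₂ (_ , i , o') = OccSource-map (arg i) (occA-img-source κ θ ts i o')
    occN-img-source κ θ {u} (hd (var v) ts) o | exp {ρs = ρs} H s with occN-inv o
    ... | inj₁ q = occHead-img-source κ θ ts v H s eq q
    ... | inj₂ (_ , i , o') with binderView {Γ = _} ρs i
    ... | binder k with occT-unren κ (s ! k) (subst (OccT u) (trans (++A-!-bvar (renA κ s) (imgA κ θ ts) k) (renA-! κ s k)) o')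
    ... | x , exx , ox = src-exp v H s x eq head exx (inj₂ (_ , k , ox))
    occN-img-source κ θ {u} (hd (var v) ts) o | exp {ρs = ρs} H s | inj₂ (_ , i , o') | outer k =
      OccSource-map (arg k) (occA-img-source κ θ ts k (subst (OccT u) (++A-!-wkV (renA κ s) (imgA κ θ ts) k) o'))

    occHead-img-source : ∀ {B Γ1 Γ2 ρ ρs τs b} (κ : Rn B Γ2) (θ : ShallowSb B Γ1 Γ2) {u : Var Γ2 ρ} (ts : ArgsF Γ1 τs)
                           (v : Var Γ1 (τs ⇒ b)) (H : HeadF B ((ρs ++ τs) ⇒ b)) (s : ArgsF B ρs) → θ v ≡ exp H s →
                         HE (HeadF Γ2) (renH κ H) (var u) → OccSource κ θ u (λ v' → OccN v' (hd (var v) ts))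
    occHead-img-source κ θ ts v (var x) s eq q with var-inj-HE q
    ... | q' with he-idx q'
    ... | refl = src-exp v (var x) s x eq head (he-≡ q') (inj₁ he)
    occHead-img-source κ θ ts v (fun f) s eq q with he-idx q
    ... | refl with he-≡ q
    ... | ()

    occA-img-source : ∀ {B Γ1 Γ2 ρ L σ} (κ : Rn B Γ2) (θ : ShallowSb B Γ1 Γ2) {u : Var Γ2 ρ} (ts : ArgsF Γ1 L) (i : Var L σ) →
                      OccT u (imgA κ θ ts ! i) → OccSource κ θ u (λ v → OccT v (ts ! i))
    occA-img-source κ θ (t ∷ ts) here o = occT-img-source κ θ t o
    occA-img-source κ θ (t ∷ ts) (there i) o = occA-img-source κ θ ts i o

    occT-img-source : ∀ {B Γ1 Γ2 ρ σ} (κ : Rn B Γ2) (θ : ShallowSb B Γ1 Γ2) {u : Var Γ2 ρ} (t : TmF Γ1 σ) →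
                      OccT u (imgT κ θ t) → OccSource κ θ u (λ v → OccT v t)
    occT-img-source κ θ {u} (lam {σs} w) (lam o) with occN-img-source _ (liftSh σs θ) w o
    ... | src-ren v' e o' with liftSh-ren-inv σs θ v' e
    ... | lifted-binder k ev eu = ⊥-elim (bvar≢wkV σs k u (sym eu))
    ... | lifted-outer v0 u0 refl eu e0 with wkV-inj σs eu
    ... | refl = src-ren v0 e0 (lam o')
    occT-img-source κ θ {u} (lam {σs} w) (lam o) | src-exp v' H s x e o' ek od with liftSh-exp-inv σs θ v' e
    ... | v0 , refl , e0 = src-exp v0 H s x e0 (lam o') (wkV-inj σs ek) od

  hasOcc-ren : ∀ {Γ Δ σ} (ρ : Rn Γ Δ) {t : TmF Γ σ} → HasOcc t → HasOcc (renT ρ t)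
  hasOcc-ren ρ (_ , x , o) = _ , ρ x , occT-ren ρ o

  hasOcc-unren : ∀ {Γ Δ σ} (ρ : Rn Γ Δ) (t : TmF Γ σ) → HasOcc (renT ρ t) → HasOcc t
  hasOcc-unren ρ t (_ , u , o) with occT-unren ρ t o
  ... | x , _ , o' = _ , x , o'

  FunArgsOcc : ∀ {Γ1 ρs τs b} → HeadF Γ1 ((ρs ++ τs) ⇒ b) → ArgsF Γ1 ρs → Set
  FunArgsOcc {ρs = ρs} g r = ∀ {f} → g ≡ fun f → Σ (Ty S) λ σ → Σ (Var ρs σ) λ p → HasOcc (r ! p)

  aligned-occ : ∀ {Δ LX LY LA LR} (X : ArgsF Δ LX) {Y : ArgsF Δ LY} (A : ArgsF Δ LA) {R : ArgsF Δ LR} →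
                HE (ArgsF Δ) (X ++A Y) (A ++A R) →
                (Σ (Ty S) λ σ → Σ (Var LX σ) λ k → HasOcc (X ! k)) →
                (Σ (Ty S) λ σ → Σ (Var LA σ) λ p → HasOcc (A ! p)) →
                Σ (Ty S) λ σ1 → Σ (Var LX σ1) λ k → Σ (Ty S) λ σ2 → Σ (Var LA σ2) λ p →
                  HE (TmF Δ) (X ! k) (A ! p) × (HasOcc (X ! k) ⊎ HasOcc (A ! p))
  aligned-occ [] A q (_ , () , _) _
  aligned-occ (x ∷ X) [] q _ (_ , () , _)
  aligned-occ (x ∷ X) (a ∷ A) q (σ , here , hx) _ = _ , here , _ , here , proj₁ (∷-inj-HE q) , inj₁ hx
  aligned-occ (x ∷ X) (a ∷ A) q (σ , there k , hx) (σ' , here , ha) = _ , here , _ , here , proj₁ (∷-inj-HE q) , inj₂ ha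
  aligned-occ (x ∷ X) (a ∷ A) q (σ , there k , hx) (σ' , there p , ha)
    with aligned-occ X A (proj₂ (∷-inj-HE q)) (σ , k , hx) (σ' , p , ha)
  ... | σ1 , k' , σ2 , p' , e , o = σ1 , there k' , σ2 , there p' , e , o

  -- Matches

  -- MatchN h0 ts0 κ n: some subterm of n is h0(ts0, …) seen through κ; a structurally
  -- recursive form of _⊵E_.
  mutual
    data MatchN {D0 : Ctx S} {ρs τs : Ctx S} {b : S} (h0 : HeadF D0 ((ρs ++ τs) ⇒ b)) (ts0 : ArgsF D0 ρs) :
            ∀ {Δ} → Rn D0 Δ → ∀ {a} → NfF Δ a → Set where
      mhere : ∀ {Δ} {κ : Rn D0 Δ} {n : NfF Δ b} (rest : ArgsF Δ τs) →
              n ≡ hd (renH κ h0) (renA κ ts0 ++A rest) → MatchN h0 ts0 κ n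
      marg : ∀ {Δ} {κ : Rn D0 Δ} {a L σ} {h : HeadF Δ (L ⇒ a)} {as : ArgsF Δ L} (i : Var L σ) →
             MatchT h0 ts0 κ (as ! i) → MatchN h0 ts0 κ (hd h as)

    data MatchT {D0 : Ctx S} {ρs τs : Ctx S} {b : S} (h0 : HeadF D0 ((ρs ++ τs) ⇒ b)) (ts0 : ArgsF D0 ρs) :
            ∀ {Δ} → Rn D0 Δ → ∀ {σ} → TmF Δ σ → Set where
      mlam : ∀ {Δ} {κ : Rn D0 Δ} {σs a} {w : NfF (σs ++ Δ) a} →
             MatchN h0 ts0 (λ x → wkV σs (κ x)) w → MatchT h0 ts0 κ (lam w)

  module _ {D0 : Ctx S} {ρs τs : Ctx S} {b : S} {h0 : HeadF D0 ((ρs ++ τs) ⇒ b)} {ts0 : ArgsF D0 ρs} where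

    mutual
      MatchN-ext : ∀ {Δ a} {κ κ' : Rn D0 Δ} → (∀ {σ} (x : Var D0 σ) → κ x ≡ κ' x) → {n : NfF Δ a} →
                   MatchN h0 ts0 κ n → MatchN h0 ts0 κ' n
      MatchN-ext e (mhere rest eq) = mhere rest (trans eq (cong₂ (λ H X → hd H X) (renH-ext e h0) (cong (_++A rest) (renA-ext e ts0))))
      MatchN-ext e (marg i m) = marg i (MatchT-ext e m)

      MatchT-ext : ∀ {Δ σ} {κ κ' : Rn D0 Δ} → (∀ {σ} (x : Var D0 σ) → κ x ≡ κ' x) → {t : TmF Δ σ} →
                   MatchT h0 ts0 κ t → MatchT h0 ts0 κ' t
      MatchT-ext e (mlam {σs = σs} m) = mlam (MatchN-ext (λ x → cong (wkV σs) (e x)) m)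

    mutual
      MatchN-ren : ∀ {Δ Δ' a} {κ : Rn D0 Δ} {n : NfF Δ a} → MatchN h0 ts0 κ n → (ρ : Rn Δ Δ') →
                   MatchN h0 ts0 (λ x → ρ (κ x)) (renN ρ n)
      MatchN-ren {κ = κ} (mhere rest eq) ρ =
        mhere (renA ρ rest) (trans (cong (renN ρ) eq)
          (cong₂ hd (renH-comp ρ κ h0) (trans (renA-++ ρ (renA κ ts0) rest) (cong (_++A renA ρ rest) (renA-comp ρ κ ts0)))))
      MatchN-ren (marg {as = as} i m) ρ = marg i (subst (MatchT h0 ts0 _) (sym (renA-! ρ as i)) (MatchT-ren m ρ))

      MatchT-ren : ∀ {Δ Δ' σ} {κ : Rn D0 Δ} {t : TmF Δ σ} → MatchT h0 ts0 κ t → (ρ : Rn Δ Δ') →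
                   MatchT h0 ts0 (λ x → ρ (κ x)) (renT ρ t)
      MatchT-ren {κ = κ} (mlam {σs = σs} m) ρ = mlam (MatchN-ext (λ x → liftR-wkV σs ρ (κ x)) (MatchN-ren m (liftR σs ρ)))

  mutual
    sizeT : ∀ {Δ σ} → TmF Δ σ → ℕ
    sizeT (lam w) = sizeN w
    sizeN : ∀ {Δ a} → NfF Δ a → ℕ
    sizeN (hd h as) = suc (sizeA as)
    sizeA : ∀ {Δ L} → ArgsF Δ L → ℕ
    sizeA [] = zero
    sizeA (t ∷ ts) = sizeT t + sizeA ts

  mutual
    size-renT : ∀ {Γ Δ σ} (ρ : Rn Γ Δ) (t : TmF Γ σ) → sizeT (renT ρ t) ≡ sizeT t
    size-renT ρ (lam {σs} w) = size-renN (liftR σs ρ) w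
    size-renN : ∀ {Γ Δ a} (ρ : Rn Γ Δ) (n : NfF Γ a) → sizeN (renN ρ n) ≡ sizeN n
    size-renN ρ (hd h as) = cong suc (size-renA ρ as)
    size-renA : ∀ {Γ Δ L} (ρ : Rn Γ Δ) (as : ArgsF Γ L) → sizeA (renA ρ as) ≡ sizeA as
    size-renA ρ [] = refl
    size-renA ρ (t ∷ ts) = cong₂ _+_ (size-renT ρ t) (size-renA ρ ts)

  size-! : ∀ {Δ L σ} (as : ArgsF Δ L) (i : Var L σ) → sizeT (as ! i) ≤ sizeA as
  size-! (t ∷ ts) here = m≤m+n (sizeT t) (sizeA ts)
  size-! (t ∷ ts) (there i) = ≤-trans (size-! ts i) (m≤n+m (sizeA ts) (sizeT t))

  module _ {D0 : Ctx S} {ρs τs : Ctx S} {b : S} {h0 : HeadF D0 ((ρs ++ τs) ⇒ b)} {ts0 : ArgsF D0 ρs} where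
    mutual
      MatchN-size : ∀ {Δ a} {κ : Rn D0 Δ} {n : NfF Δ a} → MatchN h0 ts0 κ n → ∀ {σ} (k : Var ρs σ) → sizeT (ts0 ! k) < sizeN n
      MatchN-size {κ = κ} (mhere rest refl) k =
        s≤s (subst (λ z → z ≤ sizeA (renA κ ts0 ++A rest))
                   (trans (cong sizeT (trans (++A-!-bvar (renA κ ts0) rest k) (renA-! κ ts0 k))) (size-renT κ (ts0 ! k)))
                   (size-! (renA κ ts0 ++A rest) (bvar k)))
      MatchN-size (marg {as = as} i m) k = ≤-trans (MatchT-size m k) (m≤n⇒m≤1+n (size-! as i))

      MatchT-size : ∀ {Δ σ'} {κ : Rn D0 Δ} {t : TmF Δ σ'} → MatchT h0 ts0 κ t → ∀ {σ} (k : Var ρs σ) → sizeT (ts0 ! k) < sizeT t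
      MatchT-size (mlam m) k = MatchN-size m k

    ¬MatchT-entry : ∀ {σ} (k : Var ρs σ) → ¬ MatchT h0 ts0 (λ x → x) (ts0 ! k)
    ¬MatchT-entry k mt = <-irrefl refl (MatchT-size mt k)

    mutual
      MatchN-occ-arg : ∀ {Δ a ρ σ} {κ : Rn D0 Δ} {n : NfF Δ a} → MatchN h0 ts0 κ n → (p : Var ρs σ) {u : Var D0 ρ} →
                       OccT u (ts0 ! p) → OccN (κ u) n
      MatchN-occ-arg {κ = κ} (mhere rest refl) p o =
        arg (bvar p) (subst (OccT _) (sym (trans (++A-!-bvar (renA κ ts0) rest p) (renA-! κ ts0 p))) (occT-ren κ o))
      MatchN-occ-arg (marg i m) p o = arg i (MatchT-occ-arg m p o)

      MatchT-occ-arg : ∀ {Δ σ' ρ σ} {κ : Rn D0 Δ} {t : TmF Δ σ'} → MatchT h0 ts0 κ t → (p : Var ρs σ) {u : Var D0 ρ} →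
                       OccT u (ts0 ! p) → OccT (κ u) t
      MatchT-occ-arg (mlam m) p o = lam (MatchN-occ-arg m p o)

    mutual
      MatchN-trans : ∀ {Δ a σ D1 ρs1 τs1 b1} {H1 : HeadF D1 ((ρs1 ++ τs1) ⇒ b1)} {s1 : ArgsF D1 ρs1} {κ2 : Rn D1 D0}
                     {κ : Rn D0 Δ} {n : NfF Δ a} → MatchN h0 ts0 κ n → (p : Var ρs σ) →
                     MatchT H1 s1 κ2 (ts0 ! p) → MatchN H1 s1 (λ x → κ (κ2 x)) n
      MatchN-trans {κ = κ} (mhere rest refl) p m2 =
        marg (bvar p) (subst (MatchT _ _ _) (sym (trans (++A-!-bvar (renA κ ts0) rest p) (renA-! κ ts0 p))) (MatchT-ren m2 κ))
      MatchN-trans (marg i m) p m2 = marg i (MatchT-trans m p m2)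

      MatchT-trans : ∀ {Δ σ' σ D1 ρs1 τs1 b1} {H1 : HeadF D1 ((ρs1 ++ τs1) ⇒ b1)} {s1 : ArgsF D1 ρs1} {κ2 : Rn D1 D0}
                     {κ : Rn D0 Δ} {t : TmF Δ σ'} → MatchT h0 ts0 κ t → (p : Var ρs σ) →
                     MatchT H1 s1 κ2 (ts0 ! p) → MatchT H1 s1 (λ x → κ (κ2 x)) t
      MatchT-trans (mlam m) p m2 = mlam (MatchN-trans m p m2)

    mutual
      SubN⇒MatchN : ∀ {Δ Δ' a} {n : NfF Δ a} {e : ExtF Δ Δ'} {r : NfF Δ' b} → SubN n e r →
                    (κ : Rn D0 Δ) (rest : ArgsF Δ' τs) →
                    r ≡ hd (renH (λ x → inj e (κ x)) h0) (renA (λ x → inj e (κ x)) ts0 ++A rest) → MatchN h0 ts0 κ n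
      SubN⇒MatchN self κ rest eq = mhere rest eq
      SubN⇒MatchN (arg i p) κ rest eq = marg i (SubT⇒MatchT p κ rest eq)

      SubT⇒MatchT : ∀ {Δ Δ' σ} {t : TmF Δ σ} {e : ExtF Δ Δ'} {r : NfF Δ' b} → SubT t e r →
                    (κ : Rn D0 Δ) (rest : ArgsF Δ' τs) →
                    r ≡ hd (renH (λ x → inj e (κ x)) h0) (renA (λ x → inj e (κ x)) ts0 ++A rest) → MatchT h0 ts0 κ t
      SubT⇒MatchT (lam {σs = σs} p) κ rest eq = mlam (SubN⇒MatchN p (λ x → wkV σs (κ x)) rest eq)

    mutual
      MatchN⇒SubN : ∀ {Δ a} {κ : Rn D0 Δ} {n : NfF Δ a} → MatchN h0 ts0 κ n →
                    Σ (Ctx S) λ Δ' → Σ (ExtF Δ Δ') λ e → Σ (ArgsF Δ' τs) λ rest →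
                    SubN n e (hd (renH (λ x → inj e (κ x)) h0) (renA (λ x → inj e (κ x)) ts0 ++A rest))
      MatchN⇒SubN {n = n} (mhere rest eq) = _ , stop , rest , subst (SubN n stop) eq self
      MatchN⇒SubN (marg i m) with MatchT⇒SubT m
      ... | Δ' , e , rest , p = Δ' , e , rest , arg i p

      MatchT⇒SubT : ∀ {Δ σ} {κ : Rn D0 Δ} {t : TmF Δ σ} → MatchT h0 ts0 κ t →
                    Σ (Ctx S) λ Δ' → Σ (ExtF Δ Δ') λ e → Σ (ArgsF Δ' τs) λ rest →
                    SubT t e (hd (renH (λ x → inj e (κ x)) h0) (renA (λ x → inj e (κ x)) ts0 ++A rest))
      MatchT⇒SubT (mlam {σs = σs} m) with MatchN⇒SubN m
      ... | Δ' , e , rest , p = Δ' , under σs e , rest , lam p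

  module _ {D0 : Ctx S} {ρs τs : Ctx S} {b : S} {h0 : HeadF D0 ((ρs ++ τs) ⇒ b)} {ts0 : ArgsF D0 ρs} where
    mutual
      MatchN-unren : ∀ {Γ Δ a} {κ : Rn D0 Γ} (ρ : Rn Γ Δ) → InjectiveRen ρ → (n : NfF Γ a) →
                     MatchN h0 ts0 (λ x → ρ (κ x)) (renN ρ n) → MatchN h0 ts0 κ n
      MatchN-unren {κ = κ} ρ i (hd h as) (mhere rest eq) with hd-inj eq
      ... | q1 , q2 with unren-prefix ρ i as (renA κ ts0)
                          (subst (λ z → HE (ArgsF _) (renA ρ as) (z ++A rest)) (sym (renA-comp ρ κ ts0)) q2)
      ... | (M , R'') , r with trans (sym (he-idx r)) (⇒-injˡ (he-idx q1))
      ... | e1 with ++-cancelˡ ρs M τs e1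
      ... | refl = mhere R''
                       (hd-cong-HE (renH-injHE ρ i (subst (HE (HeadF _) (renH ρ h)) (sym (renH-comp ρ κ h0)) q1)) r)
      MatchN-unren ρ i (hd h as) (marg j m) = marg j (MatchA-unren ρ i as j m)

      MatchA-unren : ∀ {Γ Δ L σ} {κ : Rn D0 Γ} (ρ : Rn Γ Δ) → InjectiveRen ρ → (as : ArgsF Γ L) (j : Var L σ) →
                     MatchT h0 ts0 (λ x → ρ (κ x)) (renA ρ as ! j) → MatchT h0 ts0 κ (as ! j)
      MatchA-unren ρ i (a ∷ as) here m = MatchT-unren ρ i a m
      MatchA-unren ρ i (a ∷ as) (there j) m = MatchA-unren ρ i as j m

      MatchT-unren : ∀ {Γ Δ σ} {κ : Rn D0 Γ} (ρ : Rn Γ Δ) → InjectiveRen ρ → (t : TmF Γ σ) →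
                     MatchT h0 ts0 (λ x → ρ (κ x)) (renT ρ t) → MatchT h0 ts0 κ t
      MatchT-unren {κ = κ} ρ i (lam {σs} w) (mlam m) =
        mlam (MatchN-unren (liftR σs ρ) (liftR-inj σs ρ i) w (MatchN-ext (λ x → sym (liftR-wkV σs ρ (κ x))) m))

  module _ {D0 : Ctx S} {ρs τs : Ctx S} {b : S} {u : Var D0 ((ρs ++ τs) ⇒ b)} {ts0 : ArgsF D0 ρs} where
    mutual
      MatchN-occ-head : ∀ {Δ a} {κ : Rn D0 Δ} {n : NfF Δ a} → MatchN (var u) ts0 κ n → OccN (κ u) n
      MatchN-occ-head (mhere rest refl) = head
      MatchN-occ-head (marg i m) = arg i (MatchT-occ-head m)

      MatchT-occ-head : ∀ {Δ σ} {κ : Rn D0 Δ} {t : TmF Δ σ} → MatchT (var u) ts0 κ t → OccT (κ u) t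
      MatchT-occ-head (mlam m) = lam (MatchN-occ-head m)

  mutual
    MatchN-weaken : ∀ {B D0 ρH τH ρX τs bH b} {H : HeadF B ((ρH ++ τH) ⇒ bH)} {s : ArgsF B ρH}
                      {κ : Rn B D0} {h0 : HeadF D0 (((ρH ++ ρX) ++ τs) ⇒ b)} {X : ArgsF D0 ρX}
                      {Δ a} {μ : Rn D0 Δ} {n : NfF Δ a} → HE (HeadF D0) h0 (renH κ H) →
                    MatchN h0 (renA κ s ++A X) μ n → MatchN H s (λ x → μ (κ x)) n
    MatchN-weaken {ρH = ρH} {τH} {ρX} {τs} {bH} {b} hh m
      with ++-cancelˡ ρH (ρX ++ τs) τH (trans (sym (++-assoc ρH ρX τs)) (⇒-injˡ (he-idx hh))) | ⇒-injʳ (he-idx hh)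
    MatchN-weaken {ρH = ρH} {τH} {ρX} {τs} {bH} {b} {H} {s} {κ} {h0} {X} {μ = μ} hh (mhere rest eq) | refl | refl =
      mhere (renA μ X ++A rest)
        (trans eq (hd-cong-HE (he-trans (renH-cong-HE μ hh) (≡-he (renH-comp μ κ H)))
          (he-trans (≡-he (cong (_++A rest) (trans (renA-++ μ (renA κ s) X) (cong (_++A renA μ X) (renA-comp μ κ s)))))
                    (++A-assoc (renA (λ x → μ (κ x)) s) (renA μ X) rest))))
    MatchN-weaken hh (marg i m) | refl | refl = marg i (MatchT-weaken hh m)

    MatchT-weaken : ∀ {B D0 ρH τH ρX τs bH b} {H : HeadF B ((ρH ++ τH) ⇒ bH)} {s : ArgsF B ρH}
                      {κ : Rn B D0} {h0 : HeadF D0 (((ρH ++ ρX) ++ τs) ⇒ b)} {X : ArgsF D0 ρX}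
                      {Δ σ} {μ : Rn D0 Δ} {t : TmF Δ σ} → HE (HeadF D0) h0 (renH κ H) →
                    MatchT h0 (renA κ s ++A X) μ t → MatchT H s (λ x → μ (κ x)) t
    MatchT-weaken hh (mlam m) = mlam (MatchN-weaken hh m)

  renA-injHE : ∀ {Γ Δ L1 L2} (ρ : Rn Γ Δ) → InjectiveRen ρ → {X1 : ArgsF Γ L1} {X2 : ArgsF Γ L2} →
               HE (ArgsF Δ) (renA ρ X1) (renA ρ X2) → HE (ArgsF Γ) X1 X2
  renA-injHE ρ i {X1} {X2} q with he-idx q
  ... | refl = ≡-he (renA-inj ρ i X1 X2 (he-≡ q))

  imgA-expArgs : ∀ {B Γ Δ ρs} τs (κ : Rn B Δ) (θ : ShallowSb B Γ Δ) (r : ArgsF Γ ρs) →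
                 imgA (λ x → wkV τs (κ x)) (liftSh τs θ) (renA (wkV τs) r ++A etaBinders τs) ≡
                 renA (wkV τs) (imgA κ θ r) ++A etaBinders τs
  imgA-expArgs τs κ θ r =
    trans (imgA-++ _ (liftSh τs θ) (renA (wkV τs) r) (etaBinders τs))
          (cong₂ _++A_ (imgA-wkV τs κ θ r) (img-etas τs _ (liftSh τs θ) bvar bvar (liftSh-bvar τs θ)))

  imgT-expTm-fun : ∀ {B Γ Δ ρs τs b} (κ : Rn B Δ) (θ : ShallowSb B Γ Δ) (f : F ((ρs ++ τs) ⇒ b)) (r : ArgsF Γ ρs) →
                   imgT κ θ (expTm (fun f) r) ≡ expTm (fun f) (imgA κ θ r)
  imgT-expTm-fun {τs = τs} κ θ f r = cong lam (cong (hd (fun f)) (imgA-expArgs τs κ θ r))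

  imgT-expTm-ren : ∀ {B Γ Δ ρs τs b} (κ : Rn B Δ) (θ : ShallowSb B Γ Δ) (v : Var Γ ((ρs ++ τs) ⇒ b)) (u : Var Δ _) →
                   θ v ≡ ren u → (r : ArgsF Γ ρs) → imgT κ θ (expTm (var v) r) ≡ expTm (var u) (imgA κ θ r)
  imgT-expTm-ren {τs = τs} κ θ v u e r =
    trans (cong (λ c → lam (imgHd (λ x → wkV τs (κ x)) (liftSh τs θ) c (renA (wkV τs) r ++A etaBinders τs)))
                (trans (liftSh-wkV τs θ v) (trans (cong (wkShallows τs) e) (wkShallows-ren τs u))))
          (cong lam (cong (hd (var (wkV τs u))) (imgA-expArgs τs κ θ r)))

  imgT-expTm-exp : ∀ {B Γ Δ ρs τs b ρH} (κ : Rn B Δ) (θ : ShallowSb B Γ Δ) (v : Var Γ ((ρs ++ τs) ⇒ b))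
                     (H : HeadF B ((ρH ++ (ρs ++ τs)) ⇒ b)) (s : ArgsF B ρH) →
                   θ v ≡ exp H s → (r : ArgsF Γ ρs) →
                   imgT κ θ (expTm (var v) r) ≡
                   lam (hd (renH (wkV τs) (renH κ H)) (renA (wkV τs) (renA κ s) ++A (renA (wkV τs) (imgA κ θ r) ++A etaBinders τs)))
  imgT-expTm-exp {τs = τs} κ θ v H s e r =
    trans (cong (λ c → lam (imgHd (λ x → wkV τs (κ x)) (liftSh τs θ) c (renA (wkV τs) r ++A etaBinders τs)))
                (trans (liftSh-wkV τs θ v) (trans (cong (wkShallows τs) e) (wkShallows-exp τs))))
          (cong lam (cong₂ hd (sym (renH-comp (wkV τs) κ H))
             (cong₂ _++A_ (sym (renA-comp (wkV τs) κ s)) (imgA-expArgs τs κ θ r))))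

  expTm-inj : ∀ {Δ ρs1 ρs2 τs b} (h1 : HeadF Δ ((ρs1 ++ τs) ⇒ b)) (ts1 : ArgsF Δ ρs1)
                (h2 : HeadF Δ ((ρs2 ++ τs) ⇒ b)) (ts2 : ArgsF Δ ρs2) →
              expTm h1 ts1 ≡ expTm h2 ts2 → HE (HeadF Δ) h1 h2 × HE (ArgsF Δ) ts1 ts2
  expTm-inj {τs = τs} h1 ts1 h2 ts2 e with hd-inj (lam-inj e)
  ... | p , q = renH-injHE (wkV τs) (wkV-inj τs) p ,
                renA-injHE (wkV τs) (wkV-inj τs) (++A-cancelʳ (etaBinders τs) q)

  expTm-inj-exp : ∀ {B Δ ρs1 ρH ρX τs b} (κ : Rn B Δ) (h1 : HeadF Δ ((ρs1 ++ τs) ⇒ b)) (ts1 : ArgsF Δ ρs1)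
                    (H : HeadF B ((ρH ++ (ρX ++ τs)) ⇒ b)) (s : ArgsF B ρH) (X : ArgsF Δ ρX) →
                  expTm h1 ts1 ≡ lam (hd (renH (wkV τs) (renH κ H)) (renA (wkV τs) (renA κ s) ++A (renA (wkV τs) X ++A etaBinders τs))) →
                  HE (HeadF Δ) h1 (renH κ H) × HE (ArgsF Δ) ts1 (renA κ s ++A X)
  expTm-inj-exp {τs = τs} κ h1 ts1 H s X e with hd-inj (lam-inj e)
  ... | p , q = renH-injHE (wkV τs) (wkV-inj τs) p ,
                renA-injHE (wkV τs) (wkV-inj τs)
                  (he-trans (++A-cancelʳ (etaBinders τs)
                              (he-trans q (he-sym (++A-assoc (renA (wkV τs) (renA κ s)) (renA (wkV τs) X) (etaBinders τs)))))
                            (≡-he (sym (renA-++ (wkV τs) (renA κ s) X))))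

  data ImgExpansion {B Γ1 Γ2 : Ctx S} (κ : Rn B Γ2) (θ : ShallowSb B Γ1 Γ2) {ρs τs : Ctx S} {b : S}
          (g : HeadF Γ1 ((ρs ++ τs) ⇒ b)) (r : ArgsF Γ1 ρs)
          {ρs' : Ctx S} (h : HeadF Γ2 ((ρs' ++ τs) ⇒ b)) (ts : ArgsF Γ2 ρs') : Set where
    via-fun : ∀ {f} → g ≡ fun f → HE (HeadF Γ2) h (fun {F = F} {Γ = Γ2} f) → HE (ArgsF Γ2) ts (imgA κ θ r) → ImgExpansion κ θ g r h ts
    via-ren : ∀ {v u} → g ≡ var v → θ v ≡ ren u → HE (HeadF Γ2) h (var u) → HE (ArgsF Γ2) ts (imgA κ θ r) → ImgExpansion κ θ g r h ts
    via-exp : ∀ {v ρH} {H : HeadF B ((ρH ++ (ρs ++ τs)) ⇒ b)} {s : ArgsF B ρH} → g ≡ var v → θ v ≡ exp H s →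
             HE (HeadF Γ2) h (renH κ H) → HE (ArgsF Γ2) ts (renA κ s ++A imgA κ θ r) → ImgExpansion κ θ g r h ts

  imgExpansion : ∀ {B Γ1 Γ2 ρs τs b ρs'} (κ : Rn B Γ2) (θ : ShallowSb B Γ1 Γ2) (g : HeadF Γ1 ((ρs ++ τs) ⇒ b)) (r : ArgsF Γ1 ρs)
                   (h : HeadF Γ2 ((ρs' ++ τs) ⇒ b)) (ts : ArgsF Γ2 ρs') →
                 ExpandedAs h ts (imgT κ θ (expTm g r)) → ImgExpansion κ θ g r h ts
  imgExpansion κ θ (fun f) r h ts e with expTm-inj h ts (fun f) (imgA κ θ r) (trans (sym e) (imgT-expTm-fun κ θ f r))
  ... | p , q = via-fun refl p q
  imgExpansion κ θ (var v) r h ts e with θ v in eq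
  ... | ren u with expTm-inj h ts (var u) (imgA κ θ r) (trans (sym e) (imgT-expTm-ren κ θ v u eq r))
  ... | p , q = via-ren refl eq p q
  imgExpansion κ θ (var v) r h ts e | exp H s with expTm-inj-exp κ h ts H s (imgA κ θ r) (trans (sym e) (imgT-expTm-exp κ θ v H s eq r))
  ... | p , q = via-exp refl eq p q

  imgT-Expanded : ∀ {B Γ1 Γ2 ρs τs b} (κ : Rn B Γ2) (θ : ShallowSb B Γ1 Γ2) (g : HeadF Γ1 ((ρs ++ τs) ⇒ b)) (r : ArgsF Γ1 ρs) →
                  Expanded (imgT κ θ (expTm g r))
  imgT-Expanded κ θ (fun f) r = _ , fun f , imgA κ θ r , imgT-expTm-fun κ θ f r
  imgT-Expanded κ θ (var v) r with θ v in eq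
  ... | ren u = _ , var u , imgA κ θ r , imgT-expTm-ren κ θ v u eq r
  imgT-Expanded {Γ2 = Γ2} {ρs} {τs} {b} κ θ (var v) r | exp {ρs = ρH} H s =
    (ρH ++ ρs) , subst (λ L → HeadF Γ2 (L ⇒ b)) (sym (++-assoc ρH ρs τs)) (renH κ H) , renA κ s ++A imgA κ θ r ,
    trans (imgT-expTm-exp κ θ v H s eq r)
      (cong lam (hd-cong-HE (renH-cong-HE (wkV τs) (he-sym (subst-HE (sym (++-assoc ρH ρs τs)) (renH κ H))))
                       (he-trans (he-sym (++A-assoc (renA (wkV τs) (renA κ s)) (renA (wkV τs) (imgA κ θ r)) (etaBinders τs)))
                                 (≡-he (cong (_++A etaBinders τs) (sym (renA-++ (wkV τs) (renA κ s) (imgA κ θ r))))))))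

  decomp-inj : ∀ {B ρs1 ρs2 τs b} {H1 : HeadF B ((ρs1 ++ τs) ⇒ b)} {H2 : HeadF B ((ρs2 ++ τs) ⇒ b)}
               {s1 : ArgsF B ρs1} {s2 : ArgsF B ρs2} → decomp H1 s1 ≡ decomp H2 s2 → HE (HeadF B) H1 H2 × HE (ArgsF B) s1 s2
  decomp-inj refl = he , he

  shallowOf-inj : ∀ {B Δ ρs τs b} (c : Decomp B (τs ⇒ b)) {H : HeadF B ((ρs ++ τs) ⇒ b)} {s : ArgsF B ρs} →
                  shallowOf {Δ = Δ} c ≡ exp H s → c ≡ decomp H s
  shallowOf-inj (decomp H' s') e with exp-inj e
  ... | he , he = refl

  OccDecomp⇒OccT : ∀ {Δ ρ ρs τs b} {x : Var Δ ρ} {H : HeadF Δ ((ρs ++ τs) ⇒ b)} {s : ArgsF Δ ρs} →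
                   OccDecomp x H s → OccT x (expTm H s)
  OccDecomp⇒OccT {H = H} (inj₁ q) with he-idx q
  ... | refl with he-≡ q
  ... | refl = lam head
  OccDecomp⇒OccT {τs = τs} {H = H} {s} (inj₂ (σ , k , o)) =
    lam (arg (bvar k) (subst (OccT _) (sym (trans (++A-!-bvar (renA (wkV τs) s) (etaBinders τs) k) (renA-! (wkV τs) s k)))
                         (occT-ren (wkV τs) o)))

  mutual
    MatchN-img-exp : ∀ {B Γ Δ a ρs τs b} (κ : Rn B Δ) (θ : ShallowSb B Γ Δ) {v : Var Γ (τs ⇒ b)}
                       {H : HeadF B ((ρs ++ τs) ⇒ b)} {s : ArgsF B ρs} → θ v ≡ exp H s →
                     {n : NfF Γ a} → OccN v n → MatchN H s κ (imgN κ θ n)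
    MatchN-img-exp κ θ {v} e (head {ts = ts}) rewrite e = mhere (imgA κ θ ts) refl
    MatchN-img-exp κ θ e {hd (fun f) ts} (arg i o) = marg i (subst (MatchT _ _ κ) (sym (imgA-! κ θ ts i)) (MatchT-img-exp κ θ e o))
    MatchN-img-exp κ θ e {hd (var w) ts} (arg i o) with θ w
    ... | ren u' = marg i (subst (MatchT _ _ κ) (sym (imgA-! κ θ ts i)) (MatchT-img-exp κ θ e o))
    ... | exp H' s' = marg (wkV _ i) (subst (MatchT _ _ κ) (sym (trans (++A-!-wkV (renA κ s') (imgA κ θ ts) i) (imgA-! κ θ ts i)))
                                    (MatchT-img-exp κ θ e o))

    MatchT-img-exp : ∀ {B Γ Δ σ ρs τs b} (κ : Rn B Δ) (θ : ShallowSb B Γ Δ) {v : Var Γ (τs ⇒ b)}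
                       {H : HeadF B ((ρs ++ τs) ⇒ b)} {s : ArgsF B ρs} → θ v ≡ exp H s →
                     {t : TmF Γ σ} → OccT v t → MatchT H s κ (imgT κ θ t)
    MatchT-img-exp κ θ {v} e (lam {σs = σs} o) =
      mlam (MatchN-img-exp _ (liftSh σs θ) (trans (liftSh-wkV σs θ v) (trans (cong (wkShallows σs) e) (wkShallows-exp σs))) o)

  fun≢var : ∀ {Γ σ1 σ2} {f : F σ1} {u : Var Γ σ2} → HE (HeadF Γ) (fun f) (var u) → ⊥
  fun≢var q with he-idx q
  ... | refl with he-≡ q
  ... | ()

  fun-HE : ∀ {Γa Γb σ1 σ2} {f1 : F σ1} {f2 : F σ2} → HE (HeadF Γa) (fun f1) (fun f2) → HE (HeadF Γb) (fun f1) (fun f2)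
  fun-HE q with he-idx q
  ... | refl with he-≡ q
  ... | refl = he

  mhere-HE : ∀ {D0 Δ ρs τs b L a M} {g : HeadF D0 ((ρs ++ τs) ⇒ b)} {r : ArgsF D0 ρs} {ν : Rn D0 Δ}
               {h' : HeadF Δ (L ⇒ a)} {as : ArgsF Δ L} {R : ArgsF Δ M} →
             HE (HeadF Δ) h' (renH ν g) → HE (ArgsF Δ) as (renA ν r ++A R) → MatchN g r ν (hd h' as)
  mhere-HE {ρs = ρs} {τs} {M = M} hh ha with ++-cancelˡ ρs M τs (trans (sym (he-idx ha)) (⇒-injˡ (he-idx hh))) | ⇒-injʳ (he-idx hh)
  ... | refl | refl = mhere _ (hd-cong-HE hh ha)

  MatchT-prefix : ∀ {Δ ρ1 τ1 b1 ρ2 τ2 b2 M} (H1 : HeadF Δ ((ρ1 ++ τ1) ⇒ b1)) (s1 : ArgsF Δ ρ1)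
                    (H2 : HeadF Δ ((ρ2 ++ τ2) ⇒ b2)) (s2 : ArgsF Δ ρ2) (R : ArgsF Δ M) →
                  HE (HeadF Δ) H1 H2 → HE (ArgsF Δ) s2 (s1 ++A R) → MatchT H1 s1 (λ x → x) (expTm H2 s2)
  MatchT-prefix {ρ1 = ρ1} {τ1} {b1} {ρ2} {τ2} {b2} {M} H1 s1 H2 s2 R hh hs with he-idx hs
  ... | refl with ++-cancelˡ ρ1 τ1 (M ++ τ2) (trans (⇒-injˡ (he-idx hh)) (++-assoc ρ1 M τ2)) | ⇒-injʳ (he-idx hh)
  ... | refl | refl with he-≡ hs
  ... | refl = mlam (mhere (renA (wkV τ2) R ++A etaBinders τ2)
                 (hd-cong-HE (renH-cong-HE (wkV τ2) (he-sym hh))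
                        (he-trans (≡-he (cong (_++A etaBinders τ2) (renA-++ (wkV τ2) s1 R)))
                                  (++A-assoc (renA (wkV τ2) s1) (renA (wkV τ2) R) (etaBinders τ2)))))

  -- DHPs as a property of every node

  module _ {Γ : Ctx S} where

    VarArgsAt : ∀ {Δ} → ExtF Γ Δ → ∀ {a} → NfF Δ a → Set
    VarArgsAt {Δ} e {a} n = ∀ {σs} (y : Var Γ (σs ⇒ a)) (ts : ArgsF Δ σs) → n ≡ hd (var (inj e y)) ts → DHPVarArgs e ts

    mutual
      DHPN : ∀ {Δ} → ExtF Γ Δ → ∀ {a} → NfF Δ a → Set
      DHPN e (hd h as) = VarArgsAt e (hd h as) × DHPA e as

      DHPA : ∀ {Δ M} → ExtF Γ Δ → ArgsF Δ M → Set
      DHPA e [] = ⊤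
      DHPA e (t ∷ ts) = DHPT e t × DHPA e ts

      DHPT : ∀ {Δ σ} → ExtF Γ Δ → TmF Δ σ → Set
      DHPT e (lam {σs} w) = DHPN (extend e σs) w

    DHPA-! : ∀ {Δ M σ} {e : ExtF Γ Δ} (as : ArgsF Δ M) → DHPA e as → (i : Var M σ) → DHPT e (as ! i)
    DHPA-! (t ∷ ts) (a , _) here = a
    DHPA-! (t ∷ ts) (_ , pa) (there i) = DHPA-! ts pa i

    DHPA-intro : ∀ {Δ M} {e : ExtF Γ Δ} (as : ArgsF Δ M) → (∀ {σ} (i : Var M σ) → DHPT e (as ! i)) → DHPA e as
    DHPA-intro [] f = tt
    DHPA-intro (t ∷ ts) f = f here , DHPA-intro ts (λ i → f (there i))

    DHPA-++ : ∀ {Δ M N} {e : ExtF Γ Δ} (X : ArgsF Δ M) {Y : ArgsF Δ N} → DHPA e X → DHPA e Y → DHPA e (X ++A Y)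
    DHPA-++ [] _ py = py
    DHPA-++ (x ∷ X) (a , px) py = a , DHPA-++ X px py

    mutual
      DHPN-sub : ∀ {Δ0 Δ a b} (e0 : ExtF Γ Δ0) (n : NfF Δ0 a) → DHPN e0 n →
                 ∀ {e : ExtF Δ0 Δ} {r : NfF Δ b} → SubN n e r → VarArgsAt (e0 ⊕ e) r
      DHPN-sub e0 (hd h as) (p , _) self = subst (λ E → VarArgsAt E (hd h as)) (sym (⊕-stop e0)) p
      DHPN-sub e0 (hd h as) (_ , pa) (arg i s) = DHPT-sub e0 (as ! i) (DHPA-! as pa i) s

      DHPT-sub : ∀ {Δ0 Δ σ b} (e0 : ExtF Γ Δ0) (t : TmF Δ0 σ) → DHPT e0 t →
                 ∀ {e : ExtF Δ0 Δ} {r : NfF Δ b} → SubT t e r → VarArgsAt (e0 ⊕ e) r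
      DHPT-sub e0 (lam {σs} w) a (lam {e = e} s) = subst (λ E → VarArgsAt E _) (extend-⊕ e0 σs e) (DHPN-sub (extend e0 σs) w a s)

    mutual
      sub-DHPN : ∀ {Δ0 a} (e0 : ExtF Γ Δ0) (n : NfF Δ0 a) →
                 (∀ {Δ b} (e : ExtF Δ0 Δ) (r : NfF Δ b) → SubN n e r → VarArgsAt (e0 ⊕ e) r) → DHPN e0 n
      sub-DHPN e0 (hd h as) H = subst (λ E → VarArgsAt E (hd h as)) (⊕-stop e0) (H stop _ self) ,
                            sub-DHPA e0 as (λ i e r s → H e r (arg i s))

      sub-DHPA : ∀ {Δ0 M} (e0 : ExtF Γ Δ0) (as : ArgsF Δ0 M) →
                 (∀ {σ} (i : Var M σ) {Δ b} (e : ExtF Δ0 Δ) (r : NfF Δ b) → SubT (as ! i) e r → VarArgsAt (e0 ⊕ e) r) → DHPA e0 as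
      sub-DHPA e0 [] H = tt
      sub-DHPA e0 (t ∷ ts) H = sub-DHPT e0 t (H here) , sub-DHPA e0 ts (λ i → H (there i))

      sub-DHPT : ∀ {Δ0 σ} (e0 : ExtF Γ Δ0) (t : TmF Δ0 σ) →
                 (∀ {Δ b} (e : ExtF Δ0 Δ) (r : NfF Δ b) → SubT t e r → VarArgsAt (e0 ⊕ e) r) → DHPT e0 t
      sub-DHPT e0 (lam {σs} w) H =
        sub-DHPN (extend e0 σs) w (λ e r s → subst (λ E → VarArgsAt E r) (sym (extend-⊕ e0 σs e)) (H (under σs e) r (lam s)))

    DHP⇒DHPT : ∀ {σ} (t : TmF Γ σ) → DHP t → DHPT stop t
    DHP⇒DHPT t d = sub-DHPT stop t (λ e r s y ts eq → d e y ts (subst (SubT t e) eq s))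

    DHPT⇒DHP : ∀ {σ} (t : TmF Γ σ) → DHPT stop t → DHP t
    DHPT⇒DHP t a e y ts s = DHPT-sub stop t a s y ts refl

    mutual
      closed-DHPN : ∀ {Δ a} (e : ExtF Γ Δ) (n : NfF Δ a) → (∀ {ρ} (y : Var Γ ρ) → ¬ OccN (inj e y) n) → DHPN e n
      closed-DHPN e (hd h as) H = (λ y ts eq → ⊥-elim (H y (subst (OccN _) (sym eq) head))) , closed-DHPA e as (λ i y o → H y (arg i o))

      closed-DHPA : ∀ {Δ M} (e : ExtF Γ Δ) (as : ArgsF Δ M) →
                    (∀ {σ} (i : Var M σ) {ρ} (y : Var Γ ρ) → ¬ OccT (inj e y) (as ! i)) → DHPA e as
      closed-DHPA e [] H = tt
      closed-DHPA e (t ∷ ts) H = closed-DHPT e t (H here) , closed-DHPA e ts (λ i → H (there i))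

      closed-DHPT : ∀ {Δ σ} (e : ExtF Γ Δ) (t : TmF Δ σ) → (∀ {ρ} (y : Var Γ ρ) → ¬ OccT (inj e y) t) → DHPT e t
      closed-DHPT e (lam {σs} w) H = closed-DHPN (extend e σs) w (λ y o → H y (lam (subst (λ z → OccN z w) (inj-extend e σs y) o)))

  -- Substituting a DHP var-arg list

  module SubstDHP {Γ : Ctx S} (Ys Xs : Ctx S) (ss : ArgsF (Xs ++ Γ) Ys) (D : DHPVarArgs (under Xs stop) ss) where
    Base : Ctx S
    Base = Xs ++ Γ

    dec : ∀ {σ} → Var Ys σ → Decomp Base σ
    dec = decompOf D

    ss≡expTm : ∀ {ρs τs b} (m : Var Ys (τs ⇒ b)) {H : HeadF Base ((ρs ++ τs) ⇒ b)} {s : ArgsF Base ρs} →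
               dec m ≡ decomp H s → ss ! m ≡ expTm H s
    ss≡expTm m e = trans (decompOf-expOf D m) (cong expOf e)

    dec-closed : ∀ {ρs τs b ρ} (m : Var Ys (τs ⇒ b)) {H : HeadF Base ((ρs ++ τs) ⇒ b)} {s : ArgsF Base ρs} →
                 dec m ≡ decomp H s → (y : Var Γ ρ) → OccDecomp (wkV Xs y) H s → ⊥
    dec-closed m e y od = DHPVarArgs.fv-bound D m y (subst (OccT (wkV Xs y)) (sym (ss≡expTm m e)) (OccDecomp⇒OccT od))

    dec-occ : ∀ {ρs τs b} (m : Var Ys (τs ⇒ b)) {H : HeadF Base ((ρs ++ τs) ⇒ b)} {s : ArgsF Base ρs} →
              dec m ≡ decomp H s →
              (Σ (Ty S) λ ρ → Σ (Var Base ρ) λ x → HE (HeadF Base) H (var x)) ⊎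
              (Σ (Ty S) λ σ → Σ (Var ρs σ) λ k → HasOcc (s ! k))
    dec-occ m {H} {s} e with DHPVarArgs.fv-nonempty D m
    ... | ρ , x , o with OccT⇒OccDecomp H s (subst (OccT x) (ss≡expTm m e) o)
    ... | inj₁ q = inj₁ (ρ , x , q)
    ... | inj₂ (σ , k , o') = inj₂ (σ , k , ρ , x , o')

    dec-noMatch : ∀ {ρq τq bq ρm τm bm} (q : Var Ys (τq ⇒ bq)) (m : Var Ys (τm ⇒ bm))
                    {Hq : HeadF Base ((ρq ++ τq) ⇒ bq)} {sq : ArgsF Base ρq} {Hm : HeadF Base ((ρm ++ τm) ⇒ bm)} {sm : ArgsF Base ρm} →
                  dec q ≡ decomp Hq sq → dec m ≡ decomp Hm sm → index q ≢ index m → MatchT Hm sm (λ x → x) (ss ! q) → ⊥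
    dec-noMatch q m eq em ne mt with MatchT⇒SubT mt
    ... | Δ' , e , rest , p = DHPVarArgs.no-emb D q m ne (_ , _ , _ , ss≡expTm m em , Δ' , e , rest , p)

    -- For m = q the match would be larger than the entry containing it; otherwise it would be an
    -- expanded subterm of s_q, against (iii).
    entry-noMatch : ∀ {ρq τq bq ρm τm bm σ} (q : Var Ys (τq ⇒ bq)) (m : Var Ys (τm ⇒ bm))
                      {Hq : HeadF Base ((ρq ++ τq) ⇒ bq)} {sq : ArgsF Base ρq} {Hm : HeadF Base ((ρm ++ τm) ⇒ bm)} {sm : ArgsF Base ρm} →
                    dec q ≡ decomp Hq sq → (k : Var ρq σ) → dec m ≡ decomp Hm sm → MatchT Hm sm (λ x → x) (sq ! k) → ⊥
    entry-noMatch q m eq k em mt with index q ≟ index m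
    ... | yes e with index-inj-HE q m e
    ... | qh with he-idx qh
    ... | refl with he-≡ qh
    ... | refl with decomp-inj (trans (sym eq) em)
    ... | p , r with he-idx r
    ... | refl with he-≡ p | he-≡ r
    ... | refl | refl = ¬MatchT-entry k mt
    entry-noMatch {τq = τq} q m {Hq} {sq} eq k em mt | no ne =
      dec-noMatch q m eq em ne
        (subst (MatchT _ _ (λ x → x)) (sym (ss≡expTm q eq))
           (mlam (marg (bvar k) (subst (MatchT _ _ _) (sym (trans (++A-!-bvar (renA (wkV τq) sq) (etaBinders τq) k) (renA-! (wkV τq) sq k)))
                                   (MatchT-ren mt (wkV τq))))))

    -- The substitution as it acts below the binders e1 of the source and e2 of the target.
    record Scope (Γ1 Γ2 : Ctx S) : Set where
      field
        e1 : ExtF (Ys ++ Γ) Γ1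
        e2 : ExtF Base Γ2
        κ : Rn Base Γ2
        θ : ShallowSb Base Γ1 Γ2
        ym : ∀ {σ} → Var Ys σ → Var Γ1 σ
        κ≡inj : ∀ {σ} (x : Var Base σ) → κ x ≡ inj e2 x
        θ-free : ∀ {σ} (y : Var Γ σ) → θ (inj e1 (wkV Ys y)) ≡ ren (inj e2 (wkV Xs y))
        θ-exp-inv : ∀ {ρs τs b} (v : Var Γ1 (τs ⇒ b)) {H : HeadF Base ((ρs ++ τs) ⇒ b)} {s : ArgsF Base ρs} →
                    θ v ≡ exp H s → Σ (Var Ys (τs ⇒ b)) λ m → v ≡ ym m × dec m ≡ decomp H s
        θ-ren-inj : ∀ {σ} (v1 v2 : Var Γ1 σ) {u : Var Γ2 σ} → θ v1 ≡ ren u → θ v2 ≡ ren u → v1 ≡ v2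
        θ-ren-free : ∀ {σ} (v : Var Γ1 σ) (x : Var Base σ) → θ v ≡ ren (κ x) → Σ (Var Γ σ) λ y → x ≡ wkV Xs y

    κ-inj : ∀ {Γ1 Γ2} (L : Scope Γ1 Γ2) → InjectiveRen (Scope.κ L)
    κ-inj L {x = x} {y} e = inj-inj (Scope.e2 L) (trans (sym (Scope.κ≡inj L x)) (trans e (Scope.κ≡inj L y)))

    liftScope : ∀ {Γ1 Γ2} σs → Scope Γ1 Γ2 → Scope (σs ++ Γ1) (σs ++ Γ2)
    liftScope σs L = record
      { e1 = extend e1 σs ; e2 = extend e2 σs ; κ = λ x → wkV σs (κ x) ; θ = liftSh σs θ
      ; ym = λ m → wkV σs (ym m)
      ; κ≡inj = λ x → trans (cong (wkV σs) (κ≡inj x)) (sym (inj-extend e2 σs x))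
      ; θ-free = λ y → trans (cong (liftSh σs θ) (inj-extend e1 σs (wkV Ys y)))
                   (trans (liftSh-wkV σs θ _) (trans (cong (wkShallows σs) (θ-free y))
                   (trans (wkShallows-ren σs _) (cong ren (sym (inj-extend e2 σs (wkV Xs y)))))))
      ; θ-exp-inv = θ-exp-inv′
      ; θ-ren-inj = θ-ren-inj′
      ; θ-ren-free = θ-ren-free′ }
      where
        open Scope L
        θ-exp-inv′ : ∀ {ρs τs b} (v : Var (σs ++ _) (τs ⇒ b)) {H : HeadF Base ((ρs ++ τs) ⇒ b)} {s : ArgsF Base ρs} →
                     liftSh σs θ v ≡ exp H s → Σ (Var Ys (τs ⇒ b)) λ m → v ≡ wkV σs (ym m) × dec m ≡ decomp H s
        θ-exp-inv′ v e with liftSh-exp-inv σs θ v e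
        ... | v0 , refl , e0 with θ-exp-inv v0 e0
        ... | m , refl , em = m , refl , em
        θ-ren-inj′ : ∀ {σ} (v1 v2 : Var (σs ++ _) σ) {u : Var (σs ++ _) σ} → liftSh σs θ v1 ≡ ren u → liftSh σs θ v2 ≡ ren u → v1 ≡ v2
        θ-ren-inj′ v1 v2 e1' e2' with liftSh-ren-inv σs θ v1 e1' | liftSh-ren-inv σs θ v2 e2'
        ... | lifted-binder k1 refl eu1 | lifted-binder k2 refl eu2 = cong bvar (bvar-inj σs (trans (sym eu1) eu2))
        ... | lifted-binder k1 refl eu1 | lifted-outer v0 u0 refl eu2 _ = ⊥-elim (bvar≢wkV σs k1 u0 (trans (sym eu1) eu2))
        ... | lifted-outer v0 u0 refl eu1 _ | lifted-binder k2 refl eu2 = ⊥-elim (bvar≢wkV σs k2 u0 (trans (sym eu2) eu1))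
        ... | lifted-outer v01 u01 refl eu1 e01 | lifted-outer v02 u02 refl eu2 e02 with wkV-inj σs (trans (sym eu1) eu2)
        ... | refl = cong (wkV σs) (θ-ren-inj v01 v02 e01 e02)
        θ-ren-free′ : ∀ {σ} (v : Var (σs ++ _) σ) (x : Var Base σ) → liftSh σs θ v ≡ ren (wkV σs (κ x)) →
                      Σ (Var Γ σ) λ y → x ≡ wkV Xs y
        θ-ren-free′ v x e with liftSh-ren-inv σs θ v e
        ... | lifted-binder k refl eu = ⊥-elim (bvar≢wkV σs k (κ x) (sym eu))
        ... | lifted-outer v0 u0 refl eu e0 with wkV-inj σs eu
        ... | refl = θ-ren-free v0 x e0

    θ₀ : ShallowSb Base (Ys ++ Γ) Base
    θ₀ v = instSb Ys dec (liftR Ys (wkV Xs) v)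

    θ₀-bvar : ∀ {σ} (m : Var Ys σ) → θ₀ (bvar m) ≡ shallowOf (dec m)
    θ₀-bvar m rewrite liftR-bvar {Γ = Γ} Ys (wkV Xs) m | split-bvar {Δ = Base} Ys m = refl

    θ₀-wkV : ∀ {σ} (y : Var Γ σ) → θ₀ (wkV Ys y) ≡ ren (wkV Xs y)
    θ₀-wkV y rewrite liftR-wkV Ys (wkV Xs) y | split-wkV Ys (wkV Xs y) = refl

    scope₀ : Scope (Ys ++ Γ) Base
    scope₀ = record
      { e1 = stop ; e2 = stop ; κ = λ x → x ; θ = θ₀ ; ym = bvar
      ; κ≡inj = λ x → refl
      ; θ-free = θ₀-wkV
      ; θ-exp-inv = θ-exp-inv′
      ; θ-ren-inj = θ-ren-inj′
      ; θ-ren-free = θ-ren-free′ }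
      where
        θ-exp-inv′ : ∀ {ρs τs b} (v : Var (Ys ++ Γ) (τs ⇒ b)) {H : HeadF Base ((ρs ++ τs) ⇒ b)} {s : ArgsF Base ρs} →
                     θ₀ v ≡ exp H s → Σ (Var Ys (τs ⇒ b)) λ m → v ≡ bvar m × dec m ≡ decomp H s
        θ-exp-inv′ v e with binderView Ys v
        ... | binder m = m , refl , shallowOf-inj (dec m) (trans (sym (θ₀-bvar m)) e)
        ... | outer y with trans (sym (θ₀-wkV y)) e
        ... | ()
        θ-ren-inj′ : ∀ {σ} (v1 v2 : Var (Ys ++ Γ) σ) {u : Var Base σ} → θ₀ v1 ≡ ren u → θ₀ v2 ≡ ren u → v1 ≡ v2
        θ-ren-inj′ v1 v2 e1 e2 with binderView Ys v1 | binderView Ys v2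
        ... | binder m | _ = ⊥-elim (shallowOf≢ren (dec m) (trans (sym (θ₀-bvar m)) e1))
        ... | outer y | binder m = ⊥-elim (shallowOf≢ren (dec m) (trans (sym (θ₀-bvar m)) e2))
        ... | outer y1 | outer y2 with wkV-inj Xs (ren-inj (trans (trans (sym (θ₀-wkV y1)) e1) (sym (trans (sym (θ₀-wkV y2)) e2))))
        ... | refl = refl
        θ-ren-free′ : ∀ {σ} (v : Var (Ys ++ Γ) σ) (x : Var Base σ) → θ₀ v ≡ ren x → Σ (Var Γ σ) λ y → x ≡ wkV Xs y
        θ-ren-free′ v x e with binderView Ys v
        ... | binder m = ⊥-elim (shallowOf≢ren (dec m) (trans (sym (θ₀-bvar m)) e))
        ... | outer y = y , sym (ren-inj (trans (sym (θ₀-wkV y)) e))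

    module _ {Γ1 Γ2 : Ctx S} (L : Scope Γ1 Γ2) where
      open Scope L

      HasOcc-img : ∀ {σ} (t : TmF Γ1 σ) → HasOcc t → HasOcc (imgT κ θ t)
      HasOcc-img t (ρ , v , o) with θ v in eq
      ... | ren u = ρ , u , occT-img-ren κ θ eq o
      HasOcc-img t (ρ , v , o) | exp H s with θ-exp-inv v eq
      ... | m , _ , em with dec-occ m em
      ... | inj₁ (ρ' , x , q) = ρ' , κ x , occT-img-exp κ θ eq (inj₁ q) o
      ... | inj₂ (σ , k , ρ' , x , o') = ρ' , κ x , occT-img-exp κ θ eq (inj₂ (σ , k , o')) o

      img-notIn-entry : ∀ {Δz σd σc ρq τq bq} (d : TmF Γ1 σd) → HasOcc d → (π : Rn Γ2 Δz) → InjectiveRen π →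
                        (ρc : Rn Base Δz) → (∀ {σ} (x : Var Base σ) → ρc x ≡ π (κ x)) →
                        (q : Var Ys (τq ⇒ bq)) {Hq : HeadF Base ((ρq ++ τq) ⇒ bq)} {sq : ArgsF Base ρq} → dec q ≡ decomp Hq sq →
                        (k : Var ρq σc) →
                        (∀ {ρ} (u : Var Γ2 ρ) → OccT u (imgT κ θ d) → OccT (π u) (renT ρc (sq ! k))) →
                        (∀ {ρm τm bm} {Hm : HeadF Base ((ρm ++ τm) ⇒ bm)} {sm : ArgsF Base ρm} →
                           MatchT Hm sm κ (imgT κ θ d) → MatchT Hm sm (λ x → π (κ x)) (renT ρc (sq ! k))) → ⊥
      img-notIn-entry d (ρ , v , o) π πi ρc eρ q {Hq} {sq} eq k occT mT with θ v in ev
      ... | ren u with occT-unren ρc (sq ! k) (occT u (occT-img-ren κ θ ev o))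
      ... | x , exx , ox with πi (trans (sym (eρ x)) exx)
      ... | refl with θ-ren-free v x ev
      ... | y , refl = dec-closed q eq y (inj₂ (_ , k , ox))
      img-notIn-entry d (ρ , v , o) π πi ρc eρ q {Hq} {sq} eq k occT mT | exp H s with θ-exp-inv v ev
      ... | m , _ , em =
        entry-noMatch q m eq k em
          (MatchT-unren ρc ρc-inj (sq ! k) (MatchT-ext (λ x → sym (eρ x)) (mT (MatchT-img-exp κ θ ev o))))
        where
          ρc-inj : InjectiveRen ρc
          ρc-inj {x = x} {y} e = κ-inj L (πi (trans (sym (eρ x)) (trans e (eρ y))))

      img≢entry : ∀ {Δz σc ρq τq bq} (d : TmF Γ1 σc) (π : Rn Γ2 Δz) → InjectiveRen π →
                  (ρc : Rn Base Δz) → (∀ {σ} (x : Var Base σ) → ρc x ≡ π (κ x)) →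
                  (q : Var Ys (τq ⇒ bq)) {Hq : HeadF Base ((ρq ++ τq) ⇒ bq)} {sq : ArgsF Base ρq} → dec q ≡ decomp Hq sq →
                  (k : Var ρq σc) → renT π (imgT κ θ d) ≡ renT ρc (sq ! k) → HasOcc (sq ! k) → ⊥
      img≢entry d π πi ρc eρ q {Hq} {sq} eq k eqZ (ρ , x , ox)
        with occT-unren π (imgT κ θ d) (subst (OccT (ρc x)) (sym eqZ) (occT-ren ρc ox))
      ... | u , eu , ou with πi (trans eu (eρ x))
      ... | refl with occT-img-source κ θ d ou
      ... | src-ren v ev _ with θ-ren-free v x ev
      ... | y , refl = dec-closed q eq y (inj₂ (_ , k , ox))
      img≢entry d π πi ρc eρ q {Hq} {sq} eq k eqZ (ρ , x , ox) | u , eu , ou | refl | src-exp v H s x' ev o _ _ =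
        img-notIn-entry d (_ , v , o) π πi ρc eρ q eq k
          (λ u o' → subst (OccT (π u)) eqZ (occT-ren π o'))
          (λ m → subst (MatchT _ _ _) eqZ (MatchT-ren m π))

    decomps-apart : ∀ {Δ ρ1 τ1 b1 ρ2 τ2 b2 M1 M2} (m1 : Var Ys (τ1 ⇒ b1)) (m2 : Var Ys (τ2 ⇒ b2))
                      {H1 : HeadF Base ((ρ1 ++ τ1) ⇒ b1)} {s1 : ArgsF Base ρ1} {H2 : HeadF Base ((ρ2 ++ τ2) ⇒ b2)} {s2 : ArgsF Base ρ2} →
                    dec m1 ≡ decomp H1 s1 → dec m2 ≡ decomp H2 s2 → index m1 ≢ index m2 →
                    (κ0 : Rn Base Δ) → InjectiveRen κ0 → HE (HeadF Δ) (renH κ0 H1) (renH κ0 H2) →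
                    {Y1 : ArgsF Δ M1} {Y2 : ArgsF Δ M2} → HE (ArgsF Δ) (renA κ0 s1 ++A Y1) (renA κ0 s2 ++A Y2) → ⊥
    decomps-apart m1 m2 {H1} {s1} {H2} {s2} e1 e2 ne κ0 κi hH hA with ++A-compare (renA κ0 s1) (renA κ0 s2) hA
    ... | inj₁ (Z , r) with unren-prefix κ0 κi s2 s1 r
    ... | R' , r' = dec-noMatch m2 m1 e2 e1 (λ z → ne (sym z))
                      (subst (MatchT H1 s1 (λ x → x)) (sym (ss≡expTm m2 e2)) (MatchT-prefix H1 s1 H2 s2 (proj₂ R') (renH-injHE κ0 κi hH) r'))
    decomps-apart m1 m2 {H1} {s1} {H2} {s2} e1 e2 ne κ0 κi hH hA | inj₂ (Z , r) with unren-prefix κ0 κi s1 s2 r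
    ... | R' , r' = dec-noMatch m1 m2 e1 e2 ne
                      (subst (MatchT H2 s2 (λ x → x)) (sym (ss≡expTm m1 e1)) (MatchT-prefix H2 s2 H1 s1 (proj₂ R') (he-sym (renH-injHE κ0 κi hH)) r'))

    ren≢expHead : ∀ {Γ1 Γ2} (L : Scope Γ1 Γ2) {σ ρs τs b} (v : Var Γ1 σ) (u : Var Γ2 σ) → Scope.θ L v ≡ ren u →
                  (w : Var Γ1 (τs ⇒ b)) (H : HeadF Base ((ρs ++ τs) ⇒ b)) (s : ArgsF Base ρs) → Scope.θ L w ≡ exp H s →
                  HE (HeadF Γ2) (var u) (renH (Scope.κ L) H) → ⊥
    ren≢expHead L v u ev w (var x) s ew p with var-inj-HE p
    ... | p' with he-idx p'
    ... | refl with he-≡ p'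
    ... | refl with Scope.θ-ren-free L v x ev
    ... | y , refl with Scope.θ-exp-inv L w ew
    ... | m , _ , em = dec-closed m em y (inj₁ he)
    ren≢expHead L v u ev w (fun f) s ew p = fun≢var (he-sym p)

    fun≢expImg : ∀ {Γ1 Γ2} (L : Scope Γ1 Γ2) {ρs τs b σ1 L1} (f : F σ1) (as1 : ArgsF Γ1 L1)
                 (w : Var Γ1 (τs ⇒ b)) (H : HeadF Base ((ρs ++ τs) ⇒ b)) (s : ArgsF Base ρs) → Scope.θ L w ≡ exp H s →
                 HE (HeadF Γ2) (fun f) (renH (Scope.κ L) H) → {X : ArgsF Γ2 τs} →
                 HE (ArgsF Γ2) (imgA (Scope.κ L) (Scope.θ L) as1) (renA (Scope.κ L) s ++A X) → ⊥
    fun≢expImg L f as1 w (var x) s ew p hA = fun≢var p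
    fun≢expImg L f as1 w (fun f') s ew p {X} hA with Scope.θ-exp-inv L w ew
    ... | m , _ , em with dec-occ m em
    ... | inj₁ (_ , x , q) = fun≢var q
    ... | inj₂ (σ , k , hc) with ++A-prefix-! (renA (Scope.κ L) s) X hA k
    ... | i , eqi =
      img≢entry L (as1 ! i) (λ x → x) (λ e → e) (Scope.κ L) (λ x → refl) m em k
        (trans (renT-id _) (trans (sym (imgA-! (Scope.κ L) (Scope.θ L) as1 i)) (trans eqi (renA-! (Scope.κ L) s k)))) hc

    imgN-head-inj : ∀ {Γ1 Γ2 a L1 L2} (L : Scope Γ1 Γ2) (h1 : HeadF Γ1 (L1 ⇒ a)) (as1 : ArgsF Γ1 L1)
                      (h2 : HeadF Γ1 (L2 ⇒ a)) (as2 : ArgsF Γ1 L2) →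
                    imgN (Scope.κ L) (Scope.θ L) (hd h1 as1) ≡ imgN (Scope.κ L) (Scope.θ L) (hd h2 as2) →
                    HE (HeadF Γ1) h1 h2 × HE (ArgsF Γ2) (imgA (Scope.κ L) (Scope.θ L) as1) (imgA (Scope.κ L) (Scope.θ L) as2)
    imgN-head-inj L (fun f1) as1 (fun f2) as2 e with hd-inj e
    ... | p , q = fun-HE p , q
    imgN-head-inj L (fun f) as1 (var v2) as2 e with Scope.θ L v2 in e2
    ... | ren u = ⊥-elim (fun≢var (proj₁ (hd-inj e)))
    ... | exp H s = ⊥-elim (fun≢expImg L f as1 v2 H s e2 (proj₁ (hd-inj e)) (proj₂ (hd-inj e)))
    imgN-head-inj L (var v1) as1 (fun f) as2 e with Scope.θ L v1 in e1
    ... | ren u = ⊥-elim (fun≢var (he-sym (proj₁ (hd-inj e))))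
    ... | exp H s = ⊥-elim (fun≢expImg L f as2 v1 H s e1 (proj₁ (hd-inj (sym e))) (proj₂ (hd-inj (sym e))))
    imgN-head-inj L (var v1) as1 (var v2) as2 e with Scope.θ L v1 in e1 | Scope.θ L v2 in e2
    ... | ren u1 | ren u2 with hd-inj e
    ... | p , q with var-inj-HE p
    ... | p' with he-idx p'
    ... | refl with he-≡ p'
    ... | refl with Scope.θ-ren-inj L v1 v2 e1 e2
    ... | refl = he , q
    imgN-head-inj L (var v1) as1 (var v2) as2 e | ren u1 | exp H s =
      ⊥-elim (ren≢expHead L v1 u1 e1 v2 H s e2 (proj₁ (hd-inj e)))
    imgN-head-inj L (var v1) as1 (var v2) as2 e | exp H s | ren u2 =
      ⊥-elim (ren≢expHead L v2 u2 e2 v1 H s e1 (proj₁ (hd-inj (sym e))))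
    imgN-head-inj L (var v1) as1 (var v2) as2 e | exp H1 s1 | exp H2 s2
      with Scope.θ-exp-inv L v1 e1 | Scope.θ-exp-inv L v2 e2
    ... | m1 , refl , em1 | m2 , refl , em2 with index m1 ≟ index m2
    ... | no ne = ⊥-elim (decomps-apart m1 m2 em1 em2 ne (Scope.κ L) (κ-inj L) (proj₁ (hd-inj e)) (proj₂ (hd-inj e)))
    ... | yes ei with index-inj-HE m1 m2 ei
    ... | mh with he-idx mh
    ... | refl with he-≡ mh
    ... | refl with decomp-inj (trans (sym em1) em2)
    ... | hH , hs with he-idx hs
    ... | refl with he-≡ hH | he-≡ hs
    ... | refl | refl = he , ++A-cancelˡ (renA (Scope.κ L) s1) (proj₂ (hd-inj e))

    mutual
      imgN-inj : ∀ {Γ1 Γ2 a} (L : Scope Γ1 Γ2) (n1 n2 : NfF Γ1 a) →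
                 imgN (Scope.κ L) (Scope.θ L) n1 ≡ imgN (Scope.κ L) (Scope.θ L) n2 → n1 ≡ n2
      imgN-inj L (hd h1 as1) (hd h2 as2) e with imgN-head-inj L h1 as1 h2 as2 e
      ... | hh , ha with he-idx ha
      ... | refl with he-≡ hh
      ... | refl = cong (hd h1) (imgA-inj L as1 as2 (he-≡ ha))

      imgT-inj : ∀ {Γ1 Γ2 σ} (L : Scope Γ1 Γ2) (t1 t2 : TmF Γ1 σ) →
                 imgT (Scope.κ L) (Scope.θ L) t1 ≡ imgT (Scope.κ L) (Scope.θ L) t2 → t1 ≡ t2
      imgT-inj L (lam {σs} w1) (lam w2) e = cong lam (imgN-inj (liftScope σs L) w1 w2 (lam-inj e))

      imgA-inj : ∀ {Γ1 Γ2 M} (L : Scope Γ1 Γ2) (as1 as2 : ArgsF Γ1 M) →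
                 imgA (Scope.κ L) (Scope.θ L) as1 ≡ imgA (Scope.κ L) (Scope.θ L) as2 → as1 ≡ as2
      imgA-inj L [] [] e = refl
      imgA-inj L (a1 ∷ as1) (a2 ∷ as2) e with ∷-inj-HE (≡-he e)
      ... | p , q = cong₂ _∷_ (imgT-inj L a1 a2 (he-≡ p)) (imgA-inj L as1 as2 (he-≡ q))

    imgA-prefix-inj : ∀ {Γ1 Γ2 M LX LR} (L : Scope Γ1 Γ2) (as : ArgsF Γ1 M) (X : ArgsF Γ1 LX) {R : ArgsF Γ2 LR} →
                      HE (ArgsF Γ2) (imgA (Scope.κ L) (Scope.θ L) as) (imgA (Scope.κ L) (Scope.θ L) X ++A R) →
                      Σ (ArgsΣ Γ1) λ R' → HE (ArgsF Γ1) as (X ++A proj₂ R')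
    imgA-prefix-inj L as [] q = (_ , as) , he
    imgA-prefix-inj L [] (x ∷ X) q with he-idx q
    ... | ()
    imgA-prefix-inj L (a ∷ as) (x ∷ X) q with ∷-inj-HE q
    ... | p1 , p2 with he-idx p1
    ... | refl with imgT-inj L a x (he-≡ p1) | imgA-prefix-inj L as X p2
    ... | refl | R' , r = R' , ∷-cong-HE he r

    -- L′ lies below further binders than L; ν and μ embed the contexts of L into those of L′.
    record Deeper {Γ1 Γ2 Γ1' Γ2'} (L : Scope Γ1 Γ2) (L' : Scope Γ1' Γ2') : Set where
      field
        ν : Rn Γ1 Γ1'
        μ : Rn Γ2 Γ2'
        μ-inj : InjectiveRen μ
        κ-μ : ∀ {σ} (x : Var Base σ) → Scope.κ L' x ≡ μ (Scope.κ L x)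
        θ-ν : ∀ {σ} (v : Var Γ1 σ) → Scope.θ L' (ν v) ≡ renShallow μ (Scope.θ L v)
        ren-reflect : ∀ {σ} (v' : Var Γ1' σ) (u : Var Γ2 σ) → Scope.θ L' v' ≡ ren (μ u) →
                      Σ (Var Γ1 σ) λ v → v' ≡ ν v × Scope.θ L v ≡ ren u
        ym-ν : ∀ {σ} (m : Var Ys σ) → Scope.ym L' m ≡ ν (Scope.ym L m)

    deeper-refl : ∀ {Γ1 Γ2} (L : Scope Γ1 Γ2) → Deeper L L
    deeper-refl L = record { ν = λ x → x ; μ = λ x → x ; μ-inj = λ e → e ; κ-μ = λ x → refl
                     ; θ-ν = λ v → sym (renShallow-id (Scope.θ L v)) ; ren-reflect = λ v' u e → v' , refl , e ; ym-ν = λ m → refl }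

    deeper-lift : ∀ {Γ1 Γ2 Γ1' Γ2'} {L : Scope Γ1 Γ2} {L' : Scope Γ1' Γ2'} σs → Deeper L L' → Deeper L (liftScope σs L')
    deeper-lift {L = L} {L'} σs R = record
      { ν = λ v → wkV σs (ν v) ; μ = λ u → wkV σs (μ u)
      ; μ-inj = λ e → μ-inj (wkV-inj σs e)
      ; κ-μ = λ x → cong (wkV σs) (κ-μ x)
      ; θ-ν = λ v → trans (liftSh-wkV σs (Scope.θ L') (ν v)) (trans (cong (wkShallows σs) (θ-ν v)) (wkShallows-renShallow σs μ (Scope.θ L v)))
      ; ren-reflect = ren-reflect′
      ; ym-ν = λ m → cong (wkV σs) (ym-ν m) }
      where
        open Deeper R
        ren-reflect′ : ∀ {σ} (v' : Var (σs ++ _) σ) (u : Var _ σ) → liftSh σs (Scope.θ L') v' ≡ ren (wkV σs (μ u)) →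
             Σ (Var _ σ) λ v → v' ≡ wkV σs (ν v) × Scope.θ L v ≡ ren u
        ren-reflect′ v' u e with liftSh-ren-inv σs (Scope.θ L') v' e
        ... | lifted-binder k refl eu = ⊥-elim (bvar≢wkV σs k (μ u) (sym eu))
        ... | lifted-outer v0 u0 refl eu e0 with wkV-inj σs eu
        ... | refl with ren-reflect v0 u e0
        ... | v , refl , ev = v , refl , ev

    renA-imgA-deeper : ∀ {Γ1 Γ2 Γ1' Γ2' M} {L : Scope Γ1 Γ2} {L' : Scope Γ1' Γ2'} (R : Deeper L L') (X : ArgsF Γ1 M) →
                       renA (Deeper.μ R) (imgA (Scope.κ L) (Scope.θ L) X) ≡ imgA (Scope.κ L') (Scope.θ L') (renA (Deeper.ν R) X)
    renA-imgA-deeper {L = L} {L'} R X =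
      trans (renA-imgA (Scope.κ L) (Scope.θ L) (Deeper.μ R) X)
        (trans (imgA-ext (λ x → sym (Deeper.κ-μ R x)) (λ v → sym (Deeper.θ-ν R v)) X)
               (sym (imgA-renA (Scope.κ L') (Scope.θ L') (Deeper.ν R) (λ v → Scope.θ L' (Deeper.ν R v)) (λ v → refl) X)))

    data ImgDecomp {Γ1 Γ2} (L : Scope Γ1 Γ2) {ρs τs : Ctx S} {b : S} (g : HeadF Γ1 ((ρs ++ τs) ⇒ b)) (r : ArgsF Γ1 ρs) :
            ∀ {ρs'} → HeadF Γ2 ((ρs' ++ τs) ⇒ b) → ArgsF Γ2 ρs' → Set where
      via-fun : ∀ {f} → g ≡ fun f → ImgDecomp L g r (fun f) (imgA (Scope.κ L) (Scope.θ L) r)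
      via-ren : ∀ {v u} → g ≡ var v → Scope.θ L v ≡ ren u → ImgDecomp L g r (var u) (imgA (Scope.κ L) (Scope.θ L) r)
      via-exp : ∀ {v ρH} {H : HeadF Base ((ρH ++ (ρs ++ τs)) ⇒ b)} {s : ArgsF Base ρH} → g ≡ var v → Scope.θ L v ≡ exp H s →
               ImgDecomp L g r (subst (λ M → HeadF Γ2 (M ⇒ b)) (sym (++-assoc ρH ρs τs)) (renH (Scope.κ L) H))
                        (renA (Scope.κ L) s ++A imgA (Scope.κ L) (Scope.θ L) r)

    θ-ren-free-HE : ∀ {Γ1 Γ2} (L : Scope Γ1 Γ2) {σ1 σ2} (v : Var Γ1 σ2) (x : Var Base σ1) {u : Var Γ2 σ2} →
                    Scope.θ L v ≡ ren u → HE (Var Γ2) (Scope.κ L x) u → Σ (Var Γ σ1) λ y → x ≡ wkV Xs y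
    θ-ren-free-HE L v x e q with he-idx q
    ... | refl with he-≡ q
    ... | refl = Scope.θ-ren-free L v x e

    -- A match of (h, ts), the image decomposition of an expanded g(r⃗, …) at scope L, inside the
    -- image of a term at a deeper scope comes from a match of (g, r⃗) in the term itself.
    module Reflect {Γ1 Γ2} (L : Scope Γ1 Γ2) where
      open Scope L using () renaming (κ to κL; θ to θL)

      expHead-deeper : ∀ {Γ1' Γ2'} {L' : Scope Γ1' Γ2'} (R : Deeper L L') {ρH ρs τs b} (H : HeadF Base ((ρH ++ (ρs ++ τs)) ⇒ b)) →
                HE (HeadF Γ2') (renH (Deeper.μ R) (subst (λ M → HeadF Γ2 (M ⇒ b)) (sym (++-assoc ρH ρs τs)) (renH κL H)))
                               (renH (Scope.κ L') H)
      expHead-deeper R {ρH} {ρs} {τs} H =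
        he-trans (renH-cong-HE (Deeper.μ R) (subst-HE (sym (++-assoc ρH ρs τs)) (renH κL H)))
                 (≡-he (trans (renH-comp (Deeper.μ R) κL H) (renH-ext (λ x → sym (Deeper.κ-μ R x)) H)))

      expArgs-deeper : ∀ {Γ1' Γ2'} {L' : Scope Γ1' Γ2'} (R : Deeper L L') {ρH M N} (s : ArgsF Base ρH) (X : ArgsF Γ2 M) (rest : ArgsF Γ2' N) →
                  HE (ArgsF Γ2') (renA (Deeper.μ R) (renA κL s ++A X) ++A rest) (renA (Scope.κ L') s ++A (renA (Deeper.μ R) X ++A rest))
      expArgs-deeper {L' = L'} R s X rest =
        he-trans (≡-he (cong (_++A rest) (trans (renA-++ (Deeper.μ R) (renA κL s) X)
                          (cong (_++A renA (Deeper.μ R) X) (trans (renA-comp (Deeper.μ R) κL s) (renA-ext (λ x → sym (Deeper.κ-μ R x)) s))))))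
                 (++A-assoc (renA (Scope.κ L') s) (renA (Deeper.μ R) X) rest)

      imgArgs-deeper : ∀ {Γ1' Γ2'} {L' : Scope Γ1' Γ2'} (R : Deeper L L') {M K N} (r : ArgsF Γ1 M) {Y : ArgsF Γ2' K} {rest : ArgsF Γ2' N} →
                  HE (ArgsF Γ2') Y (renA (Deeper.μ R) (imgA κL θL r) ++A rest) →
                  HE (ArgsF Γ2') Y (imgA (Scope.κ L') (Scope.θ L') (renA (Deeper.ν R) r) ++A rest)
      imgArgs-deeper R r {rest = rest} q = he-trans q (≡-he (cong (_++A rest) (renA-imgA-deeper R r)))

      entry-noImgMatch : ∀ {Γ1' Γ2'} (L' : Scope Γ1' Γ2') (R : Deeper L L') {ρs τs b} {g : HeadF Γ1 ((ρs ++ τs) ⇒ b)} {r : ArgsF Γ1 ρs}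
                           {ρs'} {h : HeadF Γ2 ((ρs' ++ τs) ⇒ b)} {ts : ArgsF Γ2 ρs'} → ImgDecomp L g r h ts → FunArgsOcc g r →
                         ∀ {ρq τq bq σ} (q : Var Ys (τq ⇒ bq)) {Hq : HeadF Base ((ρq ++ τq) ⇒ bq)} {sq : ArgsF Base ρq} →
                         dec q ≡ decomp Hq sq → (k : Var ρq σ) → MatchT h ts (Deeper.μ R) (renT (Scope.κ L') (sq ! k)) → ⊥
      entry-noImgMatch L' R {r = r} (via-fun refl) go q {Hq} {sq} eqq k m with go refl
      ... | σ' , p , hr =
        img-notIn-entry L (r ! p) hr (Deeper.μ R) (Deeper.μ-inj R) (Scope.κ L') (Deeper.κ-μ R) q eqq k
          (λ u o → MatchT-occ-arg m p (subst (OccT u) (sym (imgA-! κL θL r p)) o))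
          (λ m2 → MatchT-trans m p (subst (MatchT _ _ κL) (sym (imgA-! κL θL r p)) m2))
      entry-noImgMatch L' R (via-ren {v = vj} {u = uj} refl ej) go q {Hq} {sq} eqq k m
        with occT-unren (Scope.κ L') (sq ! k) (MatchT-occ-head m)
      ... | x , exx , ox with Deeper.μ-inj R (trans (sym (Deeper.κ-μ R x)) exx)
      ... | refl with Scope.θ-ren-free L vj x ej
      ... | y , refl = dec-closed q eqq y (inj₂ (_ , k , ox))
      entry-noImgMatch L' R (via-exp {v = vl} {H = Hl} {sl} refl el) go q {Hq} {sq} eqq k m with Scope.θ-exp-inv L vl el
      ... | l , _ , eql =
        entry-noMatch q l eqq k eql
          (MatchT-unren {κ = λ x → x} (Scope.κ L') (κ-inj L') (sq ! k)
             (MatchT-ext (λ x → sym (Deeper.κ-μ R x)) (MatchT-weaken (subst-HE _ _) m)))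

      renA-imgA-! : ∀ {Γ2' ρs σ} (μ : Rn Γ2 Γ2') (r : ArgsF Γ1 ρs) (p : Var ρs σ) →
                    renA μ (imgA κL θL r) ! p ≡ renT μ (imgT κL θL (r ! p))
      renA-imgA-! μ r p = trans (renA-! μ (imgA κL θL r) p) (cong (renT μ) (imgA-! κL θL r p))

      reflect-exp-fun : ∀ {Γ1' Γ2'} (L' : Scope Γ1' Γ2') (R : Deeper L L') {ρs M N} (r : ArgsF Γ1 ρs) →
                        (Σ (Ty S) λ σ → Σ (Var ρs σ) λ p → HasOcc (r ! p)) →
                        ∀ {ρq τq bq} (q : Var Ys (τq ⇒ bq)) {f : F ((ρq ++ τq) ⇒ bq)} {sq : ArgsF Base ρq} →
                        dec q ≡ decomp (fun f) sq → {X : ArgsF Γ2' M} {rest : ArgsF Γ2' N} →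
                        HE (ArgsF Γ2') (renA (Scope.κ L') sq ++A X) (renA (Deeper.μ R) (imgA κL θL r) ++A rest) → ⊥
      reflect-exp-fun L' R r (σ' , p0 , hr) q {sq = sq} eqq qa with dec-occ q eqq
      ... | inj₁ (_ , x , q') = fun≢var q'
      ... | inj₂ (σ , k , hc)
          with aligned-occ (renA (Scope.κ L') sq) (renA (Deeper.μ R) (imgA κL θL r)) qa
                 (σ , k , subst HasOcc (sym (renA-! (Scope.κ L') sq k)) (hasOcc-ren (Scope.κ L') hc))
                 (σ' , p0 , subst HasOcc (sym (renA-imgA-! (Deeper.μ R) r p0)) (hasOcc-ren (Deeper.μ R) (HasOcc-img L (r ! p0) hr)))
      ... | σ1 , k' , σ2 , p' , hx , occ
          with he-trans (≡-he (sym (renA-! (Scope.κ L') sq k'))) (he-trans hx (≡-he (renA-imgA-! (Deeper.μ R) r p')))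
      ... | hx' with he-idx hx'
      ... | refl = img≢entry L (r ! p') (Deeper.μ R) (Deeper.μ-inj R) (Scope.κ L') (Deeper.κ-μ R) q eqq k' (sym (he-≡ hx')) entryOcc
          where
            entryOcc : HasOcc (sq ! k')
            entryOcc = [ (λ o1 → hasOcc-unren (Scope.κ L') (sq ! k') (subst HasOcc (renA-! (Scope.κ L') sq k') o1)) ,
                         (λ o2 → hasOcc-unren (Scope.κ L') (sq ! k')
                                   (subst HasOcc (sym (he-≡ hx')) (subst HasOcc (renA-imgA-! (Deeper.μ R) r p') o2))) ]′ occ

      reflect-exp-here : ∀ {Γ1' Γ2'} (L' : Scope Γ1' Γ2') (R : Deeper L L') {ρs τs b} {g : HeadF Γ1 ((ρs ++ τs) ⇒ b)} {r : ArgsF Γ1 ρs}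
                           {ρs'} {h : HeadF Γ2 ((ρs' ++ τs) ⇒ b)} {ts : ArgsF Γ2 ρs'} → ImgDecomp L g r h ts → FunArgsOcc g r →
                         ∀ {ρq σs} (q : Var Ys (σs ⇒ b)) (Hq : HeadF Base ((ρq ++ σs) ⇒ b)) (sq : ArgsF Base ρq) →
                         dec q ≡ decomp Hq sq → (as : ArgsF Γ1' σs) (rest : ArgsF Γ2' τs) →
                         hd (renH (Scope.κ L') Hq) (renA (Scope.κ L') sq ++A imgA (Scope.κ L') (Scope.θ L') as) ≡
                           hd (renH (Deeper.μ R) h) (renA (Deeper.μ R) ts ++A rest) →
                         MatchN g r (Deeper.ν R) (hd (var (Scope.ym L' q)) as)
      reflect-exp-here L' R (via-fun refl) go q (var x) sq eqq as rest eq = ⊥-elim (fun≢var (he-sym (proj₁ (hd-inj eq))))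
      reflect-exp-here L' R {r = r} (via-fun refl) go q (fun f') sq eqq as rest eq =
        ⊥-elim (reflect-exp-fun L' R r (go refl) q eqq (proj₂ (hd-inj eq)))
      reflect-exp-here L' R (via-ren refl ej) go q (fun f') sq eqq as rest eq = ⊥-elim (fun≢var (proj₁ (hd-inj eq)))
      reflect-exp-here L' R (via-ren {v = vj} {u = uj} refl ej) go q (var x) sq eqq as rest eq
        with θ-ren-free-HE L vj x ej (ren-inj-HE (Deeper.μ R) (Deeper.μ-inj R)
               (he-trans (≡-he (sym (Deeper.κ-μ R x))) (var-inj-HE (proj₁ (hd-inj eq)))))
      ... | y , refl = ⊥-elim (dec-closed q eqq y (inj₁ he))
      reflect-exp-here L' R {ρs} {τs} {r = r} (via-exp {v = vl} {ρH} {H = Hl} {sl} refl el) go q Hq sq eqq as rest eq with Scope.θ-exp-inv L vl el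
      ... | l , refl , eql with hd-inj eq
      ... | p , qa with index q ≟ index l
      ... | no ne = ⊥-elim (decomps-apart q l eqq eql ne (Scope.κ L') (κ-inj L') (he-trans p (expHead-deeper R {ρH} {ρs} {τs} Hl))
                              (he-trans qa (expArgs-deeper R sl (imgA κL θL r) rest)))
      ... | yes ei with index-inj-HE q l ei
      ... | qh with he-idx qh
      ... | refl with he-≡ qh
      ... | refl with decomp-inj (trans (sym eqq) eql)
      ... | hH , hs with he-idx hs
      ... | refl with he-≡ hH | he-≡ hs
      ... | refl | refl with imgA-prefix-inj L' as (renA (Deeper.ν R) r)
                               (imgArgs-deeper R r (++A-cancelˡ (renA (Scope.κ L') sq) (he-trans qa (expArgs-deeper R sq (imgA κL θL r) rest))))
      ... | R' , r' = mhere-HE (≡-he (cong var (Deeper.ym-ν R q))) r'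

      mutual
        reflectN : ∀ {Γ1' Γ2'} (L' : Scope Γ1' Γ2') (R : Deeper L L') {ρs τs b} {g : HeadF Γ1 ((ρs ++ τs) ⇒ b)} {r : ArgsF Γ1 ρs}
                     {ρs'} {h : HeadF Γ2 ((ρs' ++ τs) ⇒ b)} {ts : ArgsF Γ2 ρs'} → ImgDecomp L g r h ts → FunArgsOcc g r →
                   ∀ {a} (n : NfF Γ1' a) → MatchN h ts (Deeper.μ R) (imgN (Scope.κ L') (Scope.θ L') n) → MatchN g r (Deeper.ν R) n
        reflectN L' R ct go (hd (fun f) as) (marg i m) = marg i (reflectA L' R ct go as i m)
        reflectN L' R {r = r} (via-fun refl) go (hd (fun f) as) (mhere rest eq) with hd-inj eq
        ... | p , q with imgA-prefix-inj L' as (renA (Deeper.ν R) r) (imgArgs-deeper R r q)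
        ... | R' , r' = mhere-HE (fun-HE p) r'
        reflectN L' R (via-ren refl ev) go (hd (fun f) as) (mhere rest eq) = ⊥-elim (fun≢var (proj₁ (hd-inj eq)))
        reflectN L' R {ρs} {τs} {r = r} (via-exp {v = vj} {ρH} {H = H} {s} refl ev) go (hd (fun f) as) (mhere rest eq) with hd-inj eq
        ... | p , q = ⊥-elim (fun≢expImg L' f as (Deeper.ν R vj) H s (trans (Deeper.θ-ν R vj) (cong (renShallow (Deeper.μ R)) ev))
                                (he-trans p (expHead-deeper R {ρH} {ρs} {τs} H)) (he-trans q (expArgs-deeper R s (imgA κL θL r) rest)))
        reflectN L' R ct go (hd (var v) as) m with Scope.θ L' v in ev'
        ... | ren u = reflect-ren L' R ct go v u ev' as m
        ... | exp Hq sq with Scope.θ-exp-inv L' v ev'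
        ... | q , refl , eqq = reflect-exp L' R ct go q Hq sq eqq as m

        reflect-ren : ∀ {Γ1' Γ2'} (L' : Scope Γ1' Γ2') (R : Deeper L L') {ρs τs b} {g : HeadF Γ1 ((ρs ++ τs) ⇒ b)} {r : ArgsF Γ1 ρs}
                        {ρs'} {h : HeadF Γ2 ((ρs' ++ τs) ⇒ b)} {ts : ArgsF Γ2 ρs'} → ImgDecomp L g r h ts → FunArgsOcc g r →
                      ∀ {σs a} (v : Var Γ1' (σs ⇒ a)) (u : Var Γ2' (σs ⇒ a)) → Scope.θ L' v ≡ ren u → (as : ArgsF Γ1' σs) →
                      MatchN h ts (Deeper.μ R) (hd (var u) (imgA (Scope.κ L') (Scope.θ L') as)) → MatchN g r (Deeper.ν R) (hd (var v) as)
        reflect-ren L' R ct go v u ev' as (marg i m) = marg i (reflectA L' R ct go as i m)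
        reflect-ren L' R (via-fun refl) go v u ev' as (mhere rest eq) = ⊥-elim (fun≢var (he-sym (proj₁ (hd-inj eq))))
        reflect-ren L' R {r = r} (via-ren {v = vj} {u = uj} refl ej) go v u ev' as (mhere rest eq) with hd-inj eq
        ... | p , q with var-inj-HE p
        ... | p' with he-idx p'
        ... | refl with he-≡ p'
        ... | refl with Deeper.ren-reflect R v uj ev'
        ... | v0 , refl , e0 with Scope.θ-ren-inj L v0 vj e0 ej
        ... | refl with imgA-prefix-inj L' as (renA (Deeper.ν R) r) (imgArgs-deeper R r q)
        ... | R' , r' = mhere-HE he r'
        reflect-ren L' R {ρs} {τs} (via-exp {v = vj} {ρH} {H = H} {s} refl ej) go v u ev' as (mhere rest eq) =
          ⊥-elim (ren≢expHead L' v u ev' (Deeper.ν R vj) H s (trans (Deeper.θ-ν R vj) (cong (renShallow (Deeper.μ R)) ej))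
                    (he-trans (proj₁ (hd-inj eq)) (expHead-deeper R {ρH} {ρs} {τs} H)))

        reflect-exp : ∀ {Γ1' Γ2'} (L' : Scope Γ1' Γ2') (R : Deeper L L') {ρs τs b} {g : HeadF Γ1 ((ρs ++ τs) ⇒ b)} {r : ArgsF Γ1 ρs}
                        {ρs'} {h : HeadF Γ2 ((ρs' ++ τs) ⇒ b)} {ts : ArgsF Γ2 ρs'} → ImgDecomp L g r h ts → FunArgsOcc g r →
                      ∀ {ρq σs a} (q : Var Ys (σs ⇒ a)) (Hq : HeadF Base ((ρq ++ σs) ⇒ a)) (sq : ArgsF Base ρq) →
                      dec q ≡ decomp Hq sq → (as : ArgsF Γ1' σs) →
                      MatchN h ts (Deeper.μ R) (hd (renH (Scope.κ L') Hq) (renA (Scope.κ L') sq ++A imgA (Scope.κ L') (Scope.θ L') as)) →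
                      MatchN g r (Deeper.ν R) (hd (var (Scope.ym L' q)) as)
        reflect-exp L' R ct go {ρq} q Hq sq eqq as (marg i m) with binderView {Γ = _} ρq i
        ... | outer k =
          marg k (reflectA L' R ct go as k
                    (subst (MatchT _ _ (Deeper.μ R)) (++A-!-wkV (renA (Scope.κ L') sq) (imgA (Scope.κ L') (Scope.θ L') as) k) m))
        ... | binder k =
          ⊥-elim (entry-noImgMatch L' R ct go q eqq k
                    (subst (MatchT _ _ (Deeper.μ R))
                       (trans (++A-!-bvar (renA (Scope.κ L') sq) (imgA (Scope.κ L') (Scope.θ L') as) k) (renA-! (Scope.κ L') sq k)) m))
        reflect-exp L' R ct go q Hq sq eqq as (mhere rest eq) = reflect-exp-here L' R ct go q Hq sq eqq as rest eq

        reflectA : ∀ {Γ1' Γ2'} (L' : Scope Γ1' Γ2') (R : Deeper L L') {ρs τs b} {g : HeadF Γ1 ((ρs ++ τs) ⇒ b)} {r : ArgsF Γ1 ρs}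
                     {ρs'} {h : HeadF Γ2 ((ρs' ++ τs) ⇒ b)} {ts : ArgsF Γ2 ρs'} → ImgDecomp L g r h ts → FunArgsOcc g r →
                   ∀ {M σ} (as : ArgsF Γ1' M) (i : Var M σ) → MatchT h ts (Deeper.μ R) (imgA (Scope.κ L') (Scope.θ L') as ! i) →
                   MatchT g r (Deeper.ν R) (as ! i)
        reflectA L' R ct go (a ∷ as) here m = reflectT L' R ct go a m
        reflectA L' R ct go (a ∷ as) (there i) m = reflectA L' R ct go as i m

        reflectT : ∀ {Γ1' Γ2'} (L' : Scope Γ1' Γ2') (R : Deeper L L') {ρs τs b} {g : HeadF Γ1 ((ρs ++ τs) ⇒ b)} {r : ArgsF Γ1 ρs}
                     {ρs'} {h : HeadF Γ2 ((ρs' ++ τs) ⇒ b)} {ts : ArgsF Γ2 ρs'} → ImgDecomp L g r h ts → FunArgsOcc g r →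
                   ∀ {σ} (t : TmF Γ1' σ) → MatchT h ts (Deeper.μ R) (imgT (Scope.κ L') (Scope.θ L') t) → MatchT g r (Deeper.ν R) t
        reflectT L' R ct go (lam {σs} w) (mlam m) = mlam (reflectN (liftScope σs L') (deeper-lift σs R) ct go w m)

    MatchT-cast : ∀ {D0 Δ ρs0 τs0 b0 ρs1 τs1 b1 σ} {h0 : HeadF D0 ((ρs0 ++ τs0) ⇒ b0)} {ts0 : ArgsF D0 ρs0}
                    {h1 : HeadF D0 ((ρs1 ++ τs1) ⇒ b1)} {ts1 : ArgsF D0 ρs1} {κ : Rn D0 Δ} {t : TmF Δ σ} →
                  MatchT h0 ts0 κ t → HE (HeadF D0) h0 h1 → HE (ArgsF D0) ts0 ts1 → MatchT h1 ts1 κ t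
    MatchT-cast {ρs0 = ρs0} {τs0} {τs1 = τs1} m hh hts with he-idx hts
    ... | refl with ++-cancelˡ ρs0 τs0 τs1 (⇒-injˡ (he-idx hh)) | ⇒-injʳ (he-idx hh)
    ... | refl | refl with he-≡ hh | he-≡ hts
    ... | refl | refl = m

    ImgExpansion⇒ImgDecomp : ∀ {Γ1 Γ2} (L : Scope Γ1 Γ2) {ρs τs b} {g : HeadF Γ1 ((ρs ++ τs) ⇒ b)} {r : ArgsF Γ1 ρs}
                               {ρs'} {h : HeadF Γ2 ((ρs' ++ τs) ⇒ b)} {ts : ArgsF Γ2 ρs'} → ImgExpansion (Scope.κ L) (Scope.θ L) g r h ts →
                             Σ (Ctx S) λ ρs1 → Σ (HeadF Γ2 ((ρs1 ++ τs) ⇒ b)) λ h1 → Σ (ArgsF Γ2 ρs1) λ ts1 →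
                               ImgDecomp L g r h1 ts1 × HE (HeadF Γ2) h h1 × HE (ArgsF Γ2) ts ts1
    ImgExpansion⇒ImgDecomp L (via-fun eg hh hts) = _ , _ , _ , via-fun eg , hh , hts
    ImgExpansion⇒ImgDecomp L (via-ren eg ev hh hts) = _ , _ , _ , via-ren eg ev , hh , hts
    ImgExpansion⇒ImgDecomp L {ρs} {τs} (via-exp {ρH = ρH} {H = H} eg ev hh hts) =
      _ , _ , _ , via-exp eg ev , he-trans hh (he-sym (subst-HE (sym (++-assoc ρH ρs τs)) (renH (Scope.κ L) H))) , hts

    img-noEmb : ∀ {Γ1 Γ2} (L : Scope Γ1 Γ2) {M} (as : ArgsF Γ1 M) → DHPVarArgs (under Ys (Scope.e1 L)) as →
                ∀ {σ τ} (i : Var M σ) (j : Var M τ) → index i ≢ index j →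
                ¬ (imgT (Scope.κ L) (Scope.θ L) (as ! i) ⊵E imgT (Scope.κ L) (Scope.θ L) (as ! j))
    img-noEmb L as D1 {τ = τs ⇒ b} i j ne (ρs' , h , ts , ea , Δ' , e , rest , sub)
      with DHPVarArgs.expanded D1 j
    ... | ρs , g , r , eqj
      with ImgExpansion⇒ImgDecomp L (imgExpansion (Scope.κ L) (Scope.θ L) g r h ts (trans (cong (imgT (Scope.κ L) (Scope.θ L)) (sym eqj)) ea))
    ... | ρs1 , h1 , ts1 , ct , hh , hts
      with MatchT⇒SubT (Reflect.reflectT L L (deeper-refl L) ct argsOcc (as ! i)
                     (MatchT-cast (SubT⇒MatchT sub (λ x → x) rest refl) hh hts))
      where
        argsOcc : FunArgsOcc g r
        argsOcc {f} refl with DHPVarArgs.fv-nonempty D1 j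
        ... | ρ , x , o with OccT⇒OccDecomp (fun f) r (subst (OccT x) eqj o)
        ... | inj₁ q = ⊥-elim (fun≢var q)
        ... | inj₂ (σ , p , o') = σ , p , (ρ , x , o')
    ... | Δ'' , e' , rest' , sub' = DHPVarArgs.no-emb D1 i j ne (ρs , g , r , eqj , Δ'' , e' , rest' , sub')

    imgA-DHPVarArgs : ∀ {Γ1 Γ2} (L : Scope Γ1 Γ2) {M} (as : ArgsF Γ1 M) → DHPVarArgs (under Ys (Scope.e1 L)) as →
                      DHPVarArgs (under Xs (Scope.e2 L)) (imgA (Scope.κ L) (Scope.θ L) as)
    imgA-DHPVarArgs L as D1 = record
      { fv-nonempty = λ i → subst HasOcc (sym (imgA-! κ θ as i)) (HasOcc-img L (as ! i) (DHPVarArgs.fv-nonempty D1 i))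
      ; fv-bound = fv-bound′
      ; expanded = expanded′
      ; no-emb = λ i j ne hyp → img-noEmb L as D1 i j ne
                   (subst₂ _⊵E_ (imgA-! κ θ as i) (imgA-! κ θ as j) hyp) }
      where
        open Scope L
        fv-bound′ : ∀ {σ} (i : Var _ σ) {ρ} (y : Var Γ ρ) → ¬ OccT (inj (under Xs e2) y) (imgA κ θ as ! i)
        fv-bound′ i y o with occT-img-source κ θ (as ! i) (subst (OccT _) (imgA-! κ θ as i) o)
        ... | src-ren v ev ov with θ-ren-inj v (inj e1 (wkV Ys y)) ev (θ-free y)
        ... | refl = DHPVarArgs.fv-bound D1 i y ov
        fv-bound′ i y o | src-exp v H s x ev ov ek od with inj-inj e2 (trans (sym (κ≡inj x)) ek)
        ... | refl with θ-exp-inv v ev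
        ... | m , _ , em = dec-closed m em y od
        expanded′ : ∀ {σ} (i : Var _ σ) → Expanded (imgA κ θ as ! i)
        expanded′ {τs ⇒ b} i with DHPVarArgs.expanded D1 i
        ... | ρs , g , r , eqi = subst Expanded (sym (trans (imgA-! κ θ as i) (cong (imgT κ θ) eqi))) (imgT-Expanded κ θ g r)

    VarArgsAt-ren : ∀ {Γ1 Γ2} (L : Scope Γ1 Γ2) {M a} (v : Var Γ1 (M ⇒ a)) (u : Var Γ2 (M ⇒ a)) → Scope.θ L v ≡ ren u →
                    (as : ArgsF Γ1 M) → VarArgsAt (under Ys (Scope.e1 L)) (hd (var v) as) →
                    VarArgsAt (under Xs (Scope.e2 L)) (hd (var u) (imgA (Scope.κ L) (Scope.θ L) as))
    VarArgsAt-ren L v u ev as p y ts eq with hd-inj eq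
    ... | p1 , p2 with he-idx p2
    ... | refl with he-≡ p2 | he-≡ (var-inj-HE p1)
    ... | refl | refl with Scope.θ-ren-inj L v (inj (Scope.e1 L) (wkV Ys y)) ev (Scope.θ-free L y)
    ... | refl = imgA-DHPVarArgs L as (p y as refl)

    var-cong-HE : ∀ {Δ σ1 σ2} {x : Var Δ σ1} {y : Var Δ σ2} → HE (Var Δ) x y → HE (HeadF Δ) (var x) (var y)
    var-cong-HE he = he

    VarArgsAt-exp : ∀ {Γ1 Γ2} (L : Scope Γ1 Γ2) {ρs M a} (v : Var Γ1 (M ⇒ a)) (H : HeadF Base ((ρs ++ M) ⇒ a)) (s : ArgsF Base ρs) →
                    Scope.θ L v ≡ exp H s → (as : ArgsF Γ1 M) →
                    VarArgsAt (under Xs (Scope.e2 L)) (hd (renH (Scope.κ L) H) (renA (Scope.κ L) s ++A imgA (Scope.κ L) (Scope.θ L) as))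
    VarArgsAt-exp L v (fun f) s ev as y ts eq = ⊥-elim (fun≢var (proj₁ (hd-inj eq)))
    VarArgsAt-exp L v (var x) s ev as y ts eq with Scope.θ-exp-inv L v ev
    ... | m , _ , em =
      ⊥-elim (dec-closed m em y (inj₁ (var-cong-HE (ren-inj-HE (inj (Scope.e2 L)) (inj-inj (Scope.e2 L))
                                    (he-trans (≡-he (sym (Scope.κ≡inj L x))) (var-inj-HE (proj₁ (hd-inj eq))))))))

    DHPA-dec : ∀ {Γ1 Γ2} (L : Scope Γ1 Γ2) {ρs τs b} (m : Var Ys (τs ⇒ b)) {H : HeadF Base ((ρs ++ τs) ⇒ b)} {s : ArgsF Base ρs} →
               dec m ≡ decomp H s → DHPA (under Xs (Scope.e2 L)) (renA (Scope.κ L) s)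
    DHPA-dec L m {H} {s} em =
      DHPA-intro (renA (Scope.κ L) s) (λ k → subst (DHPT _) (sym (renA-! (Scope.κ L) s k))
        (closed-DHPT (under Xs (Scope.e2 L)) (renT (Scope.κ L) (s ! k)) (λ y o → closed k y o)))
      where
        closed : ∀ {σ ρ} (k : Var _ σ) (y : Var Γ ρ) → ¬ OccT (inj (Scope.e2 L) (wkV Xs y)) (renT (Scope.κ L) (s ! k))
        closed k y o with occT-unren (Scope.κ L) (s ! k) o
        ... | x , exx , ox with inj-inj (Scope.e2 L) (trans (sym (Scope.κ≡inj L x)) exx)
        ... | refl = dec-closed m em y (inj₂ (_ , k , ox))

    mutual
      imgN-DHPN : ∀ {Γ1 Γ2 a} (L : Scope Γ1 Γ2) (n : NfF Γ1 a) → DHPN (under Ys (Scope.e1 L)) n →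
                  DHPN (under Xs (Scope.e2 L)) (imgN (Scope.κ L) (Scope.θ L) n)
      imgN-DHPN L (hd (fun f) as) (p , pa) = (λ y ts eq → ⊥-elim (fun≢var (proj₁ (hd-inj eq)))) , imgA-DHPA L as pa
      imgN-DHPN L (hd (var v) as) (p , pa) with Scope.θ L v in ev
      ... | ren u = VarArgsAt-ren L v u ev as p , imgA-DHPA L as pa
      ... | exp H s with Scope.θ-exp-inv L v ev
      ... | m , _ , em = VarArgsAt-exp L v H s ev as , DHPA-++ (renA (Scope.κ L) s) (DHPA-dec L m em) (imgA-DHPA L as pa)

      imgA-DHPA : ∀ {Γ1 Γ2 M} (L : Scope Γ1 Γ2) (as : ArgsF Γ1 M) → DHPA (under Ys (Scope.e1 L)) as →
                  DHPA (under Xs (Scope.e2 L)) (imgA (Scope.κ L) (Scope.θ L) as)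
      imgA-DHPA L [] _ = tt
      imgA-DHPA L (t ∷ ts) (a , pa) = imgT-DHPT L t a , imgA-DHPA L ts pa

      imgT-DHPT : ∀ {Γ1 Γ2 σ} (L : Scope Γ1 Γ2) (t : TmF Γ1 σ) → DHPT (under Ys (Scope.e1 L)) t →
                  DHPT (under Xs (Scope.e2 L)) (imgT (Scope.κ L) (Scope.θ L) t)
      imgT-DHPT L (lam {σs} w) a = imgN-DHPN (liftScope σs L) w a

lemma12 : {S : Set} (F : Ty S → Set) {Γ : Ctx S} (Ys Xs : Ctx S) {ρs : Ctx S} {a : S}
    (h : Head {F = F} (Ys ++ Γ) (ρs ⇒ a)) (us : Args (Ys ++ Γ) ρs)
    (ss : Args {F = F} (Xs ++ Γ) Ys) →
    DHP (lam {σs = Ys} (hd h us)) →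
    DHPVarArgs (under Xs stop) ss →
    DHP (substBody Ys Xs (hd h us) ss)
lemma12 F Ys Xs h us ss dhp D =
  subst DHP (sym (substBody≡imgN Ys Xs (hd h us) ss D))
    (DHPT⇒DHP (lam (imgN (λ x → x) θ₀ (hd h us))) (imgN-DHPN scope₀ (hd h us) (DHP⇒DHPT (lam (hd h us)) dhp)))
  where open SubstDHP {F = F} Ys Xs ss D
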